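{- Let $\widetilde{\mathcal Q}$ be an extended quiver with even vertices $x_1,\ldots,x_n$ and odd vertices $\xi_1,\ldots,\xi_m$, and associate to it the differential 2-form $$\omega_{\widetilde{\mathcal Q}}=\sum_{x_i\to x_j}\frac{dx_i\wedge dx_j}{x_ix_j}+\sum_{\xi_i\to x_\ell\to\xi_j}\frac{d(\xi_i\xi_j)\wedge dx_\ell}{x_\ell},$$ where the first sum runs over the arrows of the underlying quiver and the second over the 2-paths of $\widetilde{\mathcal Q}$ (both with multiplicity). Then for every even vertex $x_k$, $\omega$ is invariant under the mutation $\widetilde\mu_k$ combined with the exchange relation: expressing $x_k$ in terms of $x_k'$ and the other variables via the exchange relation and substituting into $\omega_{\widetilde{\mathcal Q}}$, one obtains exactly the form $\omega_{\widetilde\mu_k(\widetilde{\mathcal Q})}$ written in the variables $x_1,\ldots,x_{k-1},x_k',x_{k+1},\ldots,x_n,\xi_1,\ldots,\xi_m$.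
   Context: Grassmann variables $\xi_1,\ldots,\xi_m$ are odd: they anticommute pairwise ($\xi_i\xi_j=-\xi_j\xi_i$, in particular $\xi_i^2=0$) and commute with the even variables $x_1,\ldots,x_n$; differential forms are taken in the corresponding supercommutative sense. Extended quiver: $\widetilde{\mathcal Q}$ consists of (A) an ordinary quiver $\mathcal Q$ (finite, no loops, no oriented 2-cycles, arrows counted with multiplicity) with vertices labeled by even variables $x_1,\ldots,x_n$; (B) $m$ additional odd vertices labeled $\xi_1,\ldots,\xi_m$; (C) a finite multiset of oriented 2-paths $(\xi_i\to x_k\to\xi_j)$, $i\ne j$, through even vertices, with no even vertex carrying both a 2-path $\xi_i\to x_k\to\xi_j$ and the opposite one $\xi_j\to x_k\to\xi_i$. Mutation $\widetilde\mu_k$ at an even vertex $x_k$: (0) the underlying quiver $\mathcal Q$ undergoes the usual Fomin–Zelevinsky quiver mutation at $x_k$; (1*) for every 2-path $(\xi_i\to x_k\to\xi_j)$ and every arrow $x_k\to x_\ell$ (with multiplicity), add a 2-path $(\xi_i\to x_\ell\to\xi_j)$; (2*) reverse every 2-path through $x_k$, $(\xi_i\to x_k\to\xi_j)$ becoming $(\xi_j\to x_k\to\xi_i)$; (3*) cancel two by two pairs of opposite 2-paths $(\xi_i\to x_\ell\to\xi_j)$, $(\xi_j\to x_\ell\to\xi_i)$ through the same even vertex. Exchange relation: $\widetilde\mu_k$ replaces $x_k$ by $x_k'$ (other variables unchanged) with $$x_kx_k'=\prod_{x_k\to x_\ell}x_\ell+\prod_{\xi_i\to x_k\to\xi_j}(1+\xi_i\xi_j)\prod_{x_\ell\to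 x_k}x_\ell,$$ products over arrows and 2-paths of $\widetilde{\mathcal Q}$ with multiplicity. -}

module Defs where

open import Data.Nat as ℕ using (ℕ; zero; suc; _∸_)
open import Data.Integer as ℤ using (ℤ; +_; -_)
open import Data.Fin using (Fin; zero; suc; _↑ˡ_; _↑ʳ_)
import Data.Fin as Fin
open import Data.Bool using (Bool; true; false; if_then_else_; _∨_)
import Data.Bool as Bool
open import Data.Vec as Vec using (Vec; []; _∷_; lookup; updateAt)
import Data.Vec.Properties as VecP
open import Data.List as List using (List; []; _∷_; _++_; concatMap)
open import Data.Maybe using (Maybe; just; nothing)
open import Data.Product using (_×_; _,_)
open import Data.Sum using (_⊎_)
open import Relation.Binary.PropositionalEquality using (_≡_)
open import Relation.Nullary.Decidable using (⌊_⌋; _×-dec_)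

-- Sign convention (Bernstein–Leites, single total parity): the algebra of
-- polynomial differential forms is the free supercommutative ℤ-algebra on
--   x i   (even),  ξ a  (odd),  dx i  (odd),  dξ a  (even),
-- the wedge product is the product of this algebra, and d is the odd
-- derivation with d(x i) = dx i, d(ξ a) = dξ a, d(dx i) = d(dξ a) = 0.

data Gen (n m : ℕ) : Set where
  x  : Fin n → Gen n m
  ξ  : Fin m → Gen n m
  dx : Fin n → Gen n m
  dξ : Fin m → Gen n m

Word : ℕ → ℕ → Set
Word n m = List (Gen n m)

isOdd : ∀ {n m} → Gen n m → Bool
isOdd (x _)  = false
isOdd (ξ _)  = true
isOdd (dx _) = true
isOdd (dξ _) = false

-- Normal monomials: exponents of the even generators (x's, then dξ's) and
-- the set of odd generators present (ξ's, then dx's), odd ones written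
-- in increasing order.
record NMon (n m : ℕ) : Set where
  constructor nmon
  field
    evens : Vec ℕ (n ℕ.+ m)
    odds  : Vec Bool (m ℕ.+ n)

data Kind (n m : ℕ) : Set where
  evenG : Fin (n ℕ.+ m) → Kind n m
  oddG  : Fin (m ℕ.+ n) → Kind n m

kind : ∀ {n m} → Gen n m → Kind n m
kind {n} {m} (x i)  = evenG (i ↑ˡ m)
kind {n} {m} (dξ a) = evenG (n ↑ʳ a)
kind {n} {m} (ξ a)  = oddG (a ↑ˡ n)
kind {n} {m} (dx i) = oddG (m ↑ʳ i)

trues : ∀ {k} → Vec Bool k → ℕ
trues []       = 0
trues (b ∷ v)  = (if b then 1 else 0) ℕ.+ trues v

countAbove : ∀ {k} → Vec Bool k → Fin k → ℕ
countAbove (_ ∷ v) zero    = trues v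
countAbove (_ ∷ v) (suc o) = countAbove v o

negPow : ℕ → ℤ
negPow zero    = ℤ.+ 1
negPow (suc c) = - negPow c

mulGen : ∀ {n m} → ℤ × NMon n m → Gen n m → ℤ × NMon n m
mulGen (s , nmon ev od) g with kind g
... | evenG e = s , nmon (updateAt ev e suc) od
... | oddG o  = if lookup od o
                then (+ 0 , nmon ev od)
                else (s ℤ.* negPow (countAbove od o) , nmon ev (updateAt od o (λ _ → true)))

unitMon : ∀ {n m} → NMon n m
unitMon {n} {m} = nmon (Vec.replicate (n ℕ.+ m) 0) (Vec.replicate (m ℕ.+ n) false)

normWord : ∀ {n m} → Word n m → ℤ × NMon n m
normWord w = List.foldl mulGen (+ 1 , unitMon) w

eqMon : ∀ {n m} → NMon n m → NMon n m → Bool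
eqMon (nmon e o) (nmon e' o') =
  ⌊ VecP.≡-dec ℕ._≟_ e e' ×-dec VecP.≡-dec Bool._≟_ o o' ⌋

coeffWord : ∀ {n m} → Word n m → NMon n m → ℤ
coeffWord w M with normWord w
... | s , M' = if eqMon M' M then s else + 0

-- Super polynomial differential forms: formal ℤ-linear combinations of words
SP : ℕ → ℕ → Set
SP n m = List (ℤ × Word n m)

coeff : ∀ {n m} → SP n m → NMon n m → ℤ
coeff []            M = + 0
coeff ((c , w) ∷ p) M = c ℤ.* coeffWord w M ℤ.+ coeff p M

-- equality in the free supercommutative algebra: same coefficients
_≈SP_ : ∀ {n m} → SP n m → SP n m → Set
p ≈SP q = ∀ M → coeff p M ≡ coeff q M

_+SP_ : ∀ {n m} → SP n m → SP n m → SP n m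
p +SP q = p ++ q

scaleSP : ∀ {n m} → ℤ → SP n m → SP n m
scaleSP k p = List.map (λ { (c , w) → (k ℤ.* c , w) }) p

-SP_ : ∀ {n m} → SP n m → SP n m
-SP p = scaleSP (- (+ 1)) p

_*SP_ : ∀ {n m} → SP n m → SP n m → SP n m
p *SP q = concatMap (λ { (c , w) → List.map (λ { (c' , w') → (c ℤ.* c' , w ++ w') }) q }) p

constSP : ∀ {n m} → ℤ → SP n m
constSP c = (c , []) ∷ []

genSP : ∀ {n m} → Gen n m → SP n m
genSP g = (+ 1 , g ∷ []) ∷ []

parSign : ∀ {n m} → Word n m → ℤ
parSign []      = + 1
parSign (g ∷ w) = (if isOdd g then - (+ 1) else + 1) ℤ.* parSign w

flipSP : ∀ {n m} → SP n m → SP n m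
flipSP p = List.map (λ { (c , w) → (parSign w ℤ.* c , w) }) p

dGen : ∀ {n m} → Gen n m → Maybe (Gen n m)
dGen (x i)  = just (dx i)
dGen (ξ a)  = just (dξ a)
dGen (dx _) = nothing
dGen (dξ _) = nothing

dWord : ∀ {n m} → Word n m → SP n m
dWord []      = []
dWord (g ∷ w) = head ++ List.map (λ { (c , w') → (sg ℤ.* c , g ∷ w') }) (dWord w)
  where
  sg = if isOdd g then - (+ 1) else + 1
  head = case′ (dGen g)
    where
    case′ : _ → SP _ _
    case′ (just h) = (+ 1 , h ∷ w) ∷ []
    case′ nothing  = []

dSP : ∀ {n m} → SP n m → SP n m
dSP p = concatMap (λ { (c , w) → scaleSP c (dWord w) }) p

-- A fraction num / den has an even, form-degree-0 (hence central)
-- denominator; all denominators occurring below are non-zero-divisors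
-- (their body is a nonzero polynomial in the x's), so cross-multiplication
-- is the equality of the localisation.

record Frac (n m : ℕ) : Set where
  constructor _/_
  field
    num : SP n m
    den : SP n m

open Frac public

_≈F_ : ∀ {n m} → Frac n m → Frac n m → Set
u ≈F v = (num u *SP den v) ≈SP (num v *SP den u)

_+F_ : ∀ {n m} → Frac n m → Frac n m → Frac n m
(a / b) +F (c / e) = ((a *SP e) +SP (c *SP b)) / (b *SP e)

_*F_ : ∀ {n m} → Frac n m → Frac n m → Frac n m
(a / b) *F (c / e) = (a *SP c) / (b *SP e)

dF : ∀ {n m} → Frac n m → Frac n m
dF (a / b) = ((dSP a *SP b) +SP (-SP (flipSP a *SP dSP b))) / (b *SP b)

-- inverse (used only on even degree-0 elements with invertible body)
invF : ∀ {n m} → Frac n m → Frac n m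
invF (a / b) = b / a

natF : ∀ {n m} → ℕ → Frac n m
natF k = constSP (+ k) / constSP (+ 1)

spF : ∀ {n m} → SP n m → Frac n m
spF p = p / constSP (+ 1)

sumFin : ∀ {k n m} → (Fin k → Frac n m) → Frac n m
sumFin {zero}  f = natF 0
sumFin {suc k} f = f zero +F sumFin (λ i → f (suc i))

prodFinSP : ∀ {k n m} → (Fin k → SP n m) → SP n m
prodFinSP {zero}  f = constSP (+ 1)
prodFinSP {suc k} f = f zero *SP prodFinSP (λ i → f (suc i))

powSP : ∀ {n m} → SP n m → ℕ → SP n m
powSP p zero    = constSP (+ 1)
powSP p (suc e) = p *SP powSP p e

-- B i j = number of arrows x_i → x_j ;
-- T a ℓ b = number of 2-paths ξ_a → x_ℓ → ξ_b
record QData (n m : ℕ) : Set where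
  constructor qdata
  field
    B : Fin n → Fin n → ℕ
    T : Fin m → Fin n → Fin m → ℕ

record ExtQuiver (n m : ℕ) : Set where
  field
    quiver      : QData n m
  open QData quiver
  field
    noLoop      : ∀ i → B i i ≡ 0
    no2cycle    : ∀ i j → B i j ≡ 0 ⊎ B j i ≡ 0
    pathDistinct : ∀ a ℓ → T a ℓ a ≡ 0
    noOpposite  : ∀ a ℓ b → T a ℓ b ≡ 0 ⊎ T b ℓ a ≡ 0

_==_ : ∀ {k} → Fin k → Fin k → Bool
i == j = ⌊ i Fin.≟ j ⌋

mutate : ∀ {n m} → QData n m → Fin n → QData n m
mutate {n} {m} (qdata B T) k = qdata B' T'
  where
  B' : Fin n → Fin n → ℕ
  B' i j = if (i == k) ∨ (j == k)
           then B j i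
           else (B i j ℕ.+ B i k ℕ.* B k j) ∸ (B j i ℕ.+ B j k ℕ.* B k i)
  T' : Fin m → Fin n → Fin m → ℕ
  T' a ℓ b = if ℓ == k
             then T b k a
             else (T a ℓ b ℕ.+ T a k b ℕ.* B k ℓ) ∸ (T b ℓ a ℕ.+ T b k a ℕ.* B k ℓ)

exchangeRHS : ∀ {n m} → QData n m → Fin n → SP n m
exchangeRHS (qdata B T) k =
  prodFinSP (λ ℓ → powSP (genSP (x ℓ)) (B k ℓ))
  +SP
  (prodFinSP (λ a → prodFinSP (λ b →
      powSP (constSP (+ 1) +SP (genSP (ξ a) *SP genSP (ξ b))) (T a k b)))
   *SP prodFinSP (λ ℓ → powSP (genSP (x ℓ)) (B ℓ k)))

omegaAt : ∀ {n m} → QData n m → (Fin n → Frac n m) → (Fin m → Frac n m) → Frac n m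
omegaAt (qdata B T) X Ξ =
  sumFin (λ i → sumFin (λ j →
    natF (B i j) *F ((dF (X i) *F dF (X j)) *F invF (X i *F X j))))
  +F
  sumFin (λ a → sumFin (λ ℓ → sumFin (λ b →
    natF (T a ℓ b) *F ((dF (Ξ a *F Ξ b) *F dF (X ℓ)) *F invF (X ℓ)))))

varX : ∀ {n m} → Fin n → Frac n m
varX i = spF (genSP (x i))

varΞ : ∀ {n m} → Fin m → Frac n m
varΞ a = spF (genSP (ξ a))

omega : ∀ {n m} → QData n m → Frac n m
omega Q = omegaAt Q varX varΞ

-- substitution x_k ↦ (exchange RHS) / x_k', where the new coordinate x_k'
-- occupies slot k (all other coordinates unchanged)
exchangeSubst : ∀ {n m} → QData n m → Fin n → Fin n → Frac n m
exchangeSubst Q k i = if i == k then (exchangeRHS Q k / genSP (x k)) else varX i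

omegaSubst : ∀ {n m} → QData n m → Fin n → Frac n m
omegaSubst Q k = omegaAt Q (exchangeSubst Q k) varΞ

module Submission where

-- Part 2 (module Exchange): with D = x_1⋯x_n and Δ = D², both ω_{μ_k Q} and the
-- substituted ω_Q reduce to W/Δ, where W is a combination of antisymmetric
-- forms; the terms over R·Δ (R the exchange polynomial) are divisible by R by
-- the logarithmic derivative of R.  The two numerators agree because their
-- antisymmetrised coefficients do, which is the mutation rule.

open import Defs
open import Data.Nat as ℕ using (ℕ; zero; suc; pred)
import Data.Nat.Properties as ℕP
open import Data.Integer as ℤ using (ℤ; +_; -_; _+_; _*_; _-_)
import Data.Integer.Properties as ℤP
open import Data.Integer.Tactic.RingSolver using (solve-∀)
open import Data.Fin as Fin using (Fin; zero; suc; #_)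
open import Data.Bool as Bool using (Bool; true; false; if_then_else_; _∨_)
open import Data.Vec as Vec using (Vec; []; _∷_; lookup; updateAt)
open import Data.Vec using () renaming (_∷_ to _∷v_; [] to []v)
import Data.Vec.Properties as VP
open import Data.List as List using (List; []; _∷_; _++_)
import Data.List.Properties as LP
import Data.Bool.Properties as BoolP
open import Data.Product using (_×_; _,_; proj₁; proj₂; Σ)
open import Data.Sum using (_⊎_; inj₁; inj₂)
open import Data.Unit using (⊤; tt)
open import Data.Empty using (⊥; ⊥-elim)
open import Relation.Binary.PropositionalEquality
open import Relation.Nullary using (yes; no; ¬_)
open import Function using (_∘_)

true≢false : true ≢ false
true≢false ()

CoeffFn : ℕ → ℕ → Set
CoeffFn n m = NMon n m → ℤ

ifPos : ℕ → ℤ → ℤ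
ifPos zero _ = + 0
ifPos (suc _) z = z

clear : Bool → Bool
clear _ = false

-- Division by a generator: if f is the coefficient function of p, then
-- divGen (kind g) f is the coefficient function of p·g (coeffWord-snoc).
divGen : ∀ {n m} → Kind n m → CoeffFn n m → CoeffFn n m
divGen (evenG e) f (nmon ev od) = ifPos (lookup ev e) (f (nmon (updateAt ev e pred) od))
divGen (oddG o) f (nmon ev od) =
  if lookup od o then negPow (countAbove od o) ℤ.* f (nmon ev (updateAt od o clear)) else + 0

divWord : ∀ {n m} → Word n m → CoeffFn n m → CoeffFn n m
divWord [] f = f
divWord (g ∷ w) f = divWord w (divGen (kind g) f)

signedCoeff : ∀ {n m} → ℤ × NMon n m → CoeffFn n m
signedCoeff (s , M') M = if eqMon M' M then s else + 0

module _ {n m : ℕ} where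
  eqMon-sound : {A B : NMon n m} → eqMon A B ≡ true → A ≡ B
  eqMon-sound {nmon e o} {nmon e' o'} eq with VP.≡-dec ℕ._≟_ e e' | VP.≡-dec Bool._≟_ o o'
  eqMon-sound _ | yes refl | yes refl = refl
  eqMon-sound () | yes _ | no _
  eqMon-sound () | no _ | yes _
  eqMon-sound () | no _ | no _

  eqMon-refl : (A : NMon n m) → eqMon A A ≡ true
  eqMon-refl (nmon e o) with VP.≡-dec ℕ._≟_ e e | VP.≡-dec Bool._≟_ o o
  ... | yes _ | yes _ = refl
  ... | no ¬p | _ = ⊥-elim (¬p refl)
  ... | yes _ | no ¬p = ⊥-elim (¬p refl)

  eqMon-false : {A B : NMon n m} → ¬ A ≡ B → eqMon A B ≡ false
  eqMon-false {A} {B} ne with eqMon A B in eq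
  ... | true = ⊥-elim (ne (eqMon-sound eq))
  ... | false = refl

  eqMon-iff : {A B C D : NMon n m} → (A ≡ B → C ≡ D) → (C ≡ D → A ≡ B) → eqMon A B ≡ eqMon C D
  eqMon-iff {A} {B} {C} {D} f g with eqMon A B in e1 | eqMon C D in e2
  ... | true | true = refl
  ... | false | false = refl
  ... | true | false = ⊥-elim (true≢false (trans (sym (eqMon-refl C)) (subst (λ z → eqMon C z ≡ false) (sym (f (eqMon-sound e1))) e2)))
  ... | false | true = ⊥-elim (true≢false (trans (sym (eqMon-refl A)) (subst (λ z → eqMon A z ≡ false) (sym (g (eqMon-sound e2))) e1)))

module _ {A : Set} where
  upd-lookup : ∀ {k} (v : Vec A k) i (f : A → A) → lookup (updateAt v i f) i ≡ f (lookup v i)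
  upd-lookup v i f = VP.lookup∘updateAt i v

  upd-lookup′ : ∀ {k} (v : Vec A k) i j (f : A → A) → ¬ i ≡ j → lookup (updateAt v j f) i ≡ lookup v i
  upd-lookup′ v i j f i≢j = VP.lookup∘updateAt′ i j i≢j v

  upd-upd : ∀ {k} (v : Vec A k) i (f g : A → A) → updateAt (updateAt v i g) i f ≡ updateAt v i (f ∘ g)
  upd-upd v i f g = VP.updateAt-updateAt i v

  upd-id : ∀ {k} (v : Vec A k) i (f : A → A) → f (lookup v i) ≡ lookup v i → updateAt v i f ≡ v
  upd-id v i f eq = VP.updateAt-id-local i v eq

  upd-comm : ∀ {k} (v : Vec A k) i j (f g : A → A) → ¬ i ≡ j →
             updateAt (updateAt v i f) j g ≡ updateAt (updateAt v j g) i f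
  upd-comm v i j f g i≢j = VP.updateAt-commutes j i (λ e → i≢j (sym e)) v

-- The sign of an odd slot only depends on the slots above it.
countAbove-updateAt : ∀ {k} (v : Vec Bool k) o f → countAbove (updateAt v o f) o ≡ countAbove v o
countAbove-updateAt (a ∷ v) zero f = refl
countAbove-updateAt (a ∷ v) (suc o) f = countAbove-updateAt v o f

module _ {n m : ℕ} where
  -- A defined synonym of the constructor nmon: eqMon applied to it does not
  -- reduce on sight, so that 'with eqMon …' can abstract it in the goals below.
  nm : Vec ℕ (n ℕ.+ m) → Vec Bool (m ℕ.+ n) → NMon n m
  nm = nmon

  nmon-inj : {e e' : Vec ℕ (n ℕ.+ m)} {o o' : Vec Bool (m ℕ.+ n)} → nm e o ≡ nm e' o' → (e ≡ e') × (o ≡ o')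
  nmon-inj refl = refl , refl

  signedCoeff-true : ∀ {s} {M' M : NMon n m} → eqMon M' M ≡ true → signedCoeff (s , M') M ≡ s
  signedCoeff-true {s} e = cong (λ b → if b then s else + 0) e

  signedCoeff-false : ∀ {s} {M' M : NMon n m} → eqMon M' M ≡ false → signedCoeff (s , M') M ≡ + 0
  signedCoeff-false {s} e = cong (λ b → if b then s else + 0) e

  signedCoeff-even : (s : ℤ) (ev : Vec ℕ (n ℕ.+ m)) (od : Vec Bool (m ℕ.+ n)) (e : Fin (n ℕ.+ m)) (M : NMon n m) →
    signedCoeff (s , nm (updateAt ev e suc) od) M ≡ divGen (evenG e) (signedCoeff (s , nm ev od)) M
  signedCoeff-even s ev od e (nmon ev' od') with lookup ev' e in le
  ... | zero = signedCoeff-false {s} {nm (updateAt ev e suc) od} {nm ev' od'} (eqMon-false {A = nm (updateAt ev e suc) od} {B = nm ev' od'} λ p →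
         let q = trans (sym (upd-lookup ev e suc)) (cong (λ v → lookup v e) (proj₁ (nmon-inj p))) in
         ℕP.1+n≢0 (trans q le))
  ... | suc c = cong (λ b → if b then s else + 0) (eqMon-iff {A = nm (updateAt ev e suc) od} {B = nm ev' od'} {C = nm ev od} {D = nm (updateAt ev' e pred) od'}
         (λ p → let (p1 , p2) = nmon-inj p in
            cong₂ nm (trans (sym (trans (upd-upd ev e pred suc) (upd-id ev e _ refl))) (cong (λ v → updateAt v e pred) p1)) p2)
         (λ p → let (p1 , p2) = nmon-inj p in
            cong₂ nm (trans (cong (λ v → updateAt v e suc) p1)
              (trans (upd-upd ev' e suc pred) (upd-id ev' e _ (trans (cong (λ z → suc (pred z)) le) (sym le))))) p2))

  set-clear-eqMon : ∀ ev (od : Vec Bool (m ℕ.+ n)) o ev' od' → lookup od o ≡ false → lookup od' o ≡ true →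
    eqMon (nm ev (updateAt od o (λ _ → true))) (nm ev' od') ≡ eqMon (nm ev od) (nm ev' (updateAt od' o clear))
  set-clear-eqMon ev od o ev' od' lf lo = eqMon-iff backward forward
    where
    forward : nm ev od ≡ nm ev' (updateAt od' o clear) → nm ev (updateAt od o (λ _ → true)) ≡ nm ev' od'
    forward p = let (p1 , p2) = nmon-inj p in cong₂ nm p1 (trans (cong (λ v → updateAt v o (λ _ → true)) p2)
                  (trans (upd-upd od' o _ clear) (upd-id od' o _ (sym lo))))
    backward : nm ev (updateAt od o (λ _ → true)) ≡ nm ev' od' → nm ev od ≡ nm ev' (updateAt od' o clear)
    backward p = let (p1 , p2) = nmon-inj p in cong₂ nm p1
                   (trans (sym (trans (upd-upd od o clear _) (upd-id od o _ (sym lf)))) (cong (λ v → updateAt v o clear) p2))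

  signedCoeff-odd-new : (s : ℤ) (ev : Vec ℕ (n ℕ.+ m)) (od : Vec Bool (m ℕ.+ n)) (o : Fin (m ℕ.+ n)) (M : NMon n m) → lookup od o ≡ false →
    signedCoeff (s ℤ.* negPow (countAbove od o) , nm ev (updateAt od o (λ _ → true))) M ≡ divGen (oddG o) (signedCoeff (s , nm ev od)) M
  signedCoeff-odd-new s ev od o (nmon ev' od') lf with lookup od' o in lo
  ... | false = signedCoeff-false {s ℤ.* negPow (countAbove od o)} {nm ev (updateAt od o (λ _ → true))} {nm ev' od'} (eqMon-false {A = nm ev (updateAt od o (λ _ → true))} {B = nm ev' od'} λ p →
         true≢false (trans (sym (upd-lookup od o _)) (trans (cong (λ v → lookup v o) (proj₂ (nmon-inj p))) lo)))
  ... | true with eqMon (nm ev (updateAt od o (λ _ → true))) (nm ev' od') in e1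
  ... | true = (trans (trans (ℤP.*-comm s _)
         (cong (λ z → negPow z ℤ.* s) (trans (sym (countAbove-updateAt od o _)) (cong (λ v → countAbove v o) (proj₂ (nmon-inj (eqMon-sound e1)))))))
         (cong (negPow (countAbove od' o) ℤ.*_) (sym (signedCoeff-true (trans (sym (set-clear-eqMon ev od o ev' od' lf lo)) e1)))))
  ... | false = (trans (sym (ℤP.*-zeroʳ (negPow (countAbove od' o))))
         (cong (negPow (countAbove od' o) ℤ.*_) (sym (signedCoeff-false (trans (sym (set-clear-eqMon ev od o ev' od' lf lo)) e1)))))

  signedCoeff-odd-present : (s : ℤ) (ev : Vec ℕ (n ℕ.+ m)) (od : Vec Bool (m ℕ.+ n)) (o : Fin (m ℕ.+ n)) (M : NMon n m) → lookup od o ≡ true →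
    signedCoeff (+ 0 , nm ev od) M ≡ divGen (oddG o) (signedCoeff (s , nm ev od)) M
  signedCoeff-odd-present s ev od o (nmon ev' od') lt with lookup od' o in lo
  ... | false = BoolP.if-eta (eqMon (nm ev od) (nm ev' od'))
  ... | true = trans (BoolP.if-eta (eqMon (nm ev od) (nm ev' od')))
      (trans (sym (ℤP.*-zeroʳ (negPow (countAbove od' o)))) (cong (λ b → negPow (countAbove od' o) ℤ.* (if b then s else + 0))
        (sym (eqMon-false λ p → true≢false (trans (sym lt) (trans (cong (λ v → lookup v o) (proj₂ (nmon-inj p))) (upd-lookup od' o clear)))))))

  signedCoeff-mulGen : (sM : ℤ × NMon n m) (g : Gen n m) (M : NMon n m) → signedCoeff (mulGen sM g) M ≡ divGen (kind g) (signedCoeff sM) M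
  signedCoeff-mulGen (s , nmon ev od) g M with kind g
  ... | evenG e = signedCoeff-even s ev od e M
  ... | oddG o with lookup od o in lo
  ... | true = signedCoeff-odd-present s ev od o M lo
  ... | false = signedCoeff-odd-new s ev od o M lo

  coeffWord-snoc : (u : Word n m) (g : Gen n m) (M : NMon n m) → coeffWord (u ++ g ∷ []) M ≡ divGen (kind g) (coeffWord u) M
  coeffWord-snoc u g M = trans (cong (λ z → signedCoeff z M) (LP.foldl-++ mulGen (+ 1 , unitMon) u (g ∷ []))) (signedCoeff-mulGen (normWord u) g M)

  divGen-cong : (k : Kind n m) {f f' : CoeffFn n m} → (∀ M → f M ≡ f' M) → ∀ M → divGen k f M ≡ divGen k f' M
  divGen-cong (evenG e) eq (nmon ev od) = cong (ifPos (lookup ev e)) (eq _)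
  divGen-cong (oddG o) eq (nmon ev od) = cong (λ z → if lookup od o then negPow (countAbove od o) ℤ.* z else + 0) (eq _)

  divWord-cong : (w : Word n m) {f f' : CoeffFn n m} → (∀ M → f M ≡ f' M) → ∀ M → divWord w f M ≡ divWord w f' M
  divWord-cong [] eq = eq
  divWord-cong (g ∷ w) eq = divWord-cong w (divGen-cong (kind g) eq)

  coeffWord-++ : (u w : Word n m) (M : NMon n m) → coeffWord (u ++ w) M ≡ divWord w (coeffWord u) M
  coeffWord-++ u [] M = cong (λ z → coeffWord z M) (LP.++-identityʳ u)
  coeffWord-++ u (g ∷ w) M = trans (cong (λ z → coeffWord z M) (sym (LP.++-assoc u (g ∷ []) w)))
                    (trans (coeffWord-++ (u ++ g ∷ []) w M) (divWord-cong w (coeffWord-snoc u g) M))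

trues-off : ∀ {k} (v : Vec Bool k) j → lookup v j ≡ true → trues v ≡ suc (trues (updateAt v j clear))
trues-off (true ∷ v) zero eq = refl
trues-off (false ∷ v) zero ()
trues-off (true ∷ v) (suc j) eq = cong suc (trues-off v j eq)
trues-off (false ∷ v) (suc j) eq = trues-off v j eq

negsym : {a b : ℤ} → a ≡ - b → b ≡ - a
negsym {a} {b} e = trans (sym (ℤP.neg-involutive b)) (cong -_ (sym e))

countAbove-swap : ∀ {k} (od : Vec Bool k) o1 o2 → ¬ o1 ≡ o2 → lookup od o1 ≡ true → lookup od o2 ≡ true →
     negPow (countAbove od o1) ℤ.* negPow (countAbove (updateAt od o1 clear) o2)
     ≡ - (negPow (countAbove od o2) ℤ.* negPow (countAbove (updateAt od o2 clear) o1))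
countAbove-swap (b ∷ v) zero zero ne _ _ = ⊥-elim (ne refl)
countAbove-swap (b ∷ v) zero (suc j) ne t1 t2 =
  trans (cong (λ z → negPow z ℤ.* negPow (countAbove v j)) (trues-off v j t2))
  (trans (sym (ℤP.neg-distribˡ-* (negPow (trues (updateAt v j clear))) (negPow (countAbove v j))))
    (cong -_ (ℤP.*-comm (negPow (trues (updateAt v j clear))) (negPow (countAbove v j)))))
countAbove-swap (b ∷ v) (suc i) zero ne t1 t2 = negsym (countAbove-swap (b ∷ v) zero (suc i) (λ e → ne (sym e)) t2 t1)
countAbove-swap (b ∷ v) (suc i) (suc j) ne t1 t2 = countAbove-swap v i j (λ e → ne (cong suc e)) t1 t2

kindSign : ∀ {n m} → Kind n m → Kind n m → ℤ
kindSign (oddG _) (oddG _) = - (+ 1)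
kindSign _ _ = + 1

ifPos-comm : ∀ a b z → ifPos a (ifPos b z) ≡ ifPos b (ifPos a z)
ifPos-comm zero zero z = refl
ifPos-comm zero (suc b) z = refl
ifPos-comm (suc a) zero z = refl
ifPos-comm (suc a) (suc b) z = refl

ifPos-if : ∀ a (b : Bool) c z → ifPos a (if b then c ℤ.* z else + 0) ≡ (if b then c ℤ.* ifPos a z else + 0)
ifPos-if zero true c z = sym (ℤP.*-zeroʳ c)
ifPos-if zero false c z = refl
ifPos-if (suc a) true c z = refl
ifPos-if (suc a) false c z = refl

module _ {n m : ℕ} where
  open import Data.Fin.Properties using () renaming (_≟_ to _≟F_)

  divGen-comm-odd : ∀ o1 o2 (f : CoeffFn n m) ev od →
    divGen (oddG o1) (divGen (oddG o2) f) (nmon ev od) ≡ - (+ 1) ℤ.* divGen (oddG o2) (divGen (oddG o1) f) (nmon ev od)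
  divGen-comm-odd o1 o2 f ev od with o1 ≟F o2
  ... | yes refl = trans (lhs0 (lookup od o1) refl) (sym (trans (cong (- (+ 1) ℤ.*_) (lhs0 (lookup od o1) refl)) refl))
    where
      lhs0 : (b : Bool) → lookup od o1 ≡ b →
        (if b then negPow (countAbove od o1) ℤ.*
          (if lookup (updateAt od o1 clear) o1 then negPow (countAbove (updateAt od o1 clear) o1) ℤ.* f (nmon ev (updateAt (updateAt od o1 clear) o1 clear)) else + 0)
          else + 0) ≡ + 0
      lhs0 false _ = refl
      lhs0 true _ rewrite upd-lookup od o1 clear = ℤP.*-zeroʳ (negPow (countAbove od o1))
  ... | no ne with lookup od o1 in l1 | lookup od o2 in l2
  ... | false | b2 = sym (trans (cong (- (+ 1) ℤ.*_) (inner b2)) refl)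
    where
      inner : (b : Bool) → (if b then negPow (countAbove od o2) ℤ.*
          (if lookup (updateAt od o2 clear) o1 then negPow (countAbove (updateAt od o2 clear) o1) ℤ.* f (nmon ev (updateAt (updateAt od o2 clear) o1 clear)) else + 0)
          else + 0) ≡ + 0
      inner false = refl
      inner true rewrite upd-lookup′ od o1 o2 clear ne | l1 = ℤP.*-zeroʳ (negPow (countAbove od o2))
  ... | true | false rewrite upd-lookup′ od o2 o1 clear (λ e → ne (sym e)) | l2 = ℤP.*-zeroʳ (negPow (countAbove od o1))
  ... | true | true rewrite upd-lookup′ od o2 o1 clear (λ e → ne (sym e)) | l2 | upd-lookup′ od o1 o2 clear ne | l1 =
    let a = negPow (countAbove od o1)
        b = negPow (countAbove (updateAt od o1 clear) o2)
        c = negPow (countAbove od o2)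
        d = negPow (countAbove (updateAt od o2 clear) o1)
        F1 = f (nmon ev (updateAt (updateAt od o1 clear) o2 clear))
        F2 = f (nmon ev (updateAt (updateAt od o2 clear) o1 clear)) in
    trans (sym (ℤP.*-assoc a b F1))
    (trans (cong₂ ℤ._*_ (countAbove-swap od o1 o2 ne l1 l2) (cong (λ v → f (nmon ev v)) (upd-comm od o1 o2 clear clear ne)))
    (trans (sym (ℤP.neg-distribˡ-* (c ℤ.* d) F2))
    (trans (cong -_ (ℤP.*-assoc c d F2))
     (sym (ℤP.-1*i≡-i (c ℤ.* (d ℤ.* F2)))))))

  -- Divisions by two generators supercommute: this is where the sign rule of
  -- the free supercommutative algebra enters.
  divGen-comm : (k1 k2 : Kind n m) (f : CoeffFn n m) (M : NMon n m) → divGen k1 (divGen k2 f) M ≡ kindSign k1 k2 ℤ.* divGen k2 (divGen k1 f) M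
  divGen-comm (evenG e1) (evenG e2) f (nmon ev od) with e1 ≟F e2
  ... | yes refl = sym (ℤP.*-identityˡ _)
  ... | no ne = trans (cong (ifPos (lookup ev e1)) (cong₂ ifPos (upd-lookup′ ev e2 e1 pred (λ e → ne (sym e)))
                          (cong (λ v → f (nmon v od)) (upd-comm ev e1 e2 pred pred ne))))
                (trans (ifPos-comm (lookup ev e1) (lookup ev e2) _)
                (trans (cong (ifPos (lookup ev e2)) (cong (λ z → ifPos z (f (nmon (updateAt (updateAt ev e2 pred) e1 pred) od)))
                          (sym (upd-lookup′ ev e1 e2 pred ne))))
                 (sym (ℤP.*-identityˡ _))))
  divGen-comm (evenG e) (oddG o) f (nmon ev od) =
    trans (ifPos-if (lookup ev e) (lookup od o) (negPow (countAbove od o)) _) (sym (ℤP.*-identityˡ _))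
  divGen-comm (oddG o) (evenG e) f (nmon ev od) =
    trans (sym (ifPos-if (lookup ev e) (lookup od o) (negPow (countAbove od o)) _)) (sym (ℤP.*-identityˡ _))
  divGen-comm (oddG o1) (oddG o2) f (nmon ev od) = divGen-comm-odd o1 o2 f ev od

module _ {n m : ℕ} where
  infixl 6 _⊕_
  _⊕_ : CoeffFn n m → CoeffFn n m → CoeffFn n m
  (f ⊕ g) M = f M + g M
  _⊙_ : ℤ → CoeffFn n m → CoeffFn n m
  (c ⊙ f) M = c * f M
  zeroFn : CoeffFn n m
  zeroFn _ = + 0

  divGen-⊕ : ∀ k f g → divGen k (f ⊕ g) ≗ (divGen k f ⊕ divGen k g)
  divGen-⊕ (evenG e) f g (nmon ev od) with lookup ev e
  ... | zero = refl
  ... | suc _ = refl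
  divGen-⊕ (oddG o) f g (nmon ev od) with lookup od o
  ... | true = ℤP.*-distribˡ-+ (negPow (countAbove od o)) (f (nmon ev (updateAt od o clear))) (g (nmon ev (updateAt od o clear)))
  ... | false = refl

  divGen-⊙ : ∀ k c f → divGen k (c ⊙ f) ≗ (c ⊙ divGen k f)
  divGen-⊙ (evenG e) c f (nmon ev od) with lookup ev e
  ... | zero = sym (ℤP.*-zeroʳ c)
  ... | suc _ = refl
  divGen-⊙ (oddG o) c f (nmon ev od) with lookup od o
  ... | true = trans (sym (ℤP.*-assoc (negPow (countAbove od o)) c (f (nmon ev (updateAt od o clear)))))
               (trans (cong (_* f (nmon ev (updateAt od o clear))) (ℤP.*-comm (negPow (countAbove od o)) c))
                 (ℤP.*-assoc c (negPow (countAbove od o)) (f (nmon ev (updateAt od o clear)))))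
  ... | false = sym (ℤP.*-zeroʳ c)

  divGen-0 : ∀ k → divGen k zeroFn ≗ zeroFn
  divGen-0 (evenG e) (nmon ev od) with lookup ev e
  ... | zero = refl
  ... | suc _ = refl
  divGen-0 (oddG o) (nmon ev od) with lookup od o
  ... | true = ℤP.*-zeroʳ (negPow (countAbove od o))
  ... | false = refl

  divWord-⊕ : ∀ (w : Word n m) f g → divWord w (f ⊕ g) ≗ (divWord w f ⊕ divWord w g)
  divWord-⊕ [] f g M = refl
  divWord-⊕ (h ∷ w) f g M = trans (divWord-cong w (divGen-⊕ (kind h) f g) M) (divWord-⊕ w _ _ M)

  divWord-⊙ : ∀ (w : Word n m) c f → divWord w (c ⊙ f) ≗ (c ⊙ divWord w f)
  divWord-⊙ [] c f M = refl
  divWord-⊙ (h ∷ w) c f M = trans (divWord-cong w (divGen-⊙ (kind h) c f) M) (divWord-⊙ w c _ M)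

  divWord-0 : ∀ (w : Word n m) → divWord w zeroFn ≗ zeroFn
  divWord-0 [] M = refl
  divWord-0 (h ∷ w) M = trans (divWord-cong w (divGen-0 (kind h)) M) (divWord-0 w M)

  divWord-++ : ∀ (u w : Word n m) (f : CoeffFn n m) → divWord (u ++ w) f ≗ divWord w (divWord u f)
  divWord-++ [] w f M = refl
  divWord-++ (g ∷ u) w f M = divWord-++ u w (divGen (kind g) f) M

  -- Right multiplication by a form, acting on coefficient functions:
  -- mulR q (coeff p) is the coefficient function of p·q (coeff-*SP).
  mulR : SP n m → CoeffFn n m → CoeffFn n m
  mulR [] f M = + 0
  mulR ((c , w) ∷ p) f M = c * divWord w f M + mulR p f M

  mulR-cong : ∀ (p : SP n m) {f g} → f ≗ g → mulR p f ≗ mulR p g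
  mulR-cong [] e M = refl
  mulR-cong ((c , w) ∷ p) e M = cong₂ (λ a b → c * a + b) (divWord-cong w e M) (mulR-cong p e M)

  mulR-⊕ : ∀ (p : SP n m) f g → mulR p (f ⊕ g) ≗ (mulR p f ⊕ mulR p g)
  mulR-⊕ [] f g M = refl
  mulR-⊕ ((c , w) ∷ p) f g M =
    trans (cong₂ (λ a b → c * a + b) (divWord-⊕ w f g M) (mulR-⊕ p f g M))
    (trans (cong (_+ (mulR p f M + mulR p g M)) (ℤP.*-distribˡ-+ c (divWord w f M) (divWord w g M)))
      (shuffle (c * divWord w f M) (c * divWord w g M) (mulR p f M) (mulR p g M)))
    where
      shuffle : ∀ a b u v → (a + b) + (u + v) ≡ (a + u) + (b + v)
      shuffle a b u v = trans (ℤP.+-assoc a b (u + v)) (trans (cong (λ zz → a + zz) (trans (sym (ℤP.+-assoc b u v))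
        (trans (cong (_+ v) (ℤP.+-comm b u)) (ℤP.+-assoc u b v)))) (sym (ℤP.+-assoc a u (b + v))))

  mulR-⊙ : ∀ (p : SP n m) c f → mulR p (c ⊙ f) ≗ (c ⊙ mulR p f)
  mulR-⊙ [] c f M = sym (ℤP.*-zeroʳ c)
  mulR-⊙ ((d , w) ∷ p) c f M =
    trans (cong₂ (λ a b → d * a + b) (divWord-⊙ w c f M) (mulR-⊙ p c f M))
    (trans (cong (_+ (c * mulR p f M)) (trans (sym (ℤP.*-assoc d c (divWord w f M))) (trans (cong (_* divWord w f M) (ℤP.*-comm d c)) (ℤP.*-assoc c d (divWord w f M)))))
      (sym (ℤP.*-distribˡ-+ c (d * divWord w f M) (mulR p f M))))

  mulR-0 : ∀ (p : SP n m) → mulR p zeroFn ≗ zeroFn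
  mulR-0 [] M = refl
  mulR-0 ((c , w) ∷ p) M = trans (cong₂ (λ a b → c * a + b) (divWord-0 w M) (mulR-0 p M)) (cong (_+ + 0) (ℤP.*-zeroʳ c))

  mulR-++ : ∀ (p q : SP n m) f → mulR (p ++ q) f ≗ (mulR p f ⊕ mulR q f)
  mulR-++ [] q f M = sym (ℤP.+-identityˡ _)
  mulR-++ ((c , w) ∷ p) q f M = trans (cong (λ zz → c * divWord w f M + zz) (mulR-++ p q f M)) (sym (ℤP.+-assoc (c * divWord w f M) (mulR p f M) (mulR q f M)))

  coeff-++ : ∀ (p q : SP n m) M → coeff (p ++ q) M ≡ coeff p M + coeff q M
  coeff-++ [] q M = sym (ℤP.+-identityˡ _)
  coeff-++ ((c , w) ∷ p) q M = trans (cong (λ zz → c * coeffWord w M + zz) (coeff-++ p q M)) (sym (ℤP.+-assoc (c * coeffWord w M) (coeff p M) (coeff q M)))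

  coeffOne : CoeffFn n m
  coeffOne = coeffWord []

  coeff-mulR : ∀ (p : SP n m) → coeff p ≗ mulR p coeffOne
  coeff-mulR [] M = refl
  coeff-mulR ((c , w) ∷ p) M = cong₂ (λ a b → c * a + b) (coeffWord-++ {n} {m} [] w M) (coeff-mulR p M)

  termMul : ℤ → Word n m → SP n m → SP n m
  termMul c u = List.map (λ { (c' , w') → (c * c' , u ++ w') })

  coeff-termMul : ∀ (c : ℤ) (u : Word n m) (q : SP n m) M → coeff (termMul c u q) M ≡ c * mulR q (coeffWord u) M
  coeff-termMul c u [] M = sym (ℤP.*-zeroʳ c)
  coeff-termMul c u ((c' , w) ∷ q) M =
    trans (cong₂ _+_ (trans (ℤP.*-assoc c c' (coeffWord (u ++ w) M)) (cong (λ z → c * (c' * z)) (coeffWord-++ u w M))) (coeff-termMul c u q M))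
      (sym (ℤP.*-distribˡ-+ c (c' * divWord w (coeffWord u) M) (mulR q (coeffWord u) M)))

  coeff-*SP : ∀ (p q : SP n m) → coeff (p *SP q) ≗ mulR q (coeff p)
  coeff-*SP [] q M = sym (mulR-0 q M)
  coeff-*SP ((c , u) ∷ p) q M =
    trans (coeff-++ (termMul c u q) (p *SP q) M)
    (trans (cong₂ _+_ (coeff-termMul c u q M) (coeff-*SP p q M))
    (trans (cong (_+ mulR q (coeff p) M) (sym (mulR-⊙ q c (coeffWord u) M)))
      (sym (mulR-⊕ q (c ⊙ coeffWord u) (coeff p) M))))

  mulR-termMul : ∀ (c : ℤ) (u : Word n m) (q : SP n m) (f : CoeffFn n m) → mulR (termMul c u q) f ≗ (c ⊙ mulR q (divWord u f))
  mulR-termMul c u [] f M = sym (ℤP.*-zeroʳ c)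
  mulR-termMul c u ((c' , w) ∷ q) f M =
    trans (cong₂ _+_ (trans (ℤP.*-assoc c c' (divWord (u ++ w) f M)) (cong (λ z → c * (c' * z)) (divWord-++ u w f M))) (mulR-termMul c u q f M))
      (sym (ℤP.*-distribˡ-+ c (c' * divWord w (divWord u f) M) (mulR q (divWord u f) M)))

  mulR-* : ∀ (p q : SP n m) f → mulR (p *SP q) f ≗ mulR q (mulR p f)
  mulR-* [] q f M = sym (mulR-0 q M)
  mulR-* ((c , u) ∷ p) q f M =
    trans (mulR-++ (termMul c u q) (p *SP q) f M)
    (trans (cong₂ _+_ (mulR-termMul c u q f M) (mulR-* p q f M))
    (trans (cong (_+ mulR q (mulR p f) M) (sym (mulR-⊙ q c (divWord u f) M)))
      (sym (mulR-⊕ q (c ⊙ divWord u f) (mulR p f) M))))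

data IsSign : ℤ → Set where
  p1 : IsSign (+ 1)
  m1 : IsSign (- (+ 1))

genSign : ∀ {n m} → Gen n m → ℤ
genSign g = if isOdd g then - (+ 1) else + 1

IsSign-* : ∀ {a b} → IsSign a → IsSign b → IsSign (a * b)
IsSign-* p1 p1 = p1
IsSign-* p1 m1 = m1
IsSign-* m1 p1 = m1
IsSign-* m1 m1 = p1

IsSign-square : ∀ {a} → IsSign a → a * a ≡ + 1
IsSign-square p1 = refl
IsSign-square m1 = refl

IsSign-genSign : ∀ {n m} (g : Gen n m) → IsSign (genSign g)
IsSign-genSign (x _) = p1
IsSign-genSign (ξ _) = m1
IsSign-genSign (dx _) = m1
IsSign-genSign (dξ _) = p1

IsSign-parSign : ∀ {n m} (w : Word n m) → IsSign (parSign w)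
IsSign-parSign [] = p1
IsSign-parSign (g ∷ w) = IsSign-* (IsSign-genSign g) (IsSign-parSign w)

module _ {n m : ℕ} where
  kindWordSign : Kind n m → Word n m → ℤ
  kindWordSign k [] = + 1
  kindWordSign k (h ∷ w) = kindSign k (kind h) * kindWordSign k w

  kindSign-sym : (k1 k2 : Kind n m) → kindSign k1 k2 ≡ kindSign k2 k1
  kindSign-sym (evenG _) (evenG _) = refl
  kindSign-sym (evenG _) (oddG _) = refl
  kindSign-sym (oddG _) (evenG _) = refl
  kindSign-sym (oddG _) (oddG _) = refl

  divWord-divGen : ∀ (w : Word n m) k f → divWord w (divGen k f) ≗ (kindWordSign k w ⊙ divGen k (divWord w f))
  divWord-divGen [] k f M = sym (ℤP.*-identityˡ _)
  divWord-divGen (h ∷ w) k f M =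
    let a = kindSign k (kind h)
        b = kindWordSign k w
        r = divGen k (divWord w (divGen (kind h) f)) M in
    trans (divWord-cong w (λ M' → trans (divGen-comm (kind h) k f M') (cong (λ z → z * divGen k (divGen (kind h) f) M') (kindSign-sym (kind h) k))) M)
    (trans (divWord-⊙ w a (divGen k (divGen (kind h) f)) M)
    (trans (cong (a *_) (divWord-divGen w k (divGen (kind h) f) M))
     (sym (ℤP.*-assoc a b r))))

  swapSign : Word n m → Word n m → ℤ
  swapSign [] w = + 1
  swapSign (g ∷ u) w = kindWordSign (kind g) w * swapSign u w

  divWord-swap : ∀ (u w : Word n m) f → divWord w (divWord u f) ≗ (swapSign u w ⊙ divWord u (divWord w f))
  divWord-swap [] w f M = sym (ℤP.*-identityˡ _)
  divWord-swap (g ∷ u) w f M =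
    let a = kindWordSign (kind g) w
        e = swapSign u w
        r = divWord u (divGen (kind g) (divWord w f)) M in
    trans (divWord-swap u w (divGen (kind g) f) M)
    (trans (cong (e *_) (trans (divWord-cong u (divWord-divGen w (kind g) f) M) (divWord-⊙ u a (divGen (kind g) (divWord w f)) M)))
    (trans (sym (ℤP.*-assoc e a r)) (cong (_* r) (ℤP.*-comm e a))))

  kindWordSign-gen : ∀ (g : Gen n m) w → kindWordSign (kind g) w ≡ (if isOdd g then parSign w else + 1)
  kindWordSign-gen g [] with isOdd g
  ... | true = refl
  ... | false = refl
  kindWordSign-gen g (h ∷ w) = trans (cong (kindSign (kind g) (kind h) *_) (kindWordSign-gen g w)) (sign-step g h)
    where
      sign-step : ∀ (g h : Gen n m) → kindSign (kind g) (kind h) * (if isOdd g then parSign w else + 1) ≡ (if isOdd g then parSign (h ∷ w) else + 1)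
      sign-step (x _) (x _) = refl
      sign-step (x _) (ξ _) = refl
      sign-step (x _) (dx _) = refl
      sign-step (x _) (dξ _) = refl
      sign-step (dξ _) (x _) = refl
      sign-step (dξ _) (ξ _) = refl
      sign-step (dξ _) (dx _) = refl
      sign-step (dξ _) (dξ _) = refl
      sign-step (ξ _) (x _) = refl
      sign-step (ξ _) (ξ _) = refl
      sign-step (ξ _) (dx _) = refl
      sign-step (ξ _) (dξ _) = refl
      sign-step (dx _) (x _) = refl
      sign-step (dx _) (ξ _) = refl
      sign-step (dx _) (dx _) = refl
      sign-step (dx _) (dξ _) = refl

  swapSign-cases : ∀ (u w : Word n m) → (parSign u ≡ + 1 × swapSign u w ≡ + 1) ⊎ (parSign u ≡ - (+ 1) × swapSign u w ≡ parSign w)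
  swapSign-cases [] w = inj₁ (refl , refl)
  swapSign-cases (g ∷ u) w with isOdd g in og | swapSign-cases u w
  ... | false | inj₁ (a , b) = inj₁ (trans (ℤP.*-identityˡ _) a , trans (cong (_* swapSign u w) (trans (kindWordSign-gen g w) (cong (λ b → if b then parSign w else + 1) og))) (trans (ℤP.*-identityˡ _) b))
  ... | false | inj₂ (a , b) = inj₂ (trans (ℤP.*-identityˡ _) a , trans (cong (_* swapSign u w) (trans (kindWordSign-gen g w) (cong (λ b → if b then parSign w else + 1) og))) (trans (ℤP.*-identityˡ _) b))
  ... | true | inj₁ (a , b) = inj₂ (cong (- (+ 1) *_) a , trans (cong (_* swapSign u w) (trans (kindWordSign-gen g w) (cong (λ b → if b then parSign w else + 1) og))) (trans (cong (parSign w *_) b) (ℤP.*-identityʳ _)))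
  ... | true | inj₂ (a , b) = inj₁ (cong (- (+ 1) *_) a , trans (cong (_* swapSign u w) (trans (kindWordSign-gen g w) (cong (λ b → if b then parSign w else + 1) og))) (trans (cong (parSign w *_) b) (IsSign-square (IsSign-parSign w))))

  divWord-comm-even : ∀ (u w : Word n m) f → parSign u ≡ + 1 → divWord w (divWord u f) ≗ divWord u (divWord w f)
  divWord-comm-even u w f pu M with swapSign-cases u w
  ... | inj₁ (_ , e) = trans (divWord-swap u w f M) (trans (cong (_* divWord u (divWord w f) M) e) (ℤP.*-identityˡ _))
  ... | inj₂ (a , _) = ⊥-elim' (trans (sym pu) a)
    where ⊥-elim' : + 1 ≡ - (+ 1) → _
          ⊥-elim' ()

  divWord-comm-odd : ∀ (u w : Word n m) f → parSign u ≡ - (+ 1) → divWord w (divWord u f) ≗ (parSign w ⊙ divWord u (divWord w f))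
  divWord-comm-odd u w f pu M with swapSign-cases u w
  ... | inj₂ (_ , e) = trans (divWord-swap u w f M) (cong (_* divWord u (divWord w f) M) e)
  ... | inj₁ (a , _) = ⊥-elim' (trans (sym pu) a)
    where ⊥-elim' : - (+ 1) ≡ + 1 → _
          ⊥-elim' ()

HomSP : ∀ {n m} → ℤ → SP n m → Set
HomSP s [] = ⊤
HomSP s ((c , w) ∷ p) = (parSign w ≡ s) × HomSP s p

EvenSP OddSP : ∀ {n m} → SP n m → Set
EvenSP = HomSP (+ 1)
OddSP = HomSP (- (+ 1))

monSign : ∀ {n m} → NMon n m → ℤ
monSign (nmon ev od) = negPow (trues od)

module _ {n m : ℕ} where
  mulR-divWord-even : ∀ (q : SP n m) u f → parSign u ≡ + 1 → mulR q (divWord u f) ≗ divWord u (mulR q f)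
  mulR-divWord-even [] u f pu M = sym (divWord-0 u M)
  mulR-divWord-even ((c , w) ∷ q) u f pu M =
    trans (cong₂ (λ a b → c * a + b) (divWord-comm-even u w f pu M) (mulR-divWord-even q u f pu M))
    (trans (cong (_+ divWord u (mulR q f) M) (sym (divWord-⊙ u c (divWord w f) M)))
      (sym (divWord-⊕ u (c ⊙ divWord w f) (mulR q f) M)))

  mulR-divWord-odd : ∀ (q : SP n m) u f → parSign u ≡ - (+ 1) → mulR q (divWord u f) ≗ divWord u (mulR (flipSP q) f)
  mulR-divWord-odd [] u f pu M = sym (divWord-0 u M)
  mulR-divWord-odd ((c , w) ∷ q) u f pu M =
    trans (cong₂ (λ a b → c * a + b) (divWord-comm-odd u w f pu M) (mulR-divWord-odd q u f pu M))
    (trans (cong (_+ divWord u (mulR (flipSP q) f) M)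
         (trans (sym (ℤP.*-assoc c (parSign w) (divWord u (divWord w f) M)))
         (trans (cong (_* divWord u (divWord w f) M) (ℤP.*-comm c (parSign w)))
           (sym (divWord-⊙ u (parSign w * c) (divWord w f) M)))))
      (sym (divWord-⊕ u ((parSign w * c) ⊙ divWord w f) (mulR (flipSP q) f) M)))

  mulR-comm-even : ∀ (p q : SP n m) f → EvenSP p → mulR q (mulR p f) ≗ mulR p (mulR q f)
  mulR-comm-even [] q f _ M = mulR-0 q M
  mulR-comm-even ((c , u) ∷ p) q f (pu , hp) M =
    trans (mulR-⊕ q (c ⊙ divWord u f) (mulR p f) M)
    (cong₂ _+_ (trans (mulR-⊙ q c (divWord u f) M) (cong (c *_) (mulR-divWord-even q u f pu M))) (mulR-comm-even p q f hp M))

  mulR-comm-odd : ∀ (p q : SP n m) f → OddSP p → mulR q (mulR p f) ≗ mulR p (mulR (flipSP q) f)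
  mulR-comm-odd [] q f _ M = mulR-0 q M
  mulR-comm-odd ((c , u) ∷ p) q f (pu , hp) M =
    trans (mulR-⊕ q (c ⊙ divWord u f) (mulR p f) M)
    (cong₂ _+_ (trans (mulR-⊙ q c (divWord u f) M) (cong (c *_) (mulR-divWord-odd q u f pu M))) (mulR-comm-odd p q f hp M))

  -- Normalisation preserves parity: a word normalises either to 0 or to a
  -- monomial of the word's parity.
  SignInvariant : ℤ → ℤ × NMon n m → Set
  SignInvariant t (s , M) = t * s ≡ monSign M * s

  trues-on : ∀ {k} (v : Vec Bool k) o → lookup v o ≡ false → trues (updateAt v o (λ _ → true)) ≡ suc (trues v)
  trues-on (false ∷ v) zero e = refl
  trues-on (true ∷ v) zero ()
  trues-on (true ∷ v) (suc o) e = cong suc (trues-on v o e)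
  trues-on (false ∷ v) (suc o) e = trues-on v o e

  SignInvariant-odd : ∀ t s ev (od : Vec Bool (m ℕ.+ n)) o → SignInvariant t (s , nmon ev od) →
    SignInvariant (t * - (+ 1)) (if lookup od o then (+ 0 , nmon ev od) else (s * negPow (countAbove od o) , nmon ev (updateAt od o (λ _ → true))))
  SignInvariant-odd t s ev od o I with lookup od o in lo
  ... | true = trans (ℤP.*-zeroʳ (t * - (+ 1))) (sym (ℤP.*-zeroʳ (negPow (trues od))))
  ... | false rewrite trues-on od o lo =
    let a = negPow (countAbove od o) in
    trans (cong (_* (s * a)) (ℤP.*-comm t (- (+ 1))))
    (trans (ℤP.*-assoc (- (+ 1)) t (s * a))
    (trans (cong (- (+ 1) *_) (trans (sym (ℤP.*-assoc t s a)) (trans (cong (_* a) I) (ℤP.*-assoc (negPow (trues od)) s a))))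
    (trans (sym (ℤP.*-assoc (- (+ 1)) (negPow (trues od)) (s * a))) (cong (_* (s * a)) (ℤP.-1*i≡-i (negPow (trues od)))))))

  SignInvariant-mulGen : ∀ t sM (g : Gen n m) → SignInvariant t sM → SignInvariant (t * genSign g) (mulGen sM g)
  SignInvariant-mulGen t (s , nmon ev od) (x i) I = trans (cong (_* s) (ℤP.*-identityʳ t)) I
  SignInvariant-mulGen t (s , nmon ev od) (dξ a) I = trans (cong (_* s) (ℤP.*-identityʳ t)) I
  SignInvariant-mulGen t (s , nmon ev od) (ξ a) I = SignInvariant-odd t s ev od _ I
  SignInvariant-mulGen t (s , nmon ev od) (dx i) I = SignInvariant-odd t s ev od _ I

  SignInvariant-foldl : ∀ (w : Word n m) t sM → SignInvariant t sM → SignInvariant (t * parSign w) (List.foldl mulGen sM w)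
  SignInvariant-foldl [] t sM I = subst (λ z → SignInvariant z sM) (sym (ℤP.*-identityʳ t)) I
  SignInvariant-foldl (g ∷ w) t sM I = subst (λ z → SignInvariant z (List.foldl mulGen (mulGen sM g) w)) (ℤP.*-assoc t (genSign g) (parSign w))
    (SignInvariant-foldl w (t * genSign g) (mulGen sM g) (SignInvariant-mulGen t sM g I))

  SignInvariant-unit : SignInvariant (+ 1) (+ 1 , unitMon {n} {m})
  SignInvariant-unit = cong (_* + 1) (sym (trans (cong negPow (tr0 (m ℕ.+ n))) refl))
    where tr0 : ∀ k → trues (Vec.replicate k false) ≡ 0
          tr0 zero = refl
          tr0 (suc k) = tr0 k

  signedCoeff-cases : ∀ s (M' M : NMon n m) → (M' ≡ M × signedCoeff (s , M') M ≡ s) ⊎ signedCoeff (s , M') M ≡ + 0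
  signedCoeff-cases s M' M with eqMon M' M in e
  ... | true = inj₁ (eqMon-sound e , refl)
  ... | false = inj₂ refl

  signedCoeff-parity : ∀ t s (M' M : NMon n m) → SignInvariant t (s , M') → t * signedCoeff (s , M') M ≡ monSign M * signedCoeff (s , M') M
  signedCoeff-parity t s M' M I with signedCoeff-cases s M' M
  ... | inj₁ (refl , e) = trans (cong (t *_) e) (trans I (cong (monSign M *_) (sym e)))
  ... | inj₂ e = trans (cong (t *_) e) (trans (ℤP.*-zeroʳ t) (trans (sym (ℤP.*-zeroʳ (monSign M))) (cong (monSign M *_) (sym e))))

  coeffWord-parity : ∀ (w : Word n m) M → parSign w * coeffWord w M ≡ monSign M * coeffWord w M
  coeffWord-parity w M with normWord w | SignInvariant-foldl w (+ 1) (+ 1 , unitMon) SignInvariant-unit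
  ... | (s , M') | I = signedCoeff-parity (parSign w) s M' M (subst (λ z → SignInvariant z (s , M')) (ℤP.*-identityˡ (parSign w)) I)

  coeff-flip : ∀ (q : SP n m) M → coeff (flipSP q) M ≡ monSign M * coeff q M
  coeff-flip [] M = sym (ℤP.*-zeroʳ (monSign M))
  coeff-flip ((c , w) ∷ q) M =
    trans (cong₂ _+_ (trans (cong (_* coeffWord w M) (ℤP.*-comm (parSign w) c))
                     (trans (ℤP.*-assoc c (parSign w) (coeffWord w M))
                     (trans (cong (c *_) (coeffWord-parity w M))
                     (trans (sym (ℤP.*-assoc c (monSign M) (coeffWord w M)))
                     (trans (cong (_* coeffWord w M) (ℤP.*-comm c (monSign M))) (ℤP.*-assoc (monSign M) c (coeffWord w M)))))))
                   (coeff-flip q M))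
     (sym (ℤP.*-distribˡ-+ (monSign M) (c * coeffWord w M) (coeff q M)))

module _ {n m : ℕ} where
  infix 4 _≈_
  -- Equality of forms (_≈SP_ of Defs, wrapped in a record so that it is not
  -- unfolded during unification).
  record _≈_ (p q : SP n m) : Set where
    constructor ≈i
    field ≈e : ∀ M → coeff p M ≡ coeff q M
  open _≈_ public

  ≈-refl : ∀ {p} → p ≈ p
  ≈-refl = ≈i λ M → refl
  ≈-sym : ∀ {p q} → p ≈ q → q ≈ p
  ≈-sym e = ≈i λ M → sym (≈e e M)
  ≈-trans : ∀ {p q r} → p ≈ q → q ≈ r → p ≈ r
  ≈-trans e f = ≈i λ M → trans (≈e e M) (≈e f M)
  ≡⇒≈ : ∀ {p q} → p ≡ q → p ≈ q
  ≡⇒≈ refl = ≈-refl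

  infixl 6 _⊞_
  infixl 7 _⊠_
  _⊞_ : SP n m → SP n m → SP n m
  _⊞_ = _+SP_
  _⊠_ : SP n m → SP n m → SP n m
  _⊠_ = _*SP_
  𝟘 𝟙 : SP n m
  𝟘 = []
  𝟙 = constSP (+ 1)
  ⊟ : SP n m → SP n m
  ⊟ = -SP_

  -- The ring laws.  Left congruence and associativity of ⊠ come from coeff-*SP;
  -- right congruence needs supercommutativity and is proved below (*-congʳ).
  +-cong : ∀ {p p' q q'} → p ≈ p' → q ≈ q' → p ⊞ q ≈ p' ⊞ q'
  +-cong {p} {p'} {q} {q'} e f = ≈i λ M → trans (coeff-++ p q M) (trans (cong₂ _+_ (≈e e M) (≈e f M)) (sym (coeff-++ p' q' M)))

  +-comm : ∀ p q → p ⊞ q ≈ q ⊞ p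
  +-comm p q = ≈i λ M → trans (coeff-++ p q M) (trans (ℤP.+-comm (coeff p M) (coeff q M)) (sym (coeff-++ q p M)))

  +-assoc : ∀ p q r → (p ⊞ q) ⊞ r ≈ p ⊞ (q ⊞ r)
  +-assoc p q r = ≡⇒≈ (LP.++-assoc p q r)

  +-idʳ : ∀ p → p ⊞ 𝟘 ≈ p
  +-idʳ p = ≡⇒≈ (LP.++-identityʳ p)

  *-congˡ : ∀ {p p'} q → p ≈ p' → p ⊠ q ≈ p' ⊠ q
  *-congˡ {p} {p'} q e = ≈i λ M → trans (coeff-*SP p q M) (trans (mulR-cong q (≈e e) M) (sym (coeff-*SP p' q M)))

  *-assoc : ∀ p q r → (p ⊠ q) ⊠ r ≈ p ⊠ (q ⊠ r)
  *-assoc p q r = ≈i λ M → trans (coeff-*SP (p ⊠ q) r M) (trans (mulR-cong r (coeff-*SP p q) M) (trans (sym (mulR-* q r (coeff p) M)) (sym (coeff-*SP p (q ⊠ r) M))))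

  distribˡ : ∀ p q r → p ⊠ (q ⊞ r) ≈ p ⊠ q ⊞ p ⊠ r
  distribˡ p q r = ≈i λ M → trans (coeff-*SP p (q ⊞ r) M) (trans (mulR-++ q r (coeff p) M) (trans (cong₂ _+_ (sym (coeff-*SP p q M)) (sym (coeff-*SP p r M))) (sym (coeff-++ (p ⊠ q) (p ⊠ r) M))))

  distribʳ : ∀ p q r → (p ⊞ q) ⊠ r ≈ p ⊠ r ⊞ q ⊠ r
  distribʳ p q r = ≈i λ M → trans (coeff-*SP (p ⊞ q) r M) (trans (mulR-cong r (coeff-++ p q) M) (trans (mulR-⊕ r (coeff p) (coeff q) M) (trans (cong₂ _+_ (sym (coeff-*SP p r M)) (sym (coeff-*SP q r M))) (sym (coeff-++ (p ⊠ r) (q ⊠ r) M)))))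

  zeroˡ : ∀ p → 𝟘 ⊠ p ≈ 𝟘
  zeroˡ p = ≈-refl
  zeroʳ : ∀ p → p ⊠ 𝟘 ≈ 𝟘
  zeroʳ p = ≈i λ M → coeff-*SP p [] M

  coeff-𝟙 : coeff 𝟙 ≗ coeffOne
  coeff-𝟙 M = trans (ℤP.+-identityʳ _) (ℤP.*-identityˡ _)

  *-idˡ : ∀ p → 𝟙 ⊠ p ≈ p
  *-idˡ p = ≈i λ M → trans (coeff-*SP 𝟙 p M) (trans (mulR-cong p coeff-𝟙 M) (sym (coeff-mulR p M)))
  *-idʳ : ∀ p → p ⊠ 𝟙 ≈ p
  *-idʳ p = ≈i λ M → trans (coeff-*SP p 𝟙 M) (trans (ℤP.+-identityʳ _) (ℤP.*-identityˡ _))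

  comm-even : ∀ p q → EvenSP p → p ⊠ q ≈ q ⊠ p
  comm-even p q ep = ≈i λ M → trans (coeff-*SP p q M) (trans (mulR-cong q (coeff-mulR p) M) (trans (mulR-comm-even p q coeffOne ep M)
     (trans (mulR-cong p (λ M' → sym (coeff-mulR q M')) M) (sym (coeff-*SP q p M)))))

  comm-odd : ∀ p q → OddSP p → p ⊠ q ≈ flipSP q ⊠ p
  comm-odd p q op = ≈i λ M → trans (coeff-*SP p q M) (trans (mulR-cong q (coeff-mulR p) M) (trans (mulR-comm-odd p q coeffOne op M)
     (trans (mulR-cong p (λ M' → sym (coeff-mulR (flipSP q) M')) M) (sym (coeff-*SP (flipSP q) p M)))))

  flip-cong : ∀ {p q} → p ≈ q → flipSP p ≈ flipSP q
  flip-cong {p} {q} e = ≈i λ M → trans (coeff-flip p M) (trans (cong (monSign M *_) (≈e e M)) (sym (coeff-flip q M)))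

  *-congʳ-even : ∀ p {q q'} → EvenSP p → q ≈ q' → p ⊠ q ≈ p ⊠ q'
  *-congʳ-even p {q} {q'} ep e = ≈-trans (comm-even p q ep) (≈-trans (*-congˡ p e) (≈-sym (comm-even p q' ep)))

  *-congʳ-odd : ∀ p {q q'} → OddSP p → q ≈ q' → p ⊠ q ≈ p ⊠ q'
  *-congʳ-odd p {q} {q'} op e = ≈-trans (comm-odd p q op) (≈-trans (*-congˡ p (flip-cong e)) (≈-sym (comm-odd p q' op)))

  coeff-scale : ∀ k (p : SP n m) M → coeff (scaleSP k p) M ≡ k * coeff p M
  coeff-scale k [] M = sym (ℤP.*-zeroʳ k)
  coeff-scale k ((c , w) ∷ p) M = trans (cong₂ _+_ (ℤP.*-assoc k c (coeffWord w M)) (coeff-scale k p M)) (sym (ℤP.*-distribˡ-+ k (c * coeffWord w M) (coeff p M)))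

  scale-cong : ∀ k {p q} → p ≈ q → scaleSP k p ≈ scaleSP k q
  scale-cong k {p} {q} e = ≈i λ M → trans (coeff-scale k p M) (trans (cong (k *_) (≈e e M)) (sym (coeff-scale k q M)))

  scale-const : ∀ k p → scaleSP k p ≈ constSP k ⊠ p
  scale-const k p = ≈i λ M → trans (coeff-scale k p M) (trans (cong (k *_) (coeff-mulR p M)) (trans (sym (mulR-⊙ p k coeffOne M))
    (trans (mulR-cong p (λ M' → sym (trans (ℤP.+-identityʳ _) refl)) M) (sym (coeff-*SP (constSP k) p M)))))

parSign-++ : ∀ {n m} (u w : Word n m) → parSign (u ++ w) ≡ parSign u * parSign w
parSign-++ [] w = sym (ℤP.*-identityˡ _)
parSign-++ (g ∷ u) w = trans (cong (genSign g *_) (parSign-++ u w)) (sym (ℤP.*-assoc (genSign g) (parSign u) (parSign w)))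

module _ {n m : ℕ} where
  Hom-++ : ∀ {s} (p q : SP n m) → HomSP s p → HomSP s q → HomSP s (p ++ q)
  Hom-++ [] q hp hq = hq
  Hom-++ ((c , w) ∷ p) q (e , hp) hq = e , Hom-++ p q hp hq

  Hom-mapT : ∀ {s t} c (u : Word n m) q → parSign u ≡ s → HomSP t q → HomSP (s * t) (termMul c u q)
  Hom-mapT c u [] e hq = tt
  Hom-mapT c u ((c' , w) ∷ q) e (e' , hq) = trans (parSign-++ u w) (cong₂ _*_ e e') , Hom-mapT c u q e hq

  Hom-* : ∀ {s t} (p q : SP n m) → HomSP s p → HomSP t q → HomSP (s * t) (p ⊠ q)
  Hom-* [] q hp hq = tt
  Hom-* ((c , u) ∷ p) q (e , hp) hq = Hom-++ (termMul c u q) (p ⊠ q) (Hom-mapT c u q e hq) (Hom-* p q hp hq)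

  Hom-scale : ∀ {s} k (p : SP n m) → HomSP s p → HomSP s (scaleSP k p)
  Hom-scale k [] hp = tt
  Hom-scale k ((c , w) ∷ p) (e , hp) = e , Hom-scale k p hp

  Hom-flip : ∀ {s} (p : SP n m) → HomSP s p → HomSP s (flipSP p)
  Hom-flip [] hp = tt
  Hom-flip ((c , w) ∷ p) (e , hp) = e , Hom-flip p hp

  Hom-subst : ∀ {s t} (p : SP n m) → s ≡ t → HomSP s p → HomSP t p
  Hom-subst p refl h = h

  mulR-scale : ∀ k (q : SP n m) f → mulR (scaleSP k q) f ≗ (k ⊙ mulR q f)
  mulR-scale k [] f M = sym (ℤP.*-zeroʳ k)
  mulR-scale k ((c , w) ∷ q) f M = trans (cong₂ _+_ (ℤP.*-assoc k c (divWord w f M)) (mulR-scale k q f M)) (sym (ℤP.*-distribˡ-+ k (c * divWord w f M) (mulR q f M)))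

  scale-*ˡ : ∀ k (p q : SP n m) → scaleSP k p ⊠ q ≈ scaleSP k (p ⊠ q)
  scale-*ˡ k p q = ≈i λ M → trans (coeff-*SP (scaleSP k p) q M) (trans (mulR-cong q (coeff-scale k p) M) (trans (mulR-⊙ q k (coeff p) M)
      (trans (cong (k *_) (sym (coeff-*SP p q M))) (sym (coeff-scale k (p ⊠ q) M)))))

  scale-*ʳ : ∀ k (p q : SP n m) → p ⊠ scaleSP k q ≈ scaleSP k (p ⊠ q)
  scale-*ʳ k p q = ≈i λ M → trans (coeff-*SP p (scaleSP k q) M) (trans (mulR-scale k q (coeff p) M)
      (trans (cong (k *_) (sym (coeff-*SP p q M))) (sym (coeff-scale k (p ⊠ q) M))))

  scale-scale : ∀ a b (p : SP n m) → scaleSP a (scaleSP b p) ≈ scaleSP (a * b) p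
  scale-scale a b p = ≈i λ M → trans (coeff-scale a (scaleSP b p) M) (trans (cong (a *_) (coeff-scale b p M))
     (trans (sym (ℤP.*-assoc a b (coeff p M))) (sym (coeff-scale (a * b) p M))))

  scale-+ : ∀ k (p q : SP n m) → scaleSP k (p ⊞ q) ≈ scaleSP k p ⊞ scaleSP k q
  scale-+ k p q = ≡⇒≈ (LP.map-++ _ p q)

  scale-1 : ∀ (p : SP n m) → scaleSP (+ 1) p ≈ p
  scale-1 p = ≈i λ M → trans (coeff-scale (+ 1) p M) (ℤP.*-identityˡ _)

  scale-0 : ∀ (p : SP n m) → scaleSP (+ 0) p ≈ 𝟘
  scale-0 p = ≈i λ M → coeff-scale (+ 0) p M

  scale-distr : ∀ a b (p : SP n m) → scaleSP (a + b) p ≈ scaleSP a p ⊞ scaleSP b p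
  scale-distr a b p = ≈i λ M → trans (coeff-scale (a + b) p M) (trans (ℤP.*-distribʳ-+ (coeff p M) a b)
     (trans (cong₂ _+_ (sym (coeff-scale a p M)) (sym (coeff-scale b p M))) (sym (coeff-++ (scaleSP a p) (scaleSP b p) M))))

  flip-hom : ∀ {s} (p : SP n m) → HomSP s p → flipSP p ≈ scaleSP s p
  flip-hom [] hp = ≈-refl
  flip-hom ((c , w) ∷ p) (e , hp) = ≈i λ M → cong₂ _+_ (cong (λ z → z * c * coeffWord w M) e) (≈e (flip-hom p hp) M)

  ⊞-shuffle : ∀ (a b c d : SP n m) → (a ⊞ b) ⊞ (c ⊞ d) ≈ (a ⊞ c) ⊞ (b ⊞ d)
  ⊞-shuffle a b c d = ≈-trans (+-assoc a b (c ⊞ d)) (≈-trans (+-cong (≈-refl {p = a}) (≈-trans (≈-sym (+-assoc b c d))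
    (≈-trans (+-cong (+-comm b c) (≈-refl {p = d})) (+-assoc c b d)))) (≈-sym (+-assoc a c (b ⊞ d))))

  ⊟-cong : ∀ {p q : SP n m} → p ≈ q → ⊟ p ≈ ⊟ q
  ⊟-cong = scale-cong (- (+ 1))

  coeff-⊟ : ∀ (p : SP n m) M → coeff (⊟ p) M ≡ - coeff p M
  coeff-⊟ p M = trans (coeff-scale (- (+ 1)) p M) (ℤP.-1*i≡-i (coeff p M))

module _ {n m : ℕ} where
  termSP : ℤ → Word n m → SP n m
  termSP c u = (c , u) ∷ []
  wordSP : Word n m → SP n m
  wordSP u = termSP (+ 1) u

  headSP : Gen n m → Word n m → SP n m
  headSP (x i) w = wordSP (dx i ∷ w)
  headSP (ξ a) w = wordSP (dξ a ∷ w)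
  headSP (dx _) w = []
  headSP (dξ _) w = []

  genTerm-* : ∀ k (g : Gen n m) (X : SP n m) → termSP k (g ∷ []) ⊠ X ≈ List.map (λ { (c , w) → (k * c , g ∷ w) }) X
  genTerm-* k g X = ≡⇒≈ (trans (LP.++-identityʳ _) (LP.map-cong (λ { (c , w) → refl }) X))

  dWord-∷ : ∀ (g : Gen n m) w → dWord (g ∷ w) ≈ headSP g w ⊞ termSP (genSign g) (g ∷ []) ⊠ dWord w
  dWord-∷ (x i) w = +-cong {p = wordSP (dx i ∷ w)} {p' = wordSP (dx i ∷ w)} ≈-refl (≈-sym (≈-trans (genTerm-* (genSign {n} {m} (x i)) (x i) (dWord w)) (≡⇒≈ (LP.map-cong (λ { (c , w) → refl }) (dWord w)))))
  dWord-∷ (ξ a) w = +-cong {p = wordSP (dξ a ∷ w)} {p' = wordSP (dξ a ∷ w)} ≈-refl (≈-sym (≈-trans (genTerm-* (genSign {n} {m} (ξ a)) (ξ a) (dWord w)) (≡⇒≈ (LP.map-cong (λ { (c , w) → refl }) (dWord w)))))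
  dWord-∷ (dx i) w = ≈-sym (≈-trans (genTerm-* (genSign {n} {m} (dx i)) (dx i) (dWord w)) (≡⇒≈ (LP.map-cong (λ { (c , w) → refl }) (dWord w))))
  dWord-∷ (dξ a) w = ≈-sym (≈-trans (genTerm-* (genSign {n} {m} (dξ a)) (dξ a) (dWord w)) (≡⇒≈ (LP.map-cong (λ { (c , w) → refl }) (dWord w))))

  head-++ : ∀ (g : Gen n m) u w → headSP g (u ++ w) ≈ headSP g u ⊠ wordSP w
  head-++ (x i) u w = ≈i λ M → refl
  head-++ (ξ a) u w = ≈i λ M → refl
  head-++ (dx i) u w = ≈-refl
  head-++ (dξ a) u w = ≈-refl

  tt-++ : ∀ a b (u w : Word n m) → termSP a u ⊠ termSP b w ≈ termSP (a * b) (u ++ w)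
  tt-++ a b u w = ≈-refl

  termMul-termSP : ∀ c (u : Word n m) q → termMul c u q ≈ termSP c u ⊠ q
  termMul-termSP c u q = ≡⇒≈ (sym (LP.++-identityʳ _))

  *-congʳ-t : ∀ c (u : Word n m) {q q'} → q ≈ q' → termSP c u ⊠ q ≈ termSP c u ⊠ q'
  *-congʳ-t c u {q} {q'} e = by-parity (IsSign-parSign u) refl
    where
    by-parity : ∀ {s} → IsSign s → parSign u ≡ s → termSP c u ⊠ q ≈ termSP c u ⊠ q'
    by-parity p1 eq = *-congʳ-even (termSP c u) (eq , tt) e
    by-parity m1 eq = *-congʳ-odd (termSP c u) (eq , tt) e

  -- Right congruence of ⊠: a term is homogeneous, so it can be moved to the right
  -- by supercommutativity, where left congruence applies.
  *-congʳ : ∀ (p : SP n m) {q q'} → q ≈ q' → p ⊠ q ≈ p ⊠ q'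
  *-congʳ [] e = ≈-refl
  *-congʳ ((c , u) ∷ p) {q} {q'} e = +-cong (≈-trans (termMul-termSP c u q) (≈-trans (*-congʳ-t c u e) (≈-sym (termMul-termSP c u q')))) (*-congʳ p e)

  *-cong : ∀ {p p' q q' : SP n m} → p ≈ p' → q ≈ q' → p ⊠ q ≈ p' ⊠ q'
  *-cong {p} {p'} {q} {q'} e f = ≈-trans (*-congˡ q e) (*-congʳ p' f)

  dWord-++ : ∀ (u w : Word n m) → dWord (u ++ w) ≈ dWord u ⊠ wordSP w ⊞ termSP (parSign u) u ⊠ dWord w
  dWord-++ [] w = ≈-sym (*-idˡ (dWord w))
  dWord-++ (g ∷ u) w =
    let tg = termSP (genSign g) (g ∷ []) in
    ≈-trans (dWord-∷ g (u ++ w))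
    (≈-trans (+-cong (head-++ g u w) (≈-trans (*-congʳ tg (dWord-++ u w)) (distribˡ tg (dWord u ⊠ wordSP w) (termSP (parSign u) u ⊠ dWord w))))
    (≈-trans (+-cong (≈-refl {p = headSP g u ⊠ wordSP w}) (+-cong (≈-sym (*-assoc tg (dWord u) (wordSP w))) (≈-trans (≈-sym (*-assoc tg (termSP (parSign u) u) (dWord w))) (*-congˡ (dWord w) (tt-++ (genSign g) (parSign u) (g ∷ []) u)))))
    (≈-trans (≈-sym (+-assoc (headSP g u ⊠ wordSP w) ((tg ⊠ dWord u) ⊠ wordSP w) (termSP (parSign (g ∷ u)) (g ∷ u) ⊠ dWord w)))
    (+-cong (≈-trans (≈-sym (distribʳ (headSP g u) (tg ⊠ dWord u) (wordSP w))) (*-congˡ (wordSP w) (≈-sym (dWord-∷ g u)))) ≈-refl))))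

  dSP-++ : ∀ (p q : SP n m) → dSP (p ⊞ q) ≈ dSP p ⊞ dSP q
  dSP-++ p q = ≡⇒≈ (LP.concatMap-++ _ p q)

  t-scale : ∀ c (u : Word n m) → termSP c u ≈ scaleSP c (wordSP u)
  t-scale c u = ≈i λ M → cong (λ z → z * coeffWord u M + + 0) (sym (ℤP.*-identityʳ c))

  scale-** : ∀ a b (X W : SP n m) → scaleSP a X ⊠ scaleSP b W ≈ scaleSP (a * b) (X ⊠ W)
  scale-** a b X W = ≈-trans (scale-*ˡ a X (scaleSP b W)) (≈-trans (scale-cong a (scale-*ʳ b X W)) (scale-scale a b (X ⊠ W)))

  dSP-termMul : ∀ c (u : Word n m) q → dSP (termMul c u q) ≈ scaleSP c (dWord u) ⊠ q ⊞ termSP (parSign u * c) u ⊠ dSP q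
  dSP-termMul c u [] = ≈-sym (+-cong (zeroʳ (scaleSP c (dWord u))) (zeroʳ (termSP (parSign u * c) u)))
  dSP-termMul c u ((c' , w) ∷ q) =
    let X = scaleSP c (dWord u)
        T = termSP (parSign u * c) u
        A1 = scaleSP (c * c') (dWord u ⊠ wordSP w)
        A2 = scaleSP (c * c') (termSP (parSign u) u ⊠ dWord w)
        B1 : A1 ≈ X ⊠ termSP c' w
        B1 = ≈-sym (≈-trans (*-congʳ X (t-scale c' w)) (scale-** c c' (dWord u) (wordSP w)))
        Tsc : T ≈ scaleSP c (termSP (parSign u) u)
        Tsc = ≈i λ M → cong (λ z → z * coeffWord u M + + 0) (ℤP.*-comm (parSign u) c)
        B2 : A2 ≈ T ⊠ scaleSP c' (dWord w)
        B2 = ≈-sym (≈-trans (*-congˡ (scaleSP c' (dWord w)) Tsc) (scale-** c c' (termSP (parSign u) u) (dWord w)))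
    in
    ≈-trans (+-cong (≈-trans (scale-cong (c * c') (dWord-++ u w)) (scale-+ (c * c') (dWord u ⊠ wordSP w) (termSP (parSign u) u ⊠ dWord w))) (dSP-termMul c u q))
    (≈-trans (+-cong (+-cong B1 B2) ≈-refl)
    (≈-trans (⊞-shuffle (X ⊠ termSP c' w) (T ⊠ scaleSP c' (dWord w)) (X ⊠ q) (T ⊠ dSP q))
    (+-cong (≈-sym (distribˡ X (termSP c' w) q)) (≈-sym (distribˡ T (scaleSP c' (dWord w)) (dSP q))))))

  leibniz : ∀ (p q : SP n m) → dSP (p ⊠ q) ≈ dSP p ⊠ q ⊞ flipSP p ⊠ dSP q
  leibniz [] q = ≈-refl
  leibniz ((c , u) ∷ p) q =
    ≈-trans (dSP-++ (termMul c u q) (p ⊠ q))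
    (≈-trans (+-cong (dSP-termMul c u q) (leibniz p q))
    (≈-trans (⊞-shuffle (scaleSP c (dWord u) ⊠ q) (termSP (parSign u * c) u ⊠ dSP q) (dSP p ⊠ q) (flipSP p ⊠ dSP q))
    (+-cong (≈-sym (distribʳ (scaleSP c (dWord u)) (dSP p) q)) (≈-sym (distribʳ (termSP (parSign u * c) u) (flipSP p) (dSP q))))))

  Hom-map-g : ∀ {s} k (g : Gen n m) (X : SP n m) → HomSP s X → HomSP (genSign g * s) (List.map (λ { (c , w) → (k * c , g ∷ w) }) X)
  Hom-map-g k g [] h = tt
  Hom-map-g k g ((c , w) ∷ X) (e , h) = cong (genSign g *_) e , Hom-map-g k g X h

  Hom-dWord : ∀ (w : Word n m) → HomSP (- parSign w) (dWord w)
  Hom-dWord [] = tt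
  Hom-dWord (x i ∷ w) = (trans (ℤP.-1*i≡-i (parSign w)) (cong -_ (sym (ℤP.*-identityˡ (parSign w))))) ,
     Hom-subst _ (sym (ℤP.neg-distribʳ-* (genSign {n} {m} (x i)) (parSign w))) (Hom-map-g (+ 1) (x i) (dWord w) (Hom-dWord w))
  Hom-dWord (ξ a ∷ w) = (trans (ℤP.*-identityˡ (parSign w)) (trans (sym (ℤP.neg-involutive (parSign w))) (cong -_ (sym (ℤP.-1*i≡-i (parSign w)))))) ,
     Hom-subst _ (sym (ℤP.neg-distribʳ-* (genSign {n} {m} (ξ a)) (parSign w))) (Hom-map-g (- (+ 1)) (ξ a) (dWord w) (Hom-dWord w))
  Hom-dWord (dx i ∷ w) = Hom-subst _ (sym (ℤP.neg-distribʳ-* (genSign {n} {m} (dx i)) (parSign w))) (Hom-map-g (- (+ 1)) (dx i) (dWord w) (Hom-dWord w))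
  Hom-dWord (dξ a ∷ w) = Hom-subst _ (sym (ℤP.neg-distribʳ-* (genSign {n} {m} (dξ a)) (parSign w))) (Hom-map-g (+ 1) (dξ a) (dWord w) (Hom-dWord w))

  Hom-dSP : ∀ {s} (p : SP n m) → HomSP s p → HomSP (- s) (dSP p)
  Hom-dSP [] h = tt
  Hom-dSP ((c , w) ∷ p) (e , h) = Hom-++ (scaleSP c (dWord w)) (dSP p) (Hom-scale c (dWord w) (Hom-subst _ (cong -_ e) (Hom-dWord w))) (Hom-dSP p h)

-- Atoms are
-- homogeneous forms tagged with their parity (true = odd); a monomial is a
-- sorted list of atoms, where sorting introduces the supercommutation signs and
-- a repeated odd atom gives 0.  Two expressions with equal normal forms denote
-- equal forms (solve); solveVia first rewrites the atoms into expressions over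
-- other atoms (used to unfold composite atoms such as R or D).
paritySign : Bool → ℤ
paritySign true = - (+ 1)
paritySign false = + 1

data Order : Set where
  LT EQ GT : Order

cmpF : ∀ {N} → Fin N → Fin N → Order
cmpF zero zero = EQ
cmpF zero (suc _) = LT
cmpF (suc _) zero = GT
cmpF (suc i) (suc j) = cmpF i j

cmpF-eq : ∀ {N} (i j : Fin N) → cmpF i j ≡ EQ → i ≡ j
cmpF-eq zero zero e = refl
cmpF-eq zero (suc j) ()
cmpF-eq (suc i) zero ()
cmpF-eq (suc i) (suc j) e = cong suc (cmpF-eq i j e)

cmpM : ∀ {N} → List (Fin N) → List (Fin N) → Order
cmpM [] [] = EQ
cmpM [] (_ ∷ _) = LT
cmpM (_ ∷ _) [] = GT
cmpM (i ∷ a) (j ∷ b) with cmpF i j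
... | LT = LT
... | GT = GT
... | EQ = cmpM a b

cmpM-eq : ∀ {N} (a b : List (Fin N)) → cmpM a b ≡ EQ → a ≡ b
cmpM-eq [] [] e = refl
cmpM-eq [] (_ ∷ _) ()
cmpM-eq (_ ∷ _) [] ()
cmpM-eq (i ∷ a) (j ∷ b) e with cmpF i j in c
... | EQ = cong₂ _∷_ (cmpF-eq i j c) (cmpM-eq a b e)

data Expr (N : ℕ) : Set where
  atom : Fin N → Expr N
  con : ℤ → Expr N
  _:+_ _:*_ : Expr N → Expr N → Expr N
  :-_ : Expr N → Expr N
  nil : Expr N

infixl 6 _:+_
infixl 7 _:*_

Atom : ℕ → ℕ → Set
Atom n m = Σ (SP n m) λ p → Σ Bool λ b → HomSP (paritySign b) p

module Solver {n m N : ℕ} (ρ : Vec (Atom n m) N) where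
  at : Fin N → SP n m
  at i = proj₁ (lookup ρ i)
  pa : Fin N → Bool
  pa i = proj₁ (proj₂ (lookup ρ i))
  ho : ∀ i → HomSP (paritySign (pa i)) (at i)
  ho i = proj₂ (proj₂ (lookup ρ i))

  ⟦_⟧ : Expr N → SP n m
  ⟦ atom i ⟧ = at i
  ⟦ con c ⟧ = constSP c
  ⟦ e :+ f ⟧ = ⟦ e ⟧ ⊞ ⟦ f ⟧
  ⟦ e :* f ⟧ = ⟦ e ⟧ ⊠ ⟦ f ⟧
  ⟦ :- e ⟧ = ⊟ ⟦ e ⟧
  ⟦ nil ⟧ = 𝟘

  Mono = List (Fin N)
  Poly = List (ℤ × Mono)

  ⟦_⟧M : Mono → SP n m
  ⟦ [] ⟧M = 𝟙
  ⟦ i ∷ mo ⟧M = at i ⊠ ⟦ mo ⟧M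

  ⟦_⟧P : Poly → SP n m
  ⟦ [] ⟧P = 𝟘
  ⟦ (c , mo) ∷ p ⟧P = scaleSP c ⟦ mo ⟧M ⊞ ⟦ p ⟧P

  σ : Fin N → Fin N → ℤ
  σ i j = if pa i then (if pa j then - (+ 1) else + 1) else + 1

  insertAtom : Fin N → Mono → ℤ × Mono
  insertAtom i [] = + 1 , i ∷ []
  insertAtom i (j ∷ mo) with cmpF i j
  ... | LT = + 1 , i ∷ j ∷ mo
  ... | EQ = if pa i then (+ 0 , []) else (+ 1 , i ∷ j ∷ mo)
  ... | GT = let (s , mo') = insertAtom i mo in (σ i j * s , j ∷ mo')

  mulMono : Mono → Mono → ℤ × Mono
  mulMono [] mo = + 1 , mo
  mulMono (i ∷ a) mo = let (s , mo') = mulMono a mo in let (t , mo'') = insertAtom i mo' in (s * t , mo'')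

  insertTerm′ : ℤ × Mono → Poly → Poly
  insertTerm′ (c , mo) [] = (c , mo) ∷ []
  insertTerm′ (c , mo) ((c' , mo') ∷ p) with cmpM mo mo'
  ... | LT = (c , mo) ∷ (c' , mo') ∷ p
  ... | GT = (c' , mo') ∷ insertTerm′ (c , mo) p
  ... | EQ with c + c' ℤ.≟ + 0
  ...   | yes _ = p
  ...   | no _ = (c + c' , mo') ∷ p

  insertTerm : ℤ × Mono → Poly → Poly
  insertTerm (c , mo) p with c ℤ.≟ + 0
  ... | yes _ = p
  ... | no _ = insertTerm′ (c , mo) p

  addP : Poly → Poly → Poly
  addP [] q = q
  addP (t ∷ p) q = insertTerm t (addP p q)

  mulT : ℤ × Mono → Poly → Poly
  mulT (c , mo) [] = []
  mulT (c , mo) ((c' , mo') ∷ q) = let (s , mo'') = mulMono mo mo' in insertTerm ((c * c') * s , mo'') (mulT (c , mo) q)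

  mulP : Poly → Poly → Poly
  mulP [] q = []
  mulP (t ∷ p) q = addP (mulT t q) (mulP p q)

  norm : Expr N → Poly
  norm (atom i) = (+ 1 , i ∷ []) ∷ []
  norm (con c) = (c , []) ∷ []
  norm (e :+ f) = addP (norm e) (norm f)
  norm (e :* f) = mulP (norm e) (norm f)
  norm (:- e) = mulP ((- (+ 1) , []) ∷ []) (norm e)
  norm nil = []

  odd-square : ∀ (p : SP n m) → OddSP p → p ⊠ p ≈ 𝟘
  odd-square p op = ≈i λ M → self-negative (coeff (p ⊠ p) M) (trans (≈e (comm-odd p p op) M) (trans (≈e (*-congˡ p (flip-hom p op)) M)
      (trans (≈e (scale-*ˡ (- (+ 1)) p p) M) (coeff-⊟ (p ⊠ p) M))))
    where self-negative : ∀ z → z ≡ - z → z ≡ + 0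
          self-negative (+ zero) e = refl
          self-negative (+ suc k) ()
          self-negative (ℤ.-[1+ k ]) ()

  atom-swap : ∀ i j (X : SP n m) → at i ⊠ (at j ⊠ X) ≈ scaleSP (σ i j) (at j ⊠ (at i ⊠ X))
  atom-swap i j X = ≈-trans (≈-sym (*-assoc (at i) (at j) X)) (≈-trans (*-congˡ X (core (pa i) (pa j) refl refl))
      (≈-trans (scale-*ˡ (σ i j) (at j ⊠ at i) X) (scale-cong (σ i j) (*-assoc (at j) (at i) X))))
    where
      core : ∀ bi bj → pa i ≡ bi → pa j ≡ bj → at i ⊠ at j ≈ scaleSP (σ i j) (at j ⊠ at i)
      core false bj ei ej rewrite ei = ≈-trans (comm-even (at i) (at j) (subst (λ b → HomSP (paritySign b) (at i)) ei (ho i))) (≈-sym (scale-1 _))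
      core true false ei ej rewrite ei | ej = ≈-trans (≈-sym (comm-even (at j) (at i) (subst (λ b → HomSP (paritySign b) (at j)) ej (ho j)))) (≈-sym (scale-1 _))
      core true true ei ej rewrite ei | ej = ≈-trans (comm-odd (at i) (at j) (subst (λ b → HomSP (paritySign b) (at i)) ei (ho i)))
         (≈-trans (*-congˡ (at i) (flip-hom (at j) (subst (λ b → HomSP (paritySign b) (at j)) ej (ho j)))) (scale-*ˡ (- (+ 1)) (at j) (at i)))

  insertAtom-sound : ∀ i (mo : Mono) → scaleSP (proj₁ (insertAtom i mo)) ⟦ proj₂ (insertAtom i mo) ⟧M ≈ at i ⊠ ⟦ mo ⟧M
  insertAtom-sound i [] = scale-1 _
  insertAtom-sound i (j ∷ mo) with cmpF i j in c
  ... | LT = scale-1 _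
  ... | GT = ≈-trans (≈-sym (scale-scale (σ i j) (proj₁ (insertAtom i mo)) (at j ⊠ ⟦ proj₂ (insertAtom i mo) ⟧M)))
             (≈-trans (scale-cong (σ i j) (≈-trans (≈-sym (scale-*ʳ (proj₁ (insertAtom i mo)) (at j) _)) (*-congʳ (at j) (insertAtom-sound i mo))))
             (≈-sym (atom-swap i j ⟦ mo ⟧M)))
  ... | EQ with cmpF-eq i j c
  ... | refl with pa i in e
  ...   | false = scale-1 _
  ...   | true = ≈-trans (scale-0 (𝟙 {n} {m})) (≈-sym (≈-trans (≈-sym (*-assoc (at i) (at i) ⟦ mo ⟧M))
              (≈-trans (*-congˡ ⟦ mo ⟧M (odd-square (at i) (subst (λ b → HomSP (paritySign b) (at i)) e (ho i)))) (zeroˡ ⟦ mo ⟧M))))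

  mulMono-sound : ∀ (a mo : Mono) → scaleSP (proj₁ (mulMono a mo)) ⟦ proj₂ (mulMono a mo) ⟧M ≈ ⟦ a ⟧M ⊠ ⟦ mo ⟧M
  mulMono-sound [] mo = ≈-trans (scale-1 _) (≈-sym (*-idˡ _))
  mulMono-sound (i ∷ a) mo =
    let s = proj₁ (mulMono a mo)
        mo' = proj₂ (mulMono a mo)
        t = proj₁ (insertAtom i mo')
        mo'' = proj₂ (insertAtom i mo') in
    ≈-trans (≈-sym (scale-scale s t ⟦ mo'' ⟧M))
    (≈-trans (scale-cong s (insertAtom-sound i mo'))
    (≈-trans (≈-sym (scale-*ʳ s (at i) ⟦ mo' ⟧M))
    (≈-trans (*-congʳ (at i) (mulMono-sound a mo)) (≈-sym (*-assoc (at i) ⟦ a ⟧M ⟦ mo ⟧M)))))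

  insertTerm′-sound : ∀ c (mo : Mono) (p : Poly) → ⟦ insertTerm′ (c , mo) p ⟧P ≈ scaleSP c ⟦ mo ⟧M ⊞ ⟦ p ⟧P
  insertTerm′-sound c mo [] = ≈-refl
  insertTerm′-sound c mo ((c' , mo') ∷ p) with cmpM mo mo' in cm
  ... | LT = ≈-refl
  ... | GT = ≈-trans (+-cong (≈-refl {p = scaleSP c' ⟦ mo' ⟧M}) (insertTerm′-sound c mo p))
             (≈-trans (≈-sym (+-assoc (scaleSP c' ⟦ mo' ⟧M) (scaleSP c ⟦ mo ⟧M) ⟦ p ⟧P))
             (≈-trans (+-cong (+-comm (scaleSP c' ⟦ mo' ⟧M) (scaleSP c ⟦ mo ⟧M)) ≈-refl) (+-assoc (scaleSP c ⟦ mo ⟧M) (scaleSP c' ⟦ mo' ⟧M) ⟦ p ⟧P)))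
  ... | EQ with cmpM-eq mo mo' cm
  ... | refl with c + c' ℤ.≟ + 0
  ...   | yes z = ≈-sym (≈-trans (≈-sym (+-assoc (scaleSP c ⟦ mo ⟧M) (scaleSP c' ⟦ mo ⟧M) ⟦ p ⟧P))
              (+-cong (≈-trans (≈-sym (scale-distr c c' ⟦ mo ⟧M)) (≈-trans (scale-cong' z) (scale-0 _))) ≈-refl))
    where scale-cong' : c + c' ≡ + 0 → scaleSP (c + c') ⟦ mo ⟧M ≈ scaleSP (+ 0) ⟦ mo ⟧M
          scale-cong' e rewrite e = ≈-refl
  ...   | no _ = ≈-trans (+-cong (scale-distr c c' ⟦ mo ⟧M) ≈-refl) (+-assoc (scaleSP c ⟦ mo ⟧M) (scaleSP c' ⟦ mo ⟧M) ⟦ p ⟧P)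

  insertTerm-sound : ∀ c (mo : Mono) (p : Poly) → ⟦ insertTerm (c , mo) p ⟧P ≈ scaleSP c ⟦ mo ⟧M ⊞ ⟦ p ⟧P
  insertTerm-sound c mo p with c ℤ.≟ + 0
  ... | yes refl = ≈-sym (+-cong {q = ⟦ p ⟧P} {q' = ⟦ p ⟧P} (scale-0 ⟦ mo ⟧M) ≈-refl)
  ... | no _ = insertTerm′-sound c mo p

  addP-sound : ∀ (p q : Poly) → ⟦ addP p q ⟧P ≈ ⟦ p ⟧P ⊞ ⟦ q ⟧P
  addP-sound [] q = ≈-refl
  addP-sound ((c , mo) ∷ p) q = ≈-trans (insertTerm-sound c mo (addP p q)) (≈-trans (+-cong ≈-refl (addP-sound p q)) (≈-sym (+-assoc (scaleSP c ⟦ mo ⟧M) ⟦ p ⟧P ⟦ q ⟧P)))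

  mulT-sound : ∀ c (mo : Mono) (q : Poly) → ⟦ mulT (c , mo) q ⟧P ≈ scaleSP c ⟦ mo ⟧M ⊠ ⟦ q ⟧P
  mulT-sound c mo [] = ≈-sym (zeroʳ (scaleSP c ⟦ mo ⟧M))
  mulT-sound c mo ((c' , mo') ∷ q) =
    let s = proj₁ (mulMono mo mo')
        mo'' = proj₂ (mulMono mo mo') in
    ≈-trans (insertTerm-sound ((c * c') * s) mo'' (mulT (c , mo) q))
    (≈-trans (+-cong (≈-trans (≈-sym (scale-scale (c * c') s ⟦ mo'' ⟧M)) (≈-trans (scale-cong (c * c') (mulMono-sound mo mo'))
                (≈-sym (scale-** c c' ⟦ mo ⟧M ⟦ mo' ⟧M)))) (mulT-sound c mo q))
      (≈-sym (distribˡ (scaleSP c ⟦ mo ⟧M) (scaleSP c' ⟦ mo' ⟧M) ⟦ q ⟧P)))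

  mulP-sound : ∀ (p q : Poly) → ⟦ mulP p q ⟧P ≈ ⟦ p ⟧P ⊠ ⟦ q ⟧P
  mulP-sound [] q = ≈-refl
  mulP-sound ((c , mo) ∷ p) q = ≈-trans (addP-sound (mulT (c , mo) q) (mulP p q))
    (≈-trans (+-cong (mulT-sound c mo q) (mulP-sound p q)) (≈-sym (distribʳ (scaleSP c ⟦ mo ⟧M) ⟦ p ⟧P ⟦ q ⟧P)))

  norm-sound : ∀ (e : Expr N) → ⟦ norm e ⟧P ≈ ⟦ e ⟧
  norm-sound (atom i) = ≈-trans (+-idʳ _) (≈-trans (scale-1 _) (*-idʳ _))
  norm-sound (con c) = ≈i λ M → cong (λ z → z * coeffWord [] M + + 0) (ℤP.*-identityʳ c)
  norm-sound (e :+ f) = ≈-trans (addP-sound (norm e) (norm f)) (+-cong (norm-sound e) (norm-sound f))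
  norm-sound (e :* f) = ≈-trans (mulP-sound (norm e) (norm f)) (*-cong (norm-sound e) (norm-sound f))
  norm-sound (:- e) = ≈-trans (mulP-sound ((- (+ 1) , []) ∷ []) (norm e))
     (≈-trans (*-cong (norm-sound (con (- (+ 1)))) (norm-sound e))
       (≈-sym (scale-const (- (+ 1)) ⟦ e ⟧)))
  norm-sound nil = ≈-refl

  solve : ∀ (e1 e2 : Expr N) → norm e1 ≡ norm e2 → ⟦ e1 ⟧ ≈ ⟦ e2 ⟧
  solve e1 e2 eq = ≈-trans (≈-sym (norm-sound e1)) (≈-trans (≡⇒≈ (cong ⟦_⟧P eq)) (norm-sound e2))

module Subst {n m N N' : ℕ} (ρ : Vec (Atom n m) N) (ρ' : Vec (Atom n m) N') (σ' : Fin N → Expr N')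
             (h : ∀ i → Solver.at ρ i ≈ Solver.⟦_⟧ ρ' (σ' i)) where
  open Solver ρ using () renaming (⟦_⟧ to ⟦_⟧₁)
  open Solver ρ' using () renaming (⟦_⟧ to ⟦_⟧₂)

  subE : Expr N → Expr N'
  subE (atom i) = σ' i
  subE (con c) = con c
  subE (e :+ f) = subE e :+ subE f
  subE (e :* f) = subE e :* subE f
  subE (:- e) = :- subE e
  subE nil = nil

  subE-sound : ∀ e → ⟦ e ⟧₁ ≈ ⟦ subE e ⟧₂
  subE-sound (atom i) = h i
  subE-sound (con c) = ≈-refl
  subE-sound (e :+ f) = +-cong (subE-sound e) (subE-sound f)
  subE-sound (e :* f) = *-cong (subE-sound e) (subE-sound f)
  subE-sound (:- e) = ⊟-cong (subE-sound e)
  subE-sound nil = ≈-refl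

module _ {n m N' : ℕ} (ρ' : Vec (Atom n m) N') where
  infixr 5 _∷s_
  data AtomSubst : ∀ {N} → Vec (Atom n m) N → Vec (Expr N') N → Set where
    []s : AtomSubst Vec.[] Vec.[]
    _∷s_ : ∀ {N} {a : Atom n m} {e : Expr N'} {ρ : Vec (Atom n m) N} {σv : Vec (Expr N') N} →
           proj₁ a ≈ Solver.⟦_⟧ ρ' e → AtomSubst ρ σv → AtomSubst (a Vec.∷ ρ) (e Vec.∷ σv)

  subL-h : ∀ {N} {ρ : Vec (Atom n m) N} {σv : Vec (Expr N') N} → AtomSubst ρ σv → ∀ i → Solver.at ρ i ≈ Solver.⟦_⟧ ρ' (lookup σv i)
  subL-h (h ∷s s) zero = h
  subL-h (h ∷s s) (suc i) = subL-h s i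

  solveVia : ∀ {N} (ρ : Vec (Atom n m) N) (σv : Vec (Expr N') N) (s : AtomSubst ρ σv) → ∀ (e1 e2 : Expr N) →
         Solver.norm ρ' (Subst.subE ρ ρ' (lookup σv) (subL-h s) e1) ≡ Solver.norm ρ' (Subst.subE ρ ρ' (lookup σv) (subL-h s) e2) →
         Solver.⟦_⟧ ρ e1 ≈ Solver.⟦_⟧ ρ e2
  solveVia ρ σv s e1 e2 eq = ≈-trans (Subst.subE-sound ρ ρ' (lookup σv) (subL-h s) e1)
    (≈-trans (Solver.solve ρ' (Subst.subE ρ ρ' (lookup σv) (subL-h s) e1) (Subst.subE ρ ρ' (lookup σv) (subL-h s) e2) eq) (≈-sym (Subst.subE-sound ρ ρ' (lookup σv) (subL-h s) e2)))

==-suc : ∀ {k} (l i : Fin k) → (suc l == suc i) ≡ (l == i)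
==-suc l i with l Fin.≟ i
... | yes p = refl
... | no p = refl

==-refl : ∀ {k} (i : Fin k) → (i == i) ≡ true
==-refl i with i Fin.≟ i
... | yes p = refl
... | no p = ⊥-elim (p refl)

==-true : ∀ {k} {i j : Fin k} → (i == j) ≡ true → i ≡ j
==-true {k} {i} {j} e with i Fin.≟ j
... | yes p = p
==-true {k} {i} {j} () | no p

module _ {n m : ℕ} where
  ΣS : ∀ {k} → (Fin k → SP n m) → SP n m
  ΣS {zero} f = 𝟘
  ΣS {suc k} f = f zero ⊞ ΣS (f ∘ suc)

  Σ-cong : ∀ {k} {f g : Fin k → SP n m} → (∀ i → f i ≈ g i) → ΣS f ≈ ΣS g
  Σ-cong {zero} e = ≈-refl
  Σ-cong {suc k} e = +-cong (e zero) (Σ-cong (e ∘ suc))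

  Σ-+ : ∀ {k} (f g : Fin k → SP n m) → ΣS (λ i → f i ⊞ g i) ≈ ΣS f ⊞ ΣS g
  Σ-+ {zero} f g = ≈-refl
  Σ-+ {suc k} f g = ≈-trans (+-cong (≈-refl {p = f zero ⊞ g zero}) (Σ-+ (f ∘ suc) (g ∘ suc))) (⊞-shuffle (f zero) (g zero) (ΣS (f ∘ suc)) (ΣS (g ∘ suc)))

  Σ-⊠ˡ : ∀ {k} (a : SP n m) (f : Fin k → SP n m) → a ⊠ ΣS f ≈ ΣS (λ i → a ⊠ f i)
  Σ-⊠ˡ {zero} a f = zeroʳ a
  Σ-⊠ˡ {suc k} a f = ≈-trans (distribˡ a (f zero) (ΣS (f ∘ suc))) (+-cong ≈-refl (Σ-⊠ˡ a (f ∘ suc)))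

  Σ-⊠ʳ : ∀ {k} (a : SP n m) (f : Fin k → SP n m) → ΣS f ⊠ a ≈ ΣS (λ i → f i ⊠ a)
  Σ-⊠ʳ {zero} a f = ≈-refl
  Σ-⊠ʳ {suc k} a f = ≈-trans (distribʳ (f zero) (ΣS (f ∘ suc)) a) (+-cong ≈-refl (Σ-⊠ʳ a (f ∘ suc)))

  Σ-scale : ∀ {k} c (f : Fin k → SP n m) → scaleSP c (ΣS f) ≈ ΣS (λ i → scaleSP c (f i))
  Σ-scale {zero} c f = ≈-refl
  Σ-scale {suc k} c f = ≈-trans (scale-+ c (f zero) (ΣS (f ∘ suc))) (+-cong ≈-refl (Σ-scale c (f ∘ suc)))

  Σ-0 : ∀ {k} → ΣS {k} (λ _ → 𝟘) ≈ 𝟘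
  Σ-0 {zero} = ≈-refl
  Σ-0 {suc k} = Σ-0 {k}

  Σ-swap : ∀ {k l} (f : Fin k → Fin l → SP n m) → ΣS (λ i → ΣS (λ j → f i j)) ≈ ΣS (λ j → ΣS (λ i → f i j))
  Σ-swap {zero} {l} f = ≈-sym (Σ-0 {l})
  Σ-swap {suc k} {l} f = ≈-trans (+-cong (≈-refl {p = ΣS (f zero)}) (Σ-swap (f ∘ suc))) (≈-sym (Σ-+ (f zero) (λ j → ΣS (λ i → f (suc i) j))))

  Hom-Σ : ∀ {k s} (f : Fin k → SP n m) → (∀ i → HomSP s (f i)) → HomSP s (ΣS f)
  Hom-Σ {zero} f h = tt
  Hom-Σ {suc k} f h = Hom-++ (f zero) (ΣS (f ∘ suc)) (h zero) (Hom-Σ (f ∘ suc) (h ∘ suc))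

  Hom-prod : ∀ {k} (f : Fin k → SP n m) → (∀ i → EvenSP (f i)) → EvenSP (prodFinSP f)
  Hom-prod {zero} f h = refl , tt
  Hom-prod {suc k} f h = Hom-* (f zero) (prodFinSP (f ∘ suc)) (h zero) (Hom-prod (f ∘ suc) (h ∘ suc))

  Hom-pow : ∀ (p : SP n m) e → EvenSP p → EvenSP (powSP p e)
  Hom-pow p zero h = refl , tt
  Hom-pow p (suc e) h = Hom-* p (powSP p e) h (Hom-pow p e h)

  Cancellable : SP n m → Set
  Cancellable c = ∀ {a b : SP n m} → c ⊠ a ≈ c ⊠ b → a ≈ b

  Cancellable-𝟙 : Cancellable 𝟙
  Cancellable-𝟙 {a} {b} e = ≈-trans (≈-sym (*-idˡ a)) (≈-trans e (*-idˡ b))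

  Cancellable-⊠ : ∀ c d → Cancellable c → Cancellable d → Cancellable (c ⊠ d)
  Cancellable-⊠ c d kc kd {a} {b} e = kd (kc (≈-trans (≈-sym (*-assoc c d a)) (≈-trans e (*-assoc c d b))))

  coeff-*x : ∀ (a : SP n m) i M → coeff (a ⊠ genSP (x i)) M ≡ + 1 * divGen (evenG (i Fin.↑ˡ m)) (coeff a) M + + 0
  coeff-*x a i M = coeff-*SP a (genSP (x i)) M

  Cancellable-x : ∀ i → Cancellable (genSP {n} {m} (x i))
  Cancellable-x i {a} {b} e = ≈i λ { (nmon ev od) →
      let E = i Fin.↑ˡ m
          M⁺ = nmon (updateAt ev E suc) od
          e' = ≈e (≈-trans (≈-sym (comm-even (genSP (x i)) a (refl , tt))) (≈-trans e (comm-even (genSP (x i)) b (refl , tt)))) M⁺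
          h : ∀ (f : CoeffFn n m) → divGen (evenG E) f M⁺ ≡ f (nmon ev od)
          h f = trans (cong (λ z → ifPos z (f (nmon (updateAt (updateAt ev E suc) E ℕ.pred) od))) (upd-lookup ev E suc))
                   (cong (λ v → f (nmon v od)) (trans (upd-upd ev E ℕ.pred suc) (upd-id ev E _ refl)))
      in trans (sym (h (coeff a))) (trans (sym (trans (ℤP.+-identityʳ _) (ℤP.*-identityˡ _)))
           (trans (trans (sym (coeff-*x a i M⁺)) (trans e' (coeff-*x b i M⁺))) (trans (ℤP.+-identityʳ _) (trans (ℤP.*-identityˡ _) (h (coeff b)))))) }

  Cancellable-prod : ∀ {k} (f : Fin k → SP n m) → (∀ i → EvenSP (f i)) → (∀ i → Cancellable (f i)) → Cancellable (prodFinSP f)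
  Cancellable-prod {zero} f h k = Cancellable-𝟙
  Cancellable-prod {suc k} f h kk = Cancellable-⊠ (f zero) (prodFinSP (f ∘ suc)) (kk zero) (Cancellable-prod (f ∘ suc) (h ∘ suc) (kk ∘ suc))

  prod-cong : ∀ {k} {f g : Fin k → SP n m} → (∀ i → f i ≈ g i) → prodFinSP f ≈ prodFinSP g
  prod-cong {zero} e = ≈-refl
  prod-cong {suc k} e = *-cong (e zero) (prod-cong (e ∘ suc))

  prod-extract : ∀ {k} (h : Fin k → SP n m) → (∀ l → EvenSP (h l)) → ∀ i →
            h i ⊠ prodFinSP (λ l → if l == i then 𝟙 else h l) ≈ prodFinSP h
  prod-extract {suc k} h eh zero = *-congʳ (h zero) (*-idˡ _)
  prod-extract {suc k} h eh (suc i) =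
    let rest = prodFinSP (λ l → if suc l == suc i then 𝟙 else h (suc l)) in
    ≈-trans (≈-sym (*-assoc (h (suc i)) (h zero) rest))
    (≈-trans (*-congˡ rest (comm-even (h (suc i)) (h zero) (eh (suc i))))
    (≈-trans (*-assoc (h zero) (h (suc i)) rest)
    (*-congʳ (h zero) (≈-trans (*-congʳ (h (suc i)) (prod-cong (λ l → ≡⇒≈ (cong (λ b → if b then 𝟙 else h (suc l)) (==-suc l i)))))
       (prod-extract (h ∘ suc) (eh ∘ suc) i)))))

module _ {n m : ℕ} where
  interchange : ∀ (u v a b : SP n m) → EvenSP v → (u ⊠ v) ⊠ (a ⊠ b) ≈ (u ⊠ a) ⊠ (v ⊠ b)
  interchange u v a b ev = ≈-trans (*-assoc u v (a ⊠ b)) (≈-trans (*-congʳ u (≈-trans (≈-sym (*-assoc v a b))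
      (≈-trans (*-congˡ b (comm-even v a ev)) (*-assoc a v b)))) (≈-sym (*-assoc u a (v ⊠ b))))

  even-slide : ∀ (c a b : SP n m) → EvenSP c → c ⊠ (a ⊠ b) ≈ a ⊠ (c ⊠ b)
  even-slide c a b ec = ≈-trans (≈-sym (*-assoc c a b)) (≈-trans (*-congˡ b (comm-even c a ec)) (*-assoc a c b))

  infix 4 _⊒_
  -- Each summand of ω is reduced separately to a fraction over a fixed denominator.
  record _⊒_ (f g : Frac n m) : Set where
    constructor red
    field
      c1 c2 : SP n m
      ev1 : EvenSP c1
      kc1 : Cancellable c1
      ev2 : EvenSP c2
      nq : c1 ⊠ num f ≈ c2 ⊠ num g
      dq : c1 ⊠ den f ≈ c2 ⊠ den g
  open _⊒_

  ⊒-≋ : ∀ {f g : Frac n m} → num f ≈ num g → den f ≈ den g → f ⊒ g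
  ⊒-≋ {f} {g} a b = red 𝟙 𝟙 (refl , tt) Cancellable-𝟙 (refl , tt) (*-congʳ 𝟙 a) (*-congʳ 𝟙 b)

  ⊒-trans : ∀ {f g h : Frac n m} → f ⊒ g → g ⊒ h → f ⊒ h
  ⊒-trans {f} {g} {h} (red c1 c2 e1 k1 e2 nq dq) (red d1 d2 f1 l1 f2 nq' dq') =
    red (d1 ⊠ c1) (c2 ⊠ d2) (Hom-* d1 c1 f1 e1) (Cancellable-⊠ d1 c1 l1 k1) (Hom-* c2 d2 e2 f2) (step nq nq') (step dq dq')
    where
      step : ∀ {a b c} → c1 ⊠ a ≈ c2 ⊠ b → d1 ⊠ b ≈ d2 ⊠ c → (d1 ⊠ c1) ⊠ a ≈ (c2 ⊠ d2) ⊠ c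
      step {a} {b} {c} p q = ≈-trans (*-assoc d1 c1 a) (≈-trans (*-congʳ d1 p) (≈-trans (even-slide d1 c2 b f1)
                          (≈-trans (*-congʳ c2 q) (≈-sym (*-assoc c2 d2 c)))))

  ⊒-+ : ∀ {f f' g g' : Frac n m} → f ⊒ f' → g ⊒ g' → (f +F g) ⊒ (f' +F g')
  ⊒-+ {num₁ / den₁} {num₂ / den₂} {num₃ / den₃} {num₄ / den₄} (red c1 c2 e1 k1 e2 nq dq) (red d1 d2 f1 l1 f2 nq' dq') =
    red (c1 ⊠ d1) (c2 ⊠ d2) (Hom-* c1 d1 e1 f1) (Cancellable-⊠ c1 d1 k1 l1) (Hom-* c2 d2 e2 f2)
      (≈-trans (distribˡ (c1 ⊠ d1) (num₁ ⊠ den₃) (num₃ ⊠ den₁))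
      (≈-trans (+-cong (≈-trans (interchange c1 d1 num₁ den₃ f1) (≈-trans (*-cong nq dq') (≈-sym (interchange c2 d2 num₂ den₄ f2))))
                        (≈-trans (*-congˡ (num₃ ⊠ den₁) (comm-even c1 d1 e1)) (≈-trans (interchange d1 c1 num₃ den₁ e1)
                          (≈-trans (*-cong nq' dq) (≈-trans (≈-sym (interchange d2 c2 num₄ den₂ e2)) (*-congˡ (num₄ ⊠ den₂) (comm-even d2 c2 f2)))))))
      (≈-sym (distribˡ (c2 ⊠ d2) (num₂ ⊠ den₄) (num₄ ⊠ den₂)))))
      (≈-trans (interchange c1 d1 den₁ den₃ f1) (≈-trans (*-cong dq dq') (≈-sym (interchange c2 d2 den₂ den₄ f2))))

  ⊒-final : ∀ {L S G : Frac n m} → L ⊒ G → S ⊒ G → L ≈F S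
  ⊒-final {nL / dL} {nS / dS} {nG / dG} (red c1 c2 e1 k1 e2 nq dq) (red d1 d2 f1 l1 f2 nq' dq') =
    ≈e (Cancellable-⊠ c1 d1 k1 l1 (≈-trans (interchange c1 d1 nL dS f1) (≈-trans (*-cong nq dq')
       (≈-trans (≈-sym (interchange c2 d2 nG dG f2)) (≈-trans (*-congˡ (nG ⊠ dG) (comm-even c2 d2 e2)) (≈-trans (interchange d2 c2 nG dG e2)
       (≈-trans (*-cong (≈-sym nq') (≈-sym dq)) (≈-trans (≈-sym (interchange d1 c1 nS dL e1)) (*-congˡ (nS ⊠ dL) (comm-even d1 c1 f1))))))))))

  comm-even′ : ∀ (e a : SP n m) → EvenSP e → a ⊠ e ≈ e ⊠ a
  comm-even′ e a ee = ≈-sym (comm-even e a ee)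

  const0 : constSP {n} {m} (+ 0) ≈ 𝟘
  const0 = ≈i λ M → refl

-- A tagged numerator
-- (false , a) stands for a/Δ and (true , a) for a/(R·Δ); tagged numerators are
-- added without leaving these two denominators (⊕T-red, sum-red).  numer t is
-- the numerator of t over R·Δ; when R = 1, or when the numerator over R·Δ is
-- divisible by R, the sum reduces to a fraction over Δ (conv-one, conv-true).
module CommonDenominator {n m : ℕ} (R Δ : SP n m) (ER : EvenSP R) (EΔ : EvenSP Δ) (KΔ : Cancellable Δ) where
  Tagged : Set
  Tagged = Bool × SP n m

  ⟦_⟧T : Tagged → Frac n m
  ⟦ (false , a) ⟧T = a / Δ
  ⟦ (true , a) ⟧T = a / (R ⊠ Δ)

  _⊕T_ : Tagged → Tagged → Tagged
  (false , a) ⊕T (false , b) = false , a ⊞ b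
  (false , a) ⊕T (true , b) = true , R ⊠ a ⊞ b
  (true , a) ⊕T (false , b) = true , a ⊞ R ⊠ b
  (true , a) ⊕T (true , b) = true , a ⊞ b

  RΔ = R ⊠ Δ
  ERΔ : EvenSP RΔ
  ERΔ = Hom-* R Δ ER EΔ

  ev1 : EvenSP (𝟙 {n} {m})
  ev1 = refl , tt

  ⊕T-red : ∀ t t' → (⟦ t ⟧T +F ⟦ t' ⟧T) ⊒ ⟦ t ⊕T t' ⟧T
  ⊕T-red (false , a) (false , b) = red 𝟙 Δ ev1 Cancellable-𝟙 EΔ
     (≈-trans (*-idˡ _) (≈-trans (+-cong (comm-even′ Δ a EΔ) (comm-even′ Δ b EΔ)) (≈-sym (distribˡ Δ a b))))
     (*-idˡ _)
  ⊕T-red (false , a) (true , b) = red 𝟙 Δ ev1 Cancellable-𝟙 EΔ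
     (≈-trans (*-idˡ _) (≈-trans (+-cong (≈-trans (comm-even′ RΔ a ERΔ) (≈-trans (*-congˡ a (comm-even R Δ ER)) (*-assoc Δ R a))) (comm-even′ Δ b EΔ)) (≈-sym (distribˡ Δ (R ⊠ a) b))))
     (*-idˡ _)
  ⊕T-red (true , a) (false , b) = red 𝟙 Δ ev1 Cancellable-𝟙 EΔ
     (≈-trans (*-idˡ _) (≈-trans (+-cong (comm-even′ Δ a EΔ) (≈-trans (comm-even′ RΔ b ERΔ) (≈-trans (*-congˡ b (comm-even R Δ ER)) (*-assoc Δ R b)))) (≈-sym (distribˡ Δ a (R ⊠ b)))))
     (≈-trans (*-idˡ _) (comm-even′ Δ RΔ EΔ))
  ⊕T-red (true , a) (true , b) = red 𝟙 RΔ ev1 Cancellable-𝟙 ERΔ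
     (≈-trans (*-idˡ _) (≈-trans (+-cong (comm-even′ RΔ a ERΔ) (comm-even′ RΔ b ERΔ)) (≈-sym (distribˡ RΔ a b))))
     (*-idˡ _)

  foldT : ∀ {k} → (Fin k → Tagged) → Tagged
  foldT {zero} t = false , 𝟘
  foldT {suc k} t = t zero ⊕T foldT (t ∘ suc)

  sum-red : ∀ {k} (f : Fin k → Frac n m) (t : Fin k → Tagged) → (∀ i → f i ⊒ ⟦ t i ⟧T) → sumFin f ⊒ ⟦ foldT t ⟧T
  sum-red {zero} f t h = red Δ 𝟙 EΔ KΔ ev1 (≈-trans (*-congʳ Δ const0) (zeroʳ Δ)) (≈-trans (*-idʳ Δ) (≈-sym (*-idˡ Δ)))
  sum-red {suc k} f t h = ⊒-trans (⊒-+ (h zero) (sum-red (f ∘ suc) (t ∘ suc) (h ∘ suc))) (⊕T-red (t zero) (foldT (t ∘ suc)))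

  numer : Tagged → SP n m
  numer (false , a) = R ⊠ a
  numer (true , a) = a

  numer-⊕ : ∀ t t' → numer (t ⊕T t') ≈ numer t ⊞ numer t'
  numer-⊕ (false , a) (false , b) = distribˡ R a b
  numer-⊕ (false , a) (true , b) = ≈-refl
  numer-⊕ (true , a) (false , b) = ≈-refl
  numer-⊕ (true , a) (true , b) = ≈-refl

  numer-fold : ∀ {k} (t : Fin k → Tagged) → numer (foldT t) ≈ ΣS (numer ∘ t)
  numer-fold {zero} t = zeroʳ R
  numer-fold {suc k} t = ≈-trans (numer-⊕ (t zero) (foldT (t ∘ suc))) (+-cong ≈-refl (numer-fold (t ∘ suc)))

  tag-⊕ : ∀ t t' → proj₁ (t ⊕T t') ≡ (proj₁ t ∨ proj₁ t')
  tag-⊕ (false , a) (false , b) = refl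
  tag-⊕ (false , a) (true , b) = refl
  tag-⊕ (true , a) (false , b) = refl
  tag-⊕ (true , a) (true , b) = refl

  tag-fold : ∀ {k} (t : Fin k → Tagged) (i : Fin k) → proj₁ (t i) ≡ true → proj₁ (foldT t) ≡ true
  tag-fold t zero e = trans (tag-⊕ (t zero) (foldT (t ∘ suc))) (cong (_∨ proj₁ (foldT (t ∘ suc))) e)
  tag-fold t (suc i) e = trans (tag-⊕ (t zero) (foldT (t ∘ suc))) (trans (cong (proj₁ (t zero) ∨_) (tag-fold (t ∘ suc) i e)) (∨-true (proj₁ (t zero))))
    where ∨-true : ∀ b → (b ∨ true) ≡ true
          ∨-true true = refl
          ∨-true false = refl

  conv-true : ∀ (t : Tagged) W → proj₁ t ≡ true → numer t ≈ R ⊠ W → ⟦ t ⟧T ⊒ (W / Δ)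
  conv-true (true , a) W e v = red 𝟙 R ev1 Cancellable-𝟙 ER (≈-trans (*-idˡ a) v) (*-idˡ _)

  conv-one : ∀ (t : Tagged) W → R ≈ 𝟙 → numer t ≈ W → ⟦ t ⟧T ⊒ (W / Δ)
  conv-one (false , a) W r v = red 𝟙 𝟙 ev1 Cancellable-𝟙 ev1 (*-congʳ 𝟙 (≈-trans (≈-sym (*-idˡ a)) (≈-trans (*-congˡ a (≈-sym r)) v))) ≈-refl
  conv-one (true , a) W r v = red 𝟙 𝟙 ev1 Cancellable-𝟙 ev1 (*-congʳ 𝟙 v) (*-congʳ 𝟙 (≈-trans (*-congˡ Δ r) (*-idˡ Δ)))

module _ {n m : ℕ} where
  Σ-δ' : ∀ {K} (c : Fin K) (f : Fin K → SP n m) → ΣS (λ i → if i == c then f i else 𝟘) ≈ f c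
  Σ-δ' {suc K} zero f = ≈-trans (+-cong {p = f zero} {p' = f zero} {q = ΣS {n} {m} {K} (λ _ → 𝟘)} ≈-refl (Σ-0 {n} {m} {K})) (+-idʳ (f zero))
  Σ-δ' {suc K} (suc c) f = ≈-trans (Σ-cong (λ i → ≡⇒≈ (cong (λ b → if b then f (suc i) else 𝟘) (==-suc i c)))) (Σ-δ' c (f ∘ suc))

  Σ-if : ∀ {K} (b : Bool) (f : Fin K → SP n m) → ΣS (λ j → if b then f j else 𝟘) ≈ (if b then ΣS f else 𝟘)
  Σ-if true f = ≈-refl
  Σ-if {K} false f = Σ-0 {n} {m} {K}

module _ {n m : ℕ} where
  scale-≡ : ∀ {c d} (X : SP n m) → c ≡ d → scaleSP c X ≈ scaleSP d X
  scale-≡ X refl = ≈-refl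

  negneg : ∀ c (X : SP n m) → ⊟ (scaleSP c (⊟ X)) ≈ scaleSP c X
  negneg c X = ≈i λ M → trans (coeff-⊟ (scaleSP c (⊟ X)) M) (trans (cong -_ (trans (coeff-scale c (⊟ X) M) (cong (c *_) (coeff-⊟ X M))))
     (trans (cong -_ (sym (ℤP.neg-distribʳ-* c (coeff X M)))) (trans (ℤP.neg-involutive _) (sym (coeff-scale c X M)))))

  neg-scale : ∀ c (X : SP n m) → ⊟ (scaleSP c X) ≈ scaleSP (- c) X
  neg-scale c X = ≈-trans (scale-scale (- (+ 1)) c X) (scale-≡ X (ℤP.-1*i≡-i c))

  Σ-⊟ : ∀ {K} (f : Fin K → SP n m) → ⊟ (ΣS f) ≈ ΣS (λ i → ⊟ (f i))
  Σ-⊟ f = Σ-scale (- (+ 1)) f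

  scale-if : ∀ (b : Bool) c (X : SP n m) → scaleSP (if b then c else + 0) X ≈ (if b then scaleSP c X else 𝟘)
  scale-if true c X = ≈-refl
  scale-if false c X = scale-0 X

double-cancel : ∀ (a b : ℤ) → a + a ≡ b + b → a ≡ b
double-cancel a b e = ℤP.*-cancelˡ-≡ (+ 2) a b (trans (twice a) (trans e (sym (twice b))))
  where twice : ∀ z → + 2 * z ≡ z + z
        twice = solve-∀

-- The truncated differences in the mutation rule have the right antisymmetrisation.
monus-antisym : ∀ a b → + (a ℕ.∸ b) - + (b ℕ.∸ a) ≡ + a - + b
monus-antisym a b with ℕP.≤-total b a
... | inj₁ b≤a rewrite ℕP.m≤n⇒m∸n≡0 b≤a =
       trans (ℤP.+-identityʳ _) (trans (sym (ℤP.⊖-≥ b≤a)) (sym (ℤP.m-n≡m⊖n a b)))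
... | inj₂ a≤b rewrite ℕP.m≤n⇒m∸n≡0 a≤b =
       trans (ℤP.+-identityˡ _) (trans (cong -_ (sym (ℤP.⊖-≥ a≤b))) (trans (sym (ℤP.⊖-swap a b)) (sym (ℤP.m-n≡m⊖n a b))))

monus-antisym-+* : ∀ a p q a' p' q' →
  + ((a ℕ.+ p ℕ.* q) ℕ.∸ (a' ℕ.+ p' ℕ.* q')) - + ((a' ℕ.+ p' ℕ.* q') ℕ.∸ (a ℕ.+ p ℕ.* q))
  ≡ (+ a + + p * + q) - (+ a' + + p' * + q')
monus-antisym-+* a p q a' p' q' = begin
  + ((a ℕ.+ p ℕ.* q) ℕ.∸ (a' ℕ.+ p' ℕ.* q')) - + ((a' ℕ.+ p' ℕ.* q') ℕ.∸ (a ℕ.+ p ℕ.* q))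
    ≡⟨ monus-antisym (a ℕ.+ p ℕ.* q) (a' ℕ.+ p' ℕ.* q') ⟩
  + (a ℕ.+ p ℕ.* q) - + (a' ℕ.+ p' ℕ.* q')
    ≡⟨ cong₂ _-_ (ℤP.pos-+ a (p ℕ.* q)) (ℤP.pos-+ a' (p' ℕ.* q')) ⟩
  (+ a + + (p ℕ.* q)) - (+ a' + + (p' ℕ.* q'))
    ≡⟨ cong₂ (λ u v → (+ a + u) - (+ a' + v)) (ℤP.pos-* p q) (ℤP.pos-* p' q') ⟩
  (+ a + + p * + q) - (+ a' + + p' * + q') ∎
  where open ≡-Reasoning

module _ {n m : ℕ} where
  scale-⊟ : ∀ c (X : SP n m) → scaleSP c (⊟ X) ≈ scaleSP (- c) X
  scale-⊟ c X = ≈-trans (scale-scale c (- (+ 1)) X) (scale-≡ X (trans (ℤP.*-comm c (- (+ 1))) (ℤP.-1*i≡-i c)))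

  -- Sums against an antisymmetric family Zf: twice Σ c_ij Zf_ij is
  -- Σ (c_ij - c_ji) Zf_ij, so (having no 2-torsion) the sum only depends on the
  -- antisymmetrisation of c (antisym-sum).
  antisym-double : ∀ {K} (Zf : Fin K → Fin K → SP n m) → (∀ i j → Zf j i ≈ ⊟ (Zf i j)) → (c : Fin K → Fin K → ℤ) →
         ΣS (λ i → ΣS (λ j → scaleSP (c i j) (Zf i j))) ⊞ ΣS (λ i → ΣS (λ j → scaleSP (c i j) (Zf i j)))
         ≈ ΣS (λ i → ΣS (λ j → scaleSP (c i j - c j i) (Zf i j)))
  antisym-double Zf anti c = ≈-trans (+-cong (≈-refl {p = ΣS (λ i → ΣS (λ j → scaleSP (c i j) (Zf i j)))}) (Σ-swap (λ i j → scaleSP (c i j) (Zf i j))))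
    (≈-trans (≈-sym (Σ-+ (λ a → ΣS (λ b → scaleSP (c a b) (Zf a b))) (λ a → ΣS (λ b → scaleSP (c b a) (Zf b a)))))
      (Σ-cong λ a → ≈-trans (≈-sym (Σ-+ (λ b → scaleSP (c a b) (Zf a b)) (λ b → scaleSP (c b a) (Zf b a))))
        (Σ-cong λ b → ≈-trans (+-cong (≈-refl {p = scaleSP (c a b) (Zf a b)}) (≈-trans (scale-cong (c b a) (anti a b)) (scale-⊟ (c b a) (Zf a b))))
           (≈-sym (scale-distr (c a b) (- c b a) (Zf a b))))))

  antisym-sum : ∀ {K} (Zf : Fin K → Fin K → SP n m) → (∀ i j → Zf j i ≈ ⊟ (Zf i j)) → (c d : Fin K → Fin K → ℤ) →
            (∀ i j → c i j - c j i ≡ d i j - d j i) →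
            ΣS (λ i → ΣS (λ j → scaleSP (c i j) (Zf i j))) ≈ ΣS (λ i → ΣS (λ j → scaleSP (d i j) (Zf i j)))
  antisym-sum Zf anti c d h = ≈i λ M → double-cancel _ _ (trans (sym (coeff-++ (Sc c) (Sc c) M)) (trans (≈e (antisym-double Zf anti c) M)
       (trans (≈e (Σ-cong λ i → Σ-cong λ j → scale-≡ (Zf i j) (h i j)) M) (trans (sym (≈e (antisym-double Zf anti d) M)) (coeff-++ (Sc d) (Sc d) M)))))
    where Sc : _ → SP n m
          Sc c' = ΣS (λ i → ΣS (λ j → scaleSP (c' i j) (Zf i j)))

-- The computation, for arrow multiplicities B, 2-path multiplicities T, a
-- mutation vertex k, and no loops (the only quiver axiom the argument uses).
-- Notation: X i = x_i, D = x_1⋯x_n, Dx i = D / x_i, xk = x_k, Δ = D², and the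
-- exchange polynomial R = Pout + Podd·Pin (outgoing, odd and incoming factors).
module Exchange {n m : ℕ} (B : Fin n → Fin n → ℕ) (T : Fin m → Fin n → Fin m → ℕ) (k : Fin n) (noLoop : ∀ i → B i i ≡ 0) where
  Qd : QData n m
  Qd = qdata B T
  X dX : Fin n → SP n m
  X i = genSP (x i)
  dX i = genSP (dx i)
  D : SP n m
  D = prodFinSP X
  Dx : Fin n → SP n m
  Dx i = prodFinSP (λ l → if l == i then 𝟙 else X l)
  xk : SP n m
  xk = X k
  cN : ℕ → SP n m
  cN c = constSP (+ c)
  ξξ : Fin m → Fin m → SP n m
  ξξ a b = genSP (ξ a) ⊠ genSP (ξ b)
  dξξ : Fin m → Fin m → SP n m
  dξξ a b = dSP (ξξ a b)
  Pout Pin Podd R dR fR Δ : SP n m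
  Pout = prodFinSP (λ ℓ → powSP (X ℓ) (B k ℓ))
  Pin = prodFinSP (λ ℓ → powSP (X ℓ) (B ℓ k))
  Podd = prodFinSP (λ a → prodFinSP (λ b → powSP (𝟙 ⊞ ξξ a b) (T a k b)))
  R = exchangeRHS Qd k
  dR = dSP R
  fR = flipSP R
  Δ = D ⊠ D

  eX : ∀ i → EvenSP (X i)
  eX i = refl , tt
  oX : ∀ i → OddSP (dX i)
  oX i = refl , tt
  eD : EvenSP D
  eD = Hom-prod X eX
  e-factor : ∀ {l} b → EvenSP (if b then 𝟙 else X l)
  e-factor true = refl , tt
  e-factor false = refl , tt
  eDx : ∀ i → EvenSP (Dx i)
  eDx i = Hom-prod _ (λ l → e-factor (l == i))
  e1 : EvenSP (𝟙 {n} {m})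
  e1 = refl , tt
  eN : ∀ c → EvenSP (cN c)
  eN c = refl , tt
  eξξ : ∀ a b → EvenSP (ξξ a b)
  eξξ a b = Hom-* {n} {m} { - (+ 1)} { - (+ 1)} (genSP (ξ a)) (genSP (ξ b)) (refl , tt) (refl , tt)
  odξξ : ∀ a b → OddSP (dξξ a b)
  odξξ a b = Hom-dSP (ξξ a b) (eξξ a b)
  ePout : EvenSP Pout
  ePout = Hom-prod _ (λ ℓ → Hom-pow (X ℓ) (B k ℓ) (eX ℓ))
  ePin : EvenSP Pin
  ePin = Hom-prod _ (λ ℓ → Hom-pow (X ℓ) (B ℓ k) (eX ℓ))
  ePodd : EvenSP Podd
  ePodd = Hom-prod _ (λ a → Hom-prod _ (λ b → Hom-pow _ (T a k b) (Hom-++ 𝟙 (ξξ a b) e1 (eξξ a b))))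
  eR : EvenSP R
  eR = Hom-++ Pout (Podd ⊠ Pin) ePout (Hom-* Podd Pin ePodd ePin)
  odR : OddSP dR
  odR = Hom-dSP R eR
  efR : EvenSP fR
  efR = Hom-flip R eR
  fR≈R : fR ≈ R
  fR≈R = ≈-trans (flip-hom R eR) (scale-1 R)
  eΔ : EvenSP Δ
  eΔ = Hom-* D D eD eD

  kX : ∀ i → Cancellable (X i)
  kX i = Cancellable-x i
  kD : Cancellable D
  kD = Cancellable-prod X eX kX
  kDx : ∀ i → Cancellable (Dx i)
  kDx i = Cancellable-prod _ (λ l → e-factor (l == i)) (λ l → k-factor (l == i))
    where k-factor : ∀ {l} b → Cancellable (if b then 𝟙 else X l)
          k-factor true = Cancellable-𝟙
          k-factor false = Cancellable-x _
  kΔ : Cancellable Δ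
  kΔ = Cancellable-⊠ D D kD kD

  D-split : ∀ i → D ≈ X i ⊠ Dx i
  D-split i = ≈-sym (prod-extract X eX i)

  ev : ∀ (p : SP n m) → EvenSP p → Atom n m
  ev p h = p , false , h
  od : ∀ (p : SP n m) → OddSP p → Atom n m
  od p h = p , true , h
  one : ∀ {N} → Expr N
  one = con (+ 1)

  open CommonDenominator R Δ eR eΔ kΔ public

  -- Ehat = D·dR - R·dx_k·(D/x_k) = D·x_k·d(R/x_k); it is odd.
  Ehat : SP n m
  Ehat = D ⊠ dR ⊞ ⊟ (R ⊠ (dX k ⊠ Dx k))

  -- Numerators over Δ of the summands of ω: c·dx_i∧dx_j/(x_i x_j) has numerator
  -- Zterm c i j, and c·d(ξ_aξ_b)∧dx_ℓ/x_ℓ has numerator Yterm c a ℓ b.  After the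
  -- substitution x_k ↦ R/x_k the summands through k have numerators Kr, Kc, Ko
  -- over R·Δ.
  Zterm : ℕ → Fin n → Fin n → SP n m
  Zterm c i j = cN c ⊠ (dX i ⊠ dX j) ⊠ (Dx i ⊠ Dx j)
  Yterm : ℕ → Fin m → Fin n → Fin m → SP n m
  Yterm c a ℓ b = cN c ⊠ (dξξ a b ⊠ dX ℓ) ⊠ (Dx ℓ ⊠ D)
  Kr Kc : Fin n → Fin n → SP n m
  Kr i j = cN (B i j) ⊠ (Ehat ⊠ dX j) ⊠ Dx j
  Kc i j = cN (B i j) ⊠ (dX i ⊠ Ehat) ⊠ Dx i
  Ko : Fin m → Fin n → Fin m → SP n m
  Ko a ℓ b = cN (T a ℓ b) ⊠ (dξξ a b ⊠ Ehat) ⊠ D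

  -- Each is a cross-multiplication checked by the solver, after unfolding D into
  -- x_i·(D/x_i) and, for the substituted coordinate, d(R/x_k) into Ehat.

  reduce-plain : ∀ c i j → (natF c *F ((dF (varX i) *F dF (varX j)) *F invF (varX i *F varX j))) ⊒ (Zterm c i j / Δ)
  reduce-plain c i j = red (Dx i ⊠ Dx j) 𝟙 (Hom-* (Dx i) (Dx j) (eDx i) (eDx j)) (Cancellable-⊠ (Dx i) (Dx j) (kDx i) (kDx j)) e1 numq denq
    where
      ρ' : Vec (Atom n m) 7
      ρ' = ev (cN c) (eN c) ∷v od (dX i) (oX i) ∷v od (dX j) (oX j) ∷v ev (X i) (eX i) ∷v ev (X j) (eX j) ∷v ev (Dx i) (eDx i) ∷v ev (Dx j) (eDx j) ∷v []v
      ρ : Vec (Atom n m) 9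
      ρ = ρ' Vec.++ (ev D eD ∷v ev D eD ∷v []v)
      σv : Vec (Expr 7) 9
      σv = atom (# 0) ∷v atom (# 1) ∷v atom (# 2) ∷v atom (# 3) ∷v atom (# 4) ∷v atom (# 5) ∷v atom (# 6) ∷v (atom (# 3) :* atom (# 5)) ∷v (atom (# 4) :* atom (# 6)) ∷v []v
      sv : AtomSubst ρ' ρ σv
      sv = ≈-refl ∷s ≈-refl ∷s ≈-refl ∷s ≈-refl ∷s ≈-refl ∷s ≈-refl ∷s ≈-refl ∷s D-split i ∷s D-split j ∷s []s
      cc = atom {9} (# 0) ; dxi = atom {9} (# 1) ; dxj = atom {9} (# 2) ; xi = atom {9} (# 3) ; xj = atom {9} (# 4)
      Di = atom {9} (# 5) ; Dj = atom {9} (# 6) ; Da = atom {9} (# 7) ; Db = atom {9} (# 8)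
      numq = solveVia ρ' ρ σv sv ((Di :* Dj) :* (cc :* (((dxi :* one :+ :- (xi :* nil)) :* (dxj :* one :+ :- (xj :* nil))) :* (one :* one))))
                              (one :* (cc :* (dxi :* dxj) :* (Di :* Dj))) refl
      denq = solveVia ρ' ρ σv sv ((Di :* Dj) :* (one :* (((one :* one) :* (one :* one)) :* (xi :* xj)))) (one :* (Da :* Db)) refl

  reduce-odd : ∀ c a ℓ b → (natF c *F ((dF (varΞ a *F varΞ b) *F dF (varX ℓ)) *F invF (varX ℓ))) ⊒ (Yterm c a ℓ b / Δ)
  reduce-odd c a ℓ b = red (Dx ℓ ⊠ D) 𝟙 (Hom-* (Dx ℓ) D (eDx ℓ) eD) (Cancellable-⊠ (Dx ℓ) D (kDx ℓ) kD) e1 numq denq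
    where
      ρ' : Vec (Atom n m) 7
      ρ' = ev (cN c) (eN c) ∷v od (dξξ a b) (odξξ a b) ∷v ev (flipSP (ξξ a b)) (Hom-flip (ξξ a b) (eξξ a b)) ∷v od (dX ℓ) (oX ℓ) ∷v ev (X ℓ) (eX ℓ) ∷v ev (Dx ℓ) (eDx ℓ) ∷v ev D eD ∷v []v
      ρ : Vec (Atom n m) 8
      ρ = ρ' Vec.++ (ev D eD ∷v []v)
      σv : Vec (Expr 7) 8
      σv = atom (# 0) ∷v atom (# 1) ∷v atom (# 2) ∷v atom (# 3) ∷v atom (# 4) ∷v atom (# 5) ∷v atom (# 6) ∷v (atom (# 4) :* atom (# 5)) ∷v []v
      sv : AtomSubst ρ' ρ σv
      sv = ≈-refl ∷s ≈-refl ∷s ≈-refl ∷s ≈-refl ∷s ≈-refl ∷s ≈-refl ∷s ≈-refl ∷s D-split ℓ ∷s []s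
      cc = atom {8} (# 0) ; dab = atom {8} (# 1) ; fab = atom {8} (# 2) ; dxl = atom {8} (# 3) ; xl = atom {8} (# 4)
      Dl = atom {8} (# 5) ; DD = atom {8} (# 6) ; Da = atom {8} (# 7)
      Dn = dab :* (one :* one) :+ :- (fab :* nil)
      numq = solveVia ρ' ρ σv sv ((Dl :* DD) :* (cc :* ((Dn :* (dxl :* one :+ :- (xl :* nil))) :* one)))
                              (one :* (cc :* (dab :* dxl) :* (Dl :* DD))) refl
      denq = solveVia ρ' ρ σv sv ((Dl :* DD) :* (one :* ((((one :* one) :* (one :* one)) :* (one :* one)) :* xl))) (one :* (Da :* DD)) refl

  reduce-row-k : ∀ i j → (natF (B i j) *F ((dF (R / xk) *F dF (varX j)) *F invF ((R / xk) *F varX j))) ⊒ ⟦ (true , Kr i j) ⟧T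
  reduce-row-k i j = red (Dx j ⊠ Dx k) xk (Hom-* (Dx j) (Dx k) (eDx j) (eDx k)) (Cancellable-⊠ (Dx j) (Dx k) (kDx j) (kDx k)) (eX k) numq denq
    where
      ρ' : Vec (Atom n m) 9
      ρ' = ev (cN (B i j)) (eN (B i j)) ∷v od dR odR ∷v ev xk (eX k) ∷v ev R eR ∷v od (dX k) (oX k) ∷v od (dX j) (oX j) ∷v ev (X j) (eX j) ∷v ev (Dx j) (eDx j) ∷v ev (Dx k) (eDx k) ∷v []v
      ρ : Vec (Atom n m) 12
      ρ = ρ' Vec.++ (ev fR efR ∷v ev D eD ∷v ev D eD ∷v []v)
      σv : Vec (Expr 9) 12
      σv = atom (# 0) ∷v atom (# 1) ∷v atom (# 2) ∷v atom (# 3) ∷v atom (# 4) ∷v atom (# 5) ∷v atom (# 6) ∷v atom (# 7) ∷v atom (# 8) ∷v atom (# 3) ∷v (atom (# 2) :* atom (# 8)) ∷v (atom (# 6) :* atom (# 7)) ∷v []v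
      sv : AtomSubst ρ' ρ σv
      sv = ≈-refl ∷s ≈-refl ∷s ≈-refl ∷s ≈-refl ∷s ≈-refl ∷s ≈-refl ∷s ≈-refl ∷s ≈-refl ∷s ≈-refl ∷s fR≈R ∷s D-split k ∷s D-split j ∷s []s
      cc = atom {12} (# 0) ; dr = atom {12} (# 1) ; yy = atom {12} (# 2) ; rr = atom {12} (# 3) ; dxk = atom {12} (# 4)
      dxj = atom {12} (# 5) ; xj = atom {12} (# 6) ; Dj = atom {12} (# 7) ; Dk = atom {12} (# 8) ; fr = atom {12} (# 9)
      Da = atom {12} (# 10) ; Db = atom {12} (# 11)
      dFn = dr :* yy :+ :- (fr :* dxk)
      Eh = Da :* dr :+ :- (rr :* (dxk :* Dk))
      numq = solveVia ρ' ρ σv sv ((Dj :* Dk) :* (cc :* ((dFn :* (dxj :* one :+ :- (xj :* nil))) :* (yy :* one))))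
                              (yy :* (cc :* (Eh :* dxj) :* Dj)) refl
      denq = solveVia ρ' ρ σv sv ((Dj :* Dk) :* (one :* (((yy :* yy) :* (one :* one)) :* (rr :* xj)))) (yy :* (rr :* (Da :* Db))) refl

  reduce-col-k : ∀ i j → (natF (B i j) *F ((dF (varX i) *F dF (R / xk)) *F invF (varX i *F (R / xk)))) ⊒ ⟦ (true , Kc i j) ⟧T
  reduce-col-k i j = red (Dx i ⊠ Dx k) xk (Hom-* (Dx i) (Dx k) (eDx i) (eDx k)) (Cancellable-⊠ (Dx i) (Dx k) (kDx i) (kDx k)) (eX k) numq denq
    where
      ρ' : Vec (Atom n m) 9
      ρ' = ev (cN (B i j)) (eN (B i j)) ∷v od dR odR ∷v ev xk (eX k) ∷v ev R eR ∷v od (dX k) (oX k) ∷v od (dX i) (oX i) ∷v ev (X i) (eX i) ∷v ev (Dx i) (eDx i) ∷v ev (Dx k) (eDx k) ∷v []v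
      ρ : Vec (Atom n m) 12
      ρ = ρ' Vec.++ (ev fR efR ∷v ev D eD ∷v ev D eD ∷v []v)
      σv : Vec (Expr 9) 12
      σv = atom (# 0) ∷v atom (# 1) ∷v atom (# 2) ∷v atom (# 3) ∷v atom (# 4) ∷v atom (# 5) ∷v atom (# 6) ∷v atom (# 7) ∷v atom (# 8) ∷v atom (# 3) ∷v (atom (# 2) :* atom (# 8)) ∷v (atom (# 6) :* atom (# 7)) ∷v []v
      sv : AtomSubst ρ' ρ σv
      sv = ≈-refl ∷s ≈-refl ∷s ≈-refl ∷s ≈-refl ∷s ≈-refl ∷s ≈-refl ∷s ≈-refl ∷s ≈-refl ∷s ≈-refl ∷s fR≈R ∷s D-split k ∷s D-split i ∷s []s
      cc = atom {12} (# 0) ; dr = atom {12} (# 1) ; yy = atom {12} (# 2) ; rr = atom {12} (# 3) ; dxk = atom {12} (# 4)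
      dxi = atom {12} (# 5) ; xi = atom {12} (# 6) ; Di = atom {12} (# 7) ; Dk = atom {12} (# 8) ; fr = atom {12} (# 9)
      Da = atom {12} (# 10) ; Db = atom {12} (# 11)
      dFn = dr :* yy :+ :- (fr :* dxk)
      Eh = Da :* dr :+ :- (rr :* (dxk :* Dk))
      numq = solveVia ρ' ρ σv sv ((Di :* Dk) :* (cc :* (((dxi :* one :+ :- (xi :* nil)) :* dFn) :* (one :* yy))))
                              (yy :* (cc :* (dxi :* Eh) :* Di)) refl
      denq = solveVia ρ' ρ σv sv ((Di :* Dk) :* (one :* (((one :* one) :* (yy :* yy)) :* (xi :* rr)))) (yy :* (rr :* (Da :* Db))) refl

  -- The substituted diagonal summand vanishes, d(R/x_k) being odd.
  reduce-k-k : ∀ i j → (natF (B i j) *F ((dF (R / xk) *F dF (R / xk)) *F invF ((R / xk) *F (R / xk)))) ⊒ ⟦ (true , 𝟘) ⟧T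
  reduce-k-k i j = red (Dx k ⊠ Dx k) (xk ⊠ (xk ⊠ R)) (Hom-* (Dx k) (Dx k) (eDx k) (eDx k)) (Cancellable-⊠ (Dx k) (Dx k) (kDx k) (kDx k)) (Hom-* xk (xk ⊠ R) (eX k) (Hom-* xk R (eX k) eR)) numq denq
    where
      ρ' : Vec (Atom n m) 6
      ρ' = ev (cN (B i j)) (eN (B i j)) ∷v od dR odR ∷v ev xk (eX k) ∷v ev R eR ∷v od (dX k) (oX k) ∷v ev (Dx k) (eDx k) ∷v []v
      ρ : Vec (Atom n m) 9
      ρ = ρ' Vec.++ (ev fR efR ∷v ev D eD ∷v ev D eD ∷v []v)
      σv : Vec (Expr 6) 9
      σv = atom (# 0) ∷v atom (# 1) ∷v atom (# 2) ∷v atom (# 3) ∷v atom (# 4) ∷v atom (# 5) ∷v atom (# 3) ∷v (atom (# 2) :* atom (# 5)) ∷v (atom (# 2) :* atom (# 5)) ∷v []v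
      sv : AtomSubst ρ' ρ σv
      sv = ≈-refl ∷s ≈-refl ∷s ≈-refl ∷s ≈-refl ∷s ≈-refl ∷s ≈-refl ∷s fR≈R ∷s D-split k ∷s D-split k ∷s []s
      cc = atom {9} (# 0) ; dr = atom {9} (# 1) ; yy = atom {9} (# 2) ; rr = atom {9} (# 3) ; dxk = atom {9} (# 4)
      Dk = atom {9} (# 5) ; fr = atom {9} (# 6) ; Da = atom {9} (# 7) ; Db = atom {9} (# 8)
      dFn = dr :* yy :+ :- (fr :* dxk)
      numq = solveVia ρ' ρ σv sv ((Dk :* Dk) :* (cc :* ((dFn :* dFn) :* (yy :* yy)))) ((yy :* (yy :* rr)) :* nil) refl
      denq = solveVia ρ' ρ σv sv ((Dk :* Dk) :* (one :* (((yy :* yy) :* (yy :* yy)) :* (rr :* rr)))) ((yy :* (yy :* rr)) :* (rr :* (Da :* Db))) refl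

  reduce-odd-k : ∀ a ℓ b → (natF (T a ℓ b) *F ((dF (varΞ a *F varΞ b) *F dF (R / xk)) *F invF (R / xk))) ⊒ ⟦ (true , Ko a ℓ b) ⟧T
  reduce-odd-k a ℓ b = red (Dx k ⊠ D) xk (Hom-* (Dx k) D (eDx k) eD) (Cancellable-⊠ (Dx k) D (kDx k) kD) (eX k) numq denq
    where
      ρ' : Vec (Atom n m) 9
      ρ' = ev (cN (T a ℓ b)) (eN (T a ℓ b)) ∷v od dR odR ∷v ev xk (eX k) ∷v ev R eR ∷v od (dX k) (oX k) ∷v ev (Dx k) (eDx k) ∷v od (dξξ a b) (odξξ a b) ∷v ev (flipSP (ξξ a b)) (Hom-flip (ξξ a b) (eξξ a b)) ∷v ev D eD ∷v []v
      ρ : Vec (Atom n m) 11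
      ρ = ρ' Vec.++ (ev fR efR ∷v ev D eD ∷v []v)
      σv : Vec (Expr 9) 11
      σv = atom (# 0) ∷v atom (# 1) ∷v atom (# 2) ∷v atom (# 3) ∷v atom (# 4) ∷v atom (# 5) ∷v atom (# 6) ∷v atom (# 7) ∷v atom (# 8) ∷v atom (# 3) ∷v (atom (# 2) :* atom (# 5)) ∷v []v
      sv : AtomSubst ρ' ρ σv
      sv = ≈-refl ∷s ≈-refl ∷s ≈-refl ∷s ≈-refl ∷s ≈-refl ∷s ≈-refl ∷s ≈-refl ∷s ≈-refl ∷s ≈-refl ∷s fR≈R ∷s D-split k ∷s []s
      cc = atom {11} (# 0) ; dr = atom {11} (# 1) ; yy = atom {11} (# 2) ; rr = atom {11} (# 3) ; dxk = atom {11} (# 4)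
      Dk = atom {11} (# 5) ; dab = atom {11} (# 6) ; fab = atom {11} (# 7) ; DD = atom {11} (# 8) ; fr = atom {11} (# 9)
      Da = atom {11} (# 10)
      dFn = dr :* yy :+ :- (fr :* dxk)
      Eh = Da :* dr :+ :- (rr :* (dxk :* Dk))
      Dn = dab :* (one :* one) :+ :- (fab :* nil)
      numq = solveVia ρ' ρ σv sv ((Dk :* DD) :* (cc :* ((Dn :* dFn) :* yy))) (yy :* (cc :* (dab :* Eh) :* DD)) refl
      denq = solveVia ρ' ρ σv sv ((Dk :* DD) :* (one :* ((((one :* one) :* (one :* one)) :* (yy :* yy)) :* rr))) (yy :* (rr :* (Da :* DD))) refl

  -- Logarithmic derivatives: LogDeriv f s says D·df = s·f, i.e. s/D = d log f.
  -- It is additive on products and computed factor by factor; for R it gives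
  -- D·dR = p̂·Pout + (D·σ̃ + q̂)·Podd·Pin (D-dR), where p̂/D, q̂/D, σ̃ are the
  -- logarithmic derivatives of Pout, Pin and Podd.
  LogDeriv : SP n m → SP n m → Set
  LogDeriv f s = D ⊠ dSP f ≈ s ⊠ f

  LogDeriv-cong : ∀ {f s s'} → s ≈ s' → LogDeriv f s → LogDeriv f s'
  LogDeriv-cong {f} e l = ≈-trans l (*-congˡ f e)

  LogDeriv-𝟙 : LogDeriv 𝟙 𝟘
  LogDeriv-𝟙 = zeroʳ D

  LogDeriv-* : ∀ f g s t → EvenSP f → EvenSP g → LogDeriv f s → LogDeriv g t → LogDeriv (f ⊠ g) (s ⊞ t)
  LogDeriv-* f g s t ef eg lf lg =
    ≈-trans (*-congʳ D (leibniz f g))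
    (≈-trans (distribˡ D (dSP f ⊠ g) (flipSP f ⊠ dSP g))
    (≈-trans (+-cong (≈-trans (≈-sym (*-assoc D (dSP f) g)) (≈-trans (*-congˡ g lf) (*-assoc s f g)))
                     (≈-trans (*-congʳ D (*-congˡ (dSP g) (≈-trans (flip-hom f ef) (scale-1 f))))
                     (≈-trans (even-slide D f (dSP g) eD) (≈-trans (*-congʳ f lg) (≈-trans (≈-sym (*-assoc f t g))
                       (≈-trans (*-congˡ g (comm-even f t ef)) (*-assoc t f g)))))))
    (≈-sym (distribʳ s t (f ⊠ g)))))

  LogDeriv-pow : ∀ f s → EvenSP f → LogDeriv f s → ∀ e → LogDeriv (powSP f e) (scaleSP (+ e) s)
  LogDeriv-pow f s ef lf zero = ≈-trans LogDeriv-𝟙 (≈-sym (*-congˡ 𝟙 (scale-0 s)))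
  LogDeriv-pow f s ef lf (suc e) = LogDeriv-cong (≈-trans (+-cong (≈-sym (scale-1 s)) ≈-refl) (≈-sym (≈-trans (≡⇒≈ (cong (λ z → scaleSP z s) (ℤP.pos-+ 1 e))) (scale-distr (+ 1) (+ e) s))))
     (LogDeriv-* f (powSP f e) s (scaleSP (+ e) s) ef (Hom-pow f e ef) lf (LogDeriv-pow f s ef lf e))

  LogDeriv-prod : ∀ {K} (f s : Fin K → SP n m) → (∀ i → EvenSP (f i)) → (∀ i → LogDeriv (f i) (s i)) → LogDeriv (prodFinSP f) (ΣS s)
  LogDeriv-prod {zero} f s ef lf = LogDeriv-𝟙
  LogDeriv-prod {suc K} f s ef lf = LogDeriv-* (f zero) (prodFinSP (f ∘ suc)) (s zero) (ΣS (s ∘ suc)) (ef zero) (Hom-prod (f ∘ suc) (ef ∘ suc)) (lf zero) (LogDeriv-prod (f ∘ suc) (s ∘ suc) (ef ∘ suc) (lf ∘ suc))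

  LogDeriv-x : ∀ ℓ → LogDeriv (X ℓ) (dX ℓ ⊠ Dx ℓ)
  LogDeriv-x ℓ = ≈-trans (*-congˡ (dX ℓ) (D-split ℓ)) (Solver.solve ρ ((B0 :* B1) :* B2) ((B2 :* B1) :* B0) refl)
    where ρ : Vec (Atom n m) 3
          ρ = ev (X ℓ) (eX ℓ) ∷v ev (Dx ℓ) (eDx ℓ) ∷v od (dX ℓ) (oX ℓ) ∷v []v
          B0 = atom {3} (# 0) ; B1 = atom {3} (# 1) ; B2 = atom {3} (# 2)

  d-ξξ : ∀ a b → dξξ a b ≈ genSP (dξ a) ⊠ genSP (ξ b) ⊞ flipSP (genSP (ξ a)) ⊠ genSP (dξ b)
  d-ξξ a b = leibniz (genSP (ξ a)) (genSP (ξ b))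

  LogDeriv-1+ξξ : ∀ a b → LogDeriv (𝟙 ⊞ ξξ a b) (D ⊠ dξξ a b)
  LogDeriv-1+ξξ a b = solveVia ρ' ρ σv sv (B0 :* B1) ((B0 :* B1) :* (one :+ B2 :* B3)) refl
    where
      ρ' : Vec (Atom n m) 5
      ρ' = ev D eD ∷v ev (genSP (dξ a)) (refl , tt) ∷v od (genSP (ξ a)) (refl , tt) ∷v ev (genSP (dξ b)) (refl , tt) ∷v od (genSP (ξ b)) (refl , tt) ∷v []v
      ρ : Vec (Atom n m) 4
      ρ = ev D eD ∷v od (dξξ a b) (odξξ a b) ∷v od (genSP (ξ a)) (refl , tt) ∷v od (genSP (ξ b)) (refl , tt) ∷v []v
      σv : Vec (Expr 5) 4
      σv = atom (# 0) ∷v (atom (# 1) :* atom (# 4) :+ (:- atom (# 2)) :* atom (# 3)) ∷v atom (# 2) ∷v atom (# 4) ∷v []v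
      sv : AtomSubst ρ' ρ σv
      sv = ≈-refl ∷s ≈-trans (d-ξξ a b) (+-cong {p = genSP (dξ a) ⊠ genSP (ξ b)} {p' = genSP (dξ a) ⊠ genSP (ξ b)} ≈-refl (*-congˡ (genSP (dξ b)) (flip-hom (genSP (ξ a)) (refl , tt)))) ∷s ≈-refl ∷s ≈-refl ∷s []s
      B0 = atom {4} (# 0) ; B1 = atom {4} (# 1) ; B2 = atom {4} (# 2) ; B3 = atom {4} (# 3)

  p̂ q̂ σ̃ : SP n m
  p̂ = ΣS (λ ℓ → scaleSP (+ B k ℓ) (dX ℓ ⊠ Dx ℓ))
  q̂ = ΣS (λ ℓ → scaleSP (+ B ℓ k) (dX ℓ ⊠ Dx ℓ))
  σ̃ = ΣS (λ a → ΣS (λ b → scaleSP (+ T a k b) (dξξ a b)))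

  LogDeriv-Pout : LogDeriv Pout p̂
  LogDeriv-Pout = LogDeriv-prod (λ ℓ → powSP (X ℓ) (B k ℓ)) (λ ℓ → scaleSP (+ B k ℓ) (dX ℓ ⊠ Dx ℓ)) (λ ℓ → Hom-pow (X ℓ) (B k ℓ) (eX ℓ)) (λ ℓ → LogDeriv-pow (X ℓ) (dX ℓ ⊠ Dx ℓ) (eX ℓ) (LogDeriv-x ℓ) (B k ℓ))
  LogDeriv-Pin : LogDeriv Pin q̂
  LogDeriv-Pin = LogDeriv-prod (λ ℓ → powSP (X ℓ) (B ℓ k)) (λ ℓ → scaleSP (+ B ℓ k) (dX ℓ ⊠ Dx ℓ)) (λ ℓ → Hom-pow (X ℓ) (B ℓ k) (eX ℓ)) (λ ℓ → LogDeriv-pow (X ℓ) (dX ℓ ⊠ Dx ℓ) (eX ℓ) (LogDeriv-x ℓ) (B ℓ k))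

  e1+ξξ : ∀ a b → EvenSP (𝟙 ⊞ ξξ a b)
  e1+ξξ a b = Hom-++ 𝟙 (ξξ a b) e1 (eξξ a b)

  LogDeriv-Podd : LogDeriv Podd (D ⊠ σ̃)
  LogDeriv-Podd = LogDeriv-cong (≈-sym (≈-trans (Σ-⊠ˡ D (λ a → ΣS (λ b → scaleSP (+ T a k b) (dξξ a b))))
                   (Σ-cong λ a → ≈-trans (Σ-⊠ˡ D (λ b → scaleSP (+ T a k b) (dξξ a b))) (Σ-cong λ b → scale-*ʳ (+ T a k b) D (dξξ a b)))))
     (LogDeriv-prod (λ a → prodFinSP (λ b → powSP (𝟙 ⊞ ξξ a b) (T a k b))) (λ a → ΣS (λ b → scaleSP (+ T a k b) (D ⊠ dξξ a b)))
       (λ a → Hom-prod _ (λ b → Hom-pow _ (T a k b) (e1+ξξ a b)))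
       (λ a → LogDeriv-prod (λ b → powSP (𝟙 ⊞ ξξ a b) (T a k b)) (λ b → scaleSP (+ T a k b) (D ⊠ dξξ a b))
                (λ b → Hom-pow _ (T a k b) (e1+ξξ a b)) (λ b → LogDeriv-pow (𝟙 ⊞ ξξ a b) (D ⊠ dξξ a b) (e1+ξξ a b) (LogDeriv-1+ξξ a b) (T a k b))))

  D-dR : D ⊠ dR ≈ p̂ ⊠ Pout ⊞ (D ⊠ σ̃ ⊞ q̂) ⊠ (Podd ⊠ Pin)
  D-dR = ≈-trans (*-congʳ D (dSP-++ Pout (Podd ⊠ Pin))) (≈-trans (distribˡ D (dSP Pout) (dSP (Podd ⊠ Pin)))
        (+-cong LogDeriv-Pout (LogDeriv-* Podd Pin (D ⊠ σ̃) q̂ ePodd ePin LogDeriv-Podd LogDeriv-Pin)))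

  -- The terms of the substituted form with denominator R·Δ add up to Kfactored,
  -- which by D-dR is divisible by R with quotient Kreduced (Kfactored-R).
  oEh : OddSP Ehat
  oEh = Hom-++ (D ⊠ dR) (⊟ (R ⊠ (dX k ⊠ Dx k))) (Hom-* D dR eD odR)
          (Hom-scale (- (+ 1)) (R ⊠ (dX k ⊠ Dx k)) (Hom-* R (dX k ⊠ Dx k) eR (Hom-* (dX k) (Dx k) (oX k) (eDx k))))
  oZl : ∀ ℓ → OddSP (dX ℓ ⊠ Dx ℓ)
  oZl ℓ = Hom-* (dX ℓ) (Dx ℓ) (oX ℓ) (eDx ℓ)
  op̂ : OddSP p̂
  op̂ = Hom-Σ _ (λ ℓ → Hom-scale (+ B k ℓ) (dX ℓ ⊠ Dx ℓ) (oZl ℓ))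
  oq̂ : OddSP q̂
  oq̂ = Hom-Σ _ (λ ℓ → Hom-scale (+ B ℓ k) (dX ℓ ⊠ Dx ℓ) (oZl ℓ))
  oσ̃ : OddSP σ̃
  oσ̃ = Hom-Σ _ (λ a → Hom-Σ _ (λ b → Hom-scale (+ T a k b) (dξξ a b) (odξξ a b)))

  Kfactored Kreduced : SP n m
  Kfactored = Ehat ⊠ p̂ ⊞ ⊟ (Ehat ⊠ q̂) ⊞ (σ̃ ⊠ Ehat) ⊠ D
  Kreduced = D ⊠ (σ̃ ⊠ p̂) ⊞ ⊟ (p̂ ⊠ q̂) ⊞ ⊟ ((dX k ⊠ Dx k) ⊠ p̂) ⊞ (dX k ⊠ Dx k) ⊠ q̂ ⊞ ⊟ ((σ̃ ⊠ (dX k ⊠ Dx k)) ⊠ D)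

  Kfactored-R : Kfactored ≈ R ⊠ Kreduced
  Kfactored-R = solveVia ρ' ρ σv sv eL eR2 refl
    where
      ρ' : Vec (Atom n m) 9
      ρ' = ev Pout ePout ∷v ev Podd ePodd ∷v ev Pin ePin ∷v od (dX k) (oX k) ∷v ev (Dx k) (eDx k) ∷v od p̂ op̂ ∷v od q̂ oq̂ ∷v od σ̃ oσ̃ ∷v ev D eD ∷v []v
      ρ : Vec (Atom n m) 10
      ρ = ρ' Vec.++ (od (D ⊠ dR) (Hom-* D dR eD odR) ∷v []v)
      σv : Vec (Expr 9) 10
      σv = atom (# 0) ∷v atom (# 1) ∷v atom (# 2) ∷v atom (# 3) ∷v atom (# 4) ∷v atom (# 5) ∷v atom (# 6) ∷v atom (# 7) ∷v atom (# 8) ∷v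
           (atom (# 5) :* atom (# 0) :+ (atom (# 8) :* atom (# 7) :+ atom (# 6)) :* (atom (# 1) :* atom (# 2))) ∷v []v
      sv : AtomSubst ρ' ρ σv
      sv = ≈-refl ∷s ≈-refl ∷s ≈-refl ∷s ≈-refl ∷s ≈-refl ∷s ≈-refl ∷s ≈-refl ∷s ≈-refl ∷s ≈-refl ∷s D-dR ∷s []s
      pp = atom {10} (# 0) ; nn = atom {10} (# 1) ; qq = atom {10} (# 2) ; dxk = atom {10} (# 3) ; Dk = atom {10} (# 4)
      ph = atom {10} (# 5) ; qh = atom {10} (# 6) ; st = atom {10} (# 7) ; DD = atom {10} (# 8) ; ddr = atom {10} (# 9)
      rr = pp :+ nn :* qq
      Eh = ddr :+ :- (rr :* (dxk :* Dk))
      eL = Eh :* ph :+ :- (Eh :* qh) :+ (st :* Eh) :* DD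
      eR2 = rr :* (DD :* (st :* ph) :+ :- (ph :* qh) :+ :- ((dxk :* Dk) :* ph) :+ (dxk :* Dk) :* qh :+ :- ((st :* (dxk :* Dk)) :* DD))

  -- The substituted coordinates, and the reduction of the substituted form:
  -- every summand is reduced (reduce-subst), the sum has denominator R·Δ because
  -- the diagonal summand at (k , k) has (substTag-hasR).
  XS : Fin n → Frac n m
  XS i = if i == k then (R / xk) else varX i

  sumTag : Fin n → Fin n → Tagged
  sumTag i j = if i == k then (if j == k then (true , 𝟘) else (true , Kr i j)) else (if j == k then (true , Kc i j) else (false , Zterm (B i j) i j))
  sumTagOdd : Fin m → Fin n → Fin m → Tagged
  sumTagOdd a ℓ b = if ℓ == k then (true , Ko a ℓ b) else (false , Yterm (T a ℓ b) a ℓ b)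

  reduce-subst : ∀ i j → (natF (B i j) *F ((dF (XS i) *F dF (XS j)) *F invF (XS i *F XS j))) ⊒ ⟦ sumTag i j ⟧T
  reduce-subst i j with i == k | j == k
  ... | true | true = reduce-k-k i j
  ... | true | false = reduce-row-k i j
  ... | false | true = reduce-col-k i j
  ... | false | false = reduce-plain (B i j) i j

  reduce-subst-odd : ∀ a ℓ b → (natF (T a ℓ b) *F ((dF (varΞ a *F varΞ b) *F dF (XS ℓ)) *F invF (XS ℓ))) ⊒ ⟦ sumTagOdd a ℓ b ⟧T
  reduce-subst-odd a ℓ b with ℓ == k
  ... | true = reduce-odd-k a ℓ b
  ... | false = reduce-odd (T a ℓ b) a ℓ b

  substTag : Tagged
  substTag = foldT (λ i → foldT (sumTag i)) ⊕T foldT (λ a → foldT (λ ℓ → foldT (sumTagOdd a ℓ)))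

  subst-reduces₀ : omegaSubst Qd k ⊒ ⟦ substTag ⟧T
  subst-reduces₀ = ⊒-trans (⊒-+ (sum-red _ (λ i → foldT (sumTag i)) (λ i → sum-red _ (sumTag i) (reduce-subst i)))
                      (sum-red _ (λ a → foldT (λ ℓ → foldT (sumTagOdd a ℓ))) (λ a → sum-red _ (λ ℓ → foldT (sumTagOdd a ℓ)) (λ ℓ → sum-red _ (sumTagOdd a ℓ) (reduce-subst-odd a ℓ)))))
                 (⊕T-red (foldT (λ i → foldT (sumTag i))) (foldT (λ a → foldT (λ ℓ → foldT (sumTagOdd a ℓ)))))

  substTag-hasR : proj₁ substTag ≡ true
  substTag-hasR = trans (tag-⊕ (foldT (λ i → foldT (sumTag i))) (foldT (λ a → foldT (λ ℓ → foldT (sumTagOdd a ℓ))))) (cong (_∨ proj₁ (foldT (λ a → foldT (λ ℓ → foldT (sumTagOdd a ℓ))))) (tag-fold (λ i → foldT (sumTag i)) k (tag-fold (sumTag k) k diagonal)))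
    where diagonal : proj₁ (sumTag k k) ≡ true
          diagonal rewrite ==-refl k = refl

  Z : Fin n → Fin n → SP n m
  Z i j = (dX i ⊠ dX j) ⊠ (Dx i ⊠ Dx j)
  Y : Fin m → Fin n → Fin m → SP n m
  Y a ℓ b = (dξξ a b ⊠ dX ℓ) ⊠ (Dx ℓ ⊠ D)
  EP : (Fin n → Fin n → ℤ) → SP n m
  EP c = ΣS (λ i → ΣS (λ j → scaleSP (c i j) (Z i j)))
  OP : (Fin m → Fin n → Fin m → ℤ) → SP n m
  OP c = ΣS (λ a → ΣS (λ ℓ → ΣS (λ b → scaleSP (c a ℓ b) (Y a ℓ b))))

  mS : Fin n → Fin n → ℤ
  mS i j = if i == k then + 0 else (if j == k then + 0 else + B i j)
  mO : Fin m → Fin n → Fin m → ℤ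
  mO a ℓ b = if ℓ == k then + 0 else + T a ℓ b

  Zterm-scale : ∀ c i j → Zterm c i j ≈ scaleSP (+ c) (Z i j)
  Zterm-scale c i j = ≈-trans (*-assoc (cN c) (dX i ⊠ dX j) (Dx i ⊠ Dx j)) (≈-sym (scale-const (+ c) (Z i j)))
  Yterm-scale : ∀ c a ℓ b → Yterm c a ℓ b ≈ scaleSP (+ c) (Y a ℓ b)
  Yterm-scale c a ℓ b = ≈-trans (*-assoc (cN c) (dξξ a b ⊠ dX ℓ) (Dx ℓ ⊠ D)) (≈-sym (scale-const (+ c) (Y a ℓ b)))

  cN0 : ∀ {c} → c ≡ 0 → cN c ≈ 𝟘
  cN0 refl = const0

  R0 : ∀ (Zz : SP n m) → 𝟘 ≈ R ⊠ scaleSP (+ 0) Zz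
  R0 Zz = ≈-sym (≈-trans (*-congʳ R (scale-0 Zz)) (zeroʳ R))

  numer-sumTag : ∀ i j → numer (sumTag i j) ≈ (if i == k then Kr i j else 𝟘) ⊞ (if j == k then Kc i j else 𝟘) ⊞ R ⊠ scaleSP (mS i j) (Z i j)
  numer-sumTag i j with i == k in ei | j == k in ej
  ... | true | true = ≈-sym (≈-trans (+-cong (+-cong kr kc) (≈-sym (R0 (Z i j)))) ≈-refl)
    where
      Bij : B i j ≡ 0
      Bij = trans (cong₂ B (==-true ei) (==-true ej)) (noLoop k)
      kr : Kr i j ≈ 𝟘
      kr = ≈-trans (*-congˡ (Dx j) (≈-trans (*-congˡ (Ehat ⊠ dX j) (cN0 Bij)) (zeroˡ (Ehat ⊠ dX j)))) (zeroˡ (Dx j))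
      kc : Kc i j ≈ 𝟘
      kc = ≈-trans (*-congˡ (Dx i) (≈-trans (*-congˡ (dX i ⊠ Ehat) (cN0 Bij)) (zeroˡ (dX i ⊠ Ehat)))) (zeroˡ (Dx i))
  ... | true | false = ≈-sym (≈-trans (+-cong {p = Kr i j ⊞ 𝟘} {p' = Kr i j} (+-idʳ (Kr i j)) (≈-sym (R0 (Z i j)))) (+-idʳ (Kr i j)))
  ... | false | true = ≈-sym (≈-trans (+-cong {p = 𝟘 ⊞ Kc i j} {p' = Kc i j} ≈-refl (≈-sym (R0 (Z i j)))) (+-idʳ (Kc i j)))
  ... | false | false = *-congʳ R (Zterm-scale (B i j) i j)

  numer-sumTagOdd : ∀ a ℓ b → numer (sumTagOdd a ℓ b) ≈ (if ℓ == k then Ko a ℓ b else 𝟘) ⊞ R ⊠ scaleSP (mO a ℓ b) (Y a ℓ b)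
  numer-sumTagOdd a ℓ b with ℓ == k
  ... | true = ≈-sym (≈-trans (+-cong {p = Ko a ℓ b} {p' = Ko a ℓ b} ≈-refl (≈-sym (R0 (Y a ℓ b)))) (+-idʳ (Ko a ℓ b)))
  ... | false = *-congʳ R (Yterm-scale (T a ℓ b) a ℓ b)

  Σ3 : ∀ {K} (f g h : Fin K → SP n m) → ΣS (λ i → f i ⊞ g i ⊞ h i) ≈ ΣS f ⊞ ΣS g ⊞ ΣS h
  Σ3 f g h = ≈-trans (Σ-+ (λ i → f i ⊞ g i) h) (+-cong (Σ-+ f g) ≈-refl)

  Kpart : SP n m
  Kpart = ΣS (λ j → Kr k j) ⊞ ΣS (λ i → Kc i k) ⊞ ΣS (λ a → ΣS (λ b → Ko a k b))

  numer-substTag : numer substTag ≈ Kpart ⊞ R ⊠ (EP mS ⊞ OP mO)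
  numer-substTag =
    ≈-trans (numer-⊕ (foldT (λ i → foldT (sumTag i))) (foldT (λ a → foldT (λ ℓ → foldT (sumTagOdd a ℓ)))))
    (≈-trans (+-cong (≈-trans (numer-fold (λ i → foldT (sumTag i))) (Σ-cong λ i → ≈-trans (numer-fold (sumTag i)) (Σ-cong λ j → numer-sumTag i j)))
                     (≈-trans (numer-fold (λ a → foldT (λ ℓ → foldT (sumTagOdd a ℓ)))) (Σ-cong λ a → ≈-trans (numer-fold (λ ℓ → foldT (sumTagOdd a ℓ)))
                        (Σ-cong λ ℓ → ≈-trans (numer-fold (sumTagOdd a ℓ)) (Σ-cong λ b → numer-sumTagOdd a ℓ b)))))
    (≈-trans (+-cong (≈-trans (Σ-cong λ i → Σ3 (rr i) (cc i) (ee i)) (Σ3 (λ i → ΣS (rr i)) (λ i → ΣS (cc i)) (λ i → ΣS (ee i))))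
                     (≈-trans (Σ-cong λ a → ≈-trans (Σ-cong λ ℓ → Σ-+ (oo a ℓ) (ow a ℓ)) (Σ-+ (λ ℓ → ΣS (oo a ℓ)) (λ ℓ → ΣS (ow a ℓ))))
                        (Σ-+ (λ a → ΣS (λ ℓ → ΣS (oo a ℓ))) (λ a → ΣS (λ ℓ → ΣS (ow a ℓ))))))
    (≈-trans (+-cong (+-cong (+-cong rowK colK) evR) (+-cong oddK oddR))
      shuffle)))
    where
      rr cc ee : Fin n → Fin n → SP n m
      rr i j = if i == k then Kr i j else 𝟘
      cc i j = if j == k then Kc i j else 𝟘
      ee i j = R ⊠ scaleSP (mS i j) (Z i j)
      oo ow : Fin m → Fin n → Fin m → SP n m
      oo a ℓ b = if ℓ == k then Ko a ℓ b else 𝟘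
      ow a ℓ b = R ⊠ scaleSP (mO a ℓ b) (Y a ℓ b)
      rowK : ΣS (λ i → ΣS (λ j → if i == k then Kr i j else 𝟘)) ≈ ΣS (λ j → Kr k j)
      rowK = ≈-trans (Σ-cong λ i → Σ-if (i == k) (Kr i)) (Σ-δ' k (λ i → ΣS (Kr i)))
      colK : ΣS (λ i → ΣS (λ j → if j == k then Kc i j else 𝟘)) ≈ ΣS (λ i → Kc i k)
      colK = Σ-cong λ i → Σ-δ' k (Kc i)
      evR : ΣS (λ i → ΣS (λ j → R ⊠ scaleSP (mS i j) (Z i j))) ≈ R ⊠ EP mS
      evR = ≈-sym (≈-trans (Σ-⊠ˡ R (λ i → ΣS (λ j → scaleSP (mS i j) (Z i j)))) (Σ-cong λ i → Σ-⊠ˡ R (λ j → scaleSP (mS i j) (Z i j))))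
      oddK : ΣS (λ a → ΣS (λ ℓ → ΣS (λ b → if ℓ == k then Ko a ℓ b else 𝟘))) ≈ ΣS (λ a → ΣS (λ b → Ko a k b))
      oddK = Σ-cong λ a → ≈-trans (Σ-cong λ ℓ → Σ-if (ℓ == k) (λ b → Ko a ℓ b)) (Σ-δ' k (λ ℓ → ΣS (λ b → Ko a ℓ b)))
      oddR : ΣS (λ a → ΣS (λ ℓ → ΣS (λ b → R ⊠ scaleSP (mO a ℓ b) (Y a ℓ b)))) ≈ R ⊠ OP mO
      oddR = ≈-sym (≈-trans (Σ-⊠ˡ R (λ a → ΣS (λ ℓ → ΣS (λ b → scaleSP (mO a ℓ b) (Y a ℓ b))))) (Σ-cong λ a → ≈-trans (Σ-⊠ˡ R (λ ℓ → ΣS (λ b → scaleSP (mO a ℓ b) (Y a ℓ b))))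
               (Σ-cong λ ℓ → Σ-⊠ˡ R (λ b → scaleSP (mO a ℓ b) (Y a ℓ b)))))
      Kk1 = ΣS (λ j → Kr k j)
      Kk2 = ΣS (λ i → Kc i k)
      Kk3 = ΣS (λ a → ΣS (λ b → Ko a k b))
      shuffle : ((Kk1 ⊞ Kk2) ⊞ R ⊠ EP mS) ⊞ (Kk3 ⊞ R ⊠ OP mO) ≈ Kpart ⊞ R ⊠ (EP mS ⊞ OP mO)
      shuffle = ≈-trans (⊞-shuffle (Kk1 ⊞ Kk2) (R ⊠ EP mS) Kk3 (R ⊠ OP mO)) (+-cong ≈-refl (≈-sym (distribˡ R (EP mS) (OP mO))))

  EP-+ : ∀ c d → EP c ⊞ EP d ≈ EP (λ i j → c i j + d i j)
  EP-+ c d = ≈-sym (≈-trans (Σ-cong λ i → ≈-trans (Σ-cong λ j → scale-distr (c i j) (d i j) (Z i j)) (Σ-+ (λ j → scaleSP (c i j) (Z i j)) (λ j → scaleSP (d i j) (Z i j))))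
                    (Σ-+ (λ i → ΣS (λ j → scaleSP (c i j) (Z i j))) (λ i → ΣS (λ j → scaleSP (d i j) (Z i j)))))

  OP-+ : ∀ c d → OP c ⊞ OP d ≈ OP (λ a ℓ b → c a ℓ b + d a ℓ b)
  OP-+ c d = ≈-sym (≈-trans (Σ-cong λ a → ≈-trans (Σ-cong λ ℓ → ≈-trans (Σ-cong λ b → scale-distr (c a ℓ b) (d a ℓ b) (Y a ℓ b))
                        (Σ-+ (λ b → scaleSP (c a ℓ b) (Y a ℓ b)) (λ b → scaleSP (d a ℓ b) (Y a ℓ b))))
                        (Σ-+ (λ ℓ → ΣS (λ b → scaleSP (c a ℓ b) (Y a ℓ b))) (λ ℓ → ΣS (λ b → scaleSP (d a ℓ b) (Y a ℓ b)))))
                    (Σ-+ (λ a → ΣS (λ ℓ → ΣS (λ b → scaleSP (c a ℓ b) (Y a ℓ b)))) (λ a → ΣS (λ ℓ → ΣS (λ b → scaleSP (d a ℓ b) (Y a ℓ b))))))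

  rowEP : ∀ (f : Fin n → Fin n → ℤ) → EP (λ i j → if i == k then f i j else + 0) ≈ ΣS (λ j → scaleSP (f k j) (Z k j))
  rowEP f = ≈-trans (Σ-cong λ i → ≈-trans (Σ-cong λ j → scale-if (i == k) (f i j) (Z i j)) (Σ-if (i == k) (λ j → scaleSP (f i j) (Z i j))))
            (Σ-δ' k (λ i → ΣS (λ j → scaleSP (f i j) (Z i j))))

  midOP : ∀ (f : Fin m → Fin n → Fin m → ℤ) → OP (λ a ℓ b → if ℓ == k then f a ℓ b else + 0) ≈ ΣS (λ a → ΣS (λ b → scaleSP (f a k b) (Y a k b)))
  midOP f = Σ-cong λ a → ≈-trans (Σ-cong λ ℓ → ≈-trans (Σ-cong λ b → scale-if (ℓ == k) (f a ℓ b) (Y a ℓ b)) (Σ-if (ℓ == k) (λ b → scaleSP (f a ℓ b) (Y a ℓ b))))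
            (Σ-δ' k (λ ℓ → ΣS (λ b → scaleSP (f a ℓ b) (Y a ℓ b))))

  reorder-row : ∀ (c E u v : SP n m) → EvenSP c → OddSP E → OddSP u → EvenSP v → c ⊠ (E ⊠ u) ⊠ v ≈ E ⊠ (c ⊠ (u ⊠ v))
  reorder-row c E u v ec oE ou ev' = Solver.solve ρ ((B0 :* (B1 :* B2)) :* B3) (B1 :* (B0 :* (B2 :* B3))) refl
    where ρ : Vec (Atom n m) 4
          ρ = ev c ec ∷v od E oE ∷v od u ou ∷v ev v ev' ∷v []v
          B0 = atom {4} (# 0) ; B1 = atom {4} (# 1) ; B2 = atom {4} (# 2) ; B3 = atom {4} (# 3)

  reorder-col : ∀ (c E u v : SP n m) → EvenSP c → OddSP E → OddSP u → EvenSP v → c ⊠ (u ⊠ E) ⊠ v ≈ ⊟ (E ⊠ (c ⊠ (u ⊠ v)))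
  reorder-col c E u v ec oE ou ev' = Solver.solve ρ ((B0 :* (B2 :* B1)) :* B3) (:- (B1 :* (B0 :* (B2 :* B3)))) refl
    where ρ : Vec (Atom n m) 4
          ρ = ev c ec ∷v od E oE ∷v od u ou ∷v ev v ev' ∷v []v
          B0 = atom {4} (# 0) ; B1 = atom {4} (# 1) ; B2 = atom {4} (# 2) ; B3 = atom {4} (# 3)

  reorder-odd : ∀ (c u E v : SP n m) → EvenSP c → OddSP u → OddSP E → EvenSP v → c ⊠ (u ⊠ E) ⊠ v ≈ ((c ⊠ u) ⊠ E) ⊠ v
  reorder-odd c u E v ec ou oE ev' = Solver.solve ρ ((B0 :* (B1 :* B2)) :* B3) (((B0 :* B1) :* B2) :* B3) refl
    where ρ : Vec (Atom n m) 4
          ρ = ev c ec ∷v od u ou ∷v od E oE ∷v ev v ev' ∷v []v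
          B0 = atom {4} (# 0) ; B1 = atom {4} (# 1) ; B2 = atom {4} (# 2) ; B3 = atom {4} (# 3)

  p̂-term : Fin n → SP n m
  p̂-term j = scaleSP (+ B k j) (dX j ⊠ Dx j)
  q̂-term : Fin n → SP n m
  q̂-term i = scaleSP (+ B i k) (dX i ⊠ Dx i)
  σ̃-term : Fin m → Fin m → SP n m
  σ̃-term a b = scaleSP (+ T a k b) (dξξ a b)

  Kpart-factor : Kpart ≈ Kfactored
  Kpart-factor = +-cong (+-cong row-k col-k) odd-k
    where
      row-k : ΣS (λ j → Kr k j) ≈ Ehat ⊠ p̂
      row-k = ≈-trans (Σ-cong λ j → ≈-trans (reorder-row (cN (B k j)) Ehat (dX j) (Dx j) (eN (B k j)) oEh (oX j) (eDx j))
                     (*-congʳ Ehat (≈-sym (scale-const (+ B k j) (dX j ⊠ Dx j)))))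
             (≈-sym (Σ-⊠ˡ Ehat (λ j → scaleSP (+ B k j) (dX j ⊠ Dx j))))
      col-k : ΣS (λ i → Kc i k) ≈ ⊟ (Ehat ⊠ q̂)
      col-k = ≈-trans (Σ-cong λ i → ≈-trans (reorder-col (cN (B i k)) Ehat (dX i) (Dx i) (eN (B i k)) oEh (oX i) (eDx i))
                     (⊟-cong (*-congʳ Ehat (≈-sym (scale-const (+ B i k) (dX i ⊠ Dx i))))))
             (≈-sym (≈-trans (⊟-cong (Σ-⊠ˡ Ehat (λ i → scaleSP (+ B i k) (dX i ⊠ Dx i)))) (Σ-⊟ (λ i → Ehat ⊠ scaleSP (+ B i k) (dX i ⊠ Dx i)))))
      odd-k : ΣS (λ a → ΣS (λ b → Ko a k b)) ≈ (σ̃ ⊠ Ehat) ⊠ D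
      odd-k = ≈-trans (Σ-cong λ a → Σ-cong λ b → ≈-trans (reorder-odd (cN (T a k b)) (dξξ a b) Ehat D (eN (T a k b)) (odξξ a b) oEh eD)
                      (*-congˡ D (*-congˡ Ehat (≈-sym (scale-const (+ T a k b) (dξξ a b))))))
           (≈-sym (≈-trans (*-congˡ D (Σ-⊠ʳ Ehat (λ a → ΣS (σ̃-term a)))) (≈-trans (Σ-⊠ʳ D (λ a → ΣS (σ̃-term a) ⊠ Ehat))
              (Σ-cong λ a → ≈-trans (*-congˡ D (Σ-⊠ʳ Ehat (σ̃-term a))) (Σ-⊠ʳ D (λ b → σ̃-term a b ⊠ Ehat))))))

  -- The coefficients record the
  -- contributions of 2-paths i → k → j (cPath), of arrows out of and into k
  -- (cOutK, cInK), and the corresponding odd contributions (cOddPath, cOddK).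
  cPath cOutK cInK : Fin n → Fin n → ℤ
  cPath i j = + B i k * + B k j
  cOutK i j = if i == k then - (+ B i j) else + 0
  cInK i j = if i == k then + B j i else + 0
  cOddPath cOddK : Fin m → Fin n → Fin m → ℤ
  cOddPath a ℓ b = + T a k b * + B k ℓ
  cOddK a ℓ b = if ℓ == k then - (+ T a ℓ b) else + 0

  Wk : SP n m
  Wk = dX k ⊠ Dx k

  Z-flip : ∀ i j → (dX j ⊠ Dx j) ⊠ (dX i ⊠ Dx i) ≈ ⊟ (Z i j)
  Z-flip i j = Solver.solve ρ ((B1 :* B3) :* (B0 :* B2)) (:- ((B0 :* B1) :* (B2 :* B3))) refl
    where ρ : Vec (Atom n m) 4
          ρ = od (dX i) (oX i) ∷v od (dX j) (oX j) ∷v ev (Dx i) (eDx i) ∷v ev (Dx j) (eDx j) ∷v []v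
          B0 = atom {4} (# 0) ; B1 = atom {4} (# 1) ; B2 = atom {4} (# 2) ; B3 = atom {4} (# 3)

  Wk-Z : ∀ j → Wk ⊠ (dX j ⊠ Dx j) ≈ Z k j
  Wk-Z j = Solver.solve ρ ((B0 :* B2) :* (B1 :* B3)) ((B0 :* B1) :* (B2 :* B3)) refl
    where ρ : Vec (Atom n m) 4
          ρ = od (dX k) (oX k) ∷v od (dX j) (oX j) ∷v ev (Dx k) (eDx k) ∷v ev (Dx j) (eDx j) ∷v []v
          B0 = atom {4} (# 0) ; B1 = atom {4} (# 1) ; B2 = atom {4} (# 2) ; B3 = atom {4} (# 3)

  D-Y : ∀ a ℓ b → D ⊠ (dξξ a b ⊠ (dX ℓ ⊠ Dx ℓ)) ≈ Y a ℓ b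
  D-Y a ℓ b = Solver.solve ρ (B0 :* (B1 :* (B2 :* B3))) ((B1 :* B2) :* (B3 :* B0)) refl
    where ρ : Vec (Atom n m) 4
          ρ = ev D eD ∷v od (dξξ a b) (odξξ a b) ∷v od (dX ℓ) (oX ℓ) ∷v ev (Dx ℓ) (eDx ℓ) ∷v []v
          B0 = atom {4} (# 0) ; B1 = atom {4} (# 1) ; B2 = atom {4} (# 2) ; B3 = atom {4} (# 3)

  Y-Wk : ∀ a b → (dξξ a b ⊠ Wk) ⊠ D ≈ Y a k b
  Y-Wk a b = Solver.solve ρ ((B1 :* (B2 :* B3)) :* B0) ((B1 :* B2) :* (B3 :* B0)) refl
    where ρ : Vec (Atom n m) 4
          ρ = ev D eD ∷v od (dξξ a b) (odξξ a b) ∷v od (dX k) (oX k) ∷v ev (Dx k) (eDx k) ∷v []v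
          B0 = atom {4} (# 0) ; B1 = atom {4} (# 1) ; B2 = atom {4} (# 2) ; B3 = atom {4} (# 3)

  expand-pq : ⊟ (p̂ ⊠ q̂) ≈ EP cPath
  expand-pq = ≈-trans (⊟-cong (≈-trans (Σ-⊠ʳ q̂ p̂-term) (≈-trans (Σ-cong λ j → Σ-⊠ˡ (p̂-term j) q̂-term) (Σ-swap (λ j i → p̂-term j ⊠ q̂-term i)))))
       (≈-trans (Σ-⊟ (λ i → ΣS (λ j → p̂-term j ⊠ q̂-term i)))
       (Σ-cong λ i → ≈-trans (Σ-⊟ (λ j → p̂-term j ⊠ q̂-term i)) (Σ-cong λ j →
          ≈-trans (⊟-cong (≈-trans (scale-** (+ B k j) (+ B i k) (dX j ⊠ Dx j) (dX i ⊠ Dx i)) (scale-cong (+ B k j * + B i k) (Z-flip i j))))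
          (≈-trans (negneg (+ B k j * + B i k) (Z i j)) (scale-≡ (Z i j) (ℤP.*-comm (+ B k j) (+ B i k)))))))

  expand-Wp : ⊟ (Wk ⊠ p̂) ≈ EP cOutK
  expand-Wp = ≈-trans (⊟-cong (Σ-⊠ˡ Wk p̂-term)) (≈-trans (Σ-⊟ (λ j → Wk ⊠ p̂-term j))
       (≈-trans (Σ-cong λ j → ≈-trans (⊟-cong (≈-trans (scale-*ʳ (+ B k j) Wk (dX j ⊠ Dx j)) (scale-cong (+ B k j) (Wk-Z j)))) (neg-scale (+ B k j) (Z k j)))
        (≈-sym (rowEP (λ i j → - (+ B i j))))))

  expand-Wq : Wk ⊠ q̂ ≈ EP cInK
  expand-Wq = ≈-trans (Σ-⊠ˡ Wk q̂-term) (≈-trans (Σ-cong λ l → ≈-trans (scale-*ʳ (+ B l k) Wk (dX l ⊠ Dx l)) (scale-cong (+ B l k) (Wk-Z l)))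
        (≈-sym (rowEP (λ i j → + B j i))))

  expand-σp : D ⊠ (σ̃ ⊠ p̂) ≈ OP cOddPath
  expand-σp = ≈-trans (*-congʳ D (≈-trans (Σ-⊠ʳ p̂ (λ a → ΣS (σ̃-term a))) (Σ-cong λ a → ≈-trans (Σ-⊠ʳ p̂ (σ̃-term a)) (Σ-cong λ b → Σ-⊠ˡ (σ̃-term a b) p̂-term))))
       (≈-trans (Σ-⊠ˡ D (λ a → ΣS (λ b → ΣS (λ ℓ → σ̃-term a b ⊠ p̂-term ℓ))))
       (Σ-cong λ a → ≈-trans (Σ-⊠ˡ D (λ b → ΣS (λ ℓ → σ̃-term a b ⊠ p̂-term ℓ)))
         (≈-trans (Σ-cong λ b → Σ-⊠ˡ D (λ ℓ → σ̃-term a b ⊠ p̂-term ℓ))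
         (≈-trans (Σ-swap (λ b ℓ → D ⊠ (σ̃-term a b ⊠ p̂-term ℓ)))
         (Σ-cong λ ℓ → Σ-cong λ b →
            ≈-trans (*-congʳ D (scale-** (+ T a k b) (+ B k ℓ) (dξξ a b) (dX ℓ ⊠ Dx ℓ)))
            (≈-trans (scale-*ʳ (+ T a k b * + B k ℓ) D (dξξ a b ⊠ (dX ℓ ⊠ Dx ℓ))) (scale-cong (+ T a k b * + B k ℓ) (D-Y a ℓ b))))))))

  expand-σW : ⊟ ((σ̃ ⊠ Wk) ⊠ D) ≈ OP cOddK
  expand-σW = ≈-trans (⊟-cong (≈-trans (*-congˡ D (≈-trans (Σ-⊠ʳ Wk (λ a → ΣS (σ̃-term a))) (Σ-cong λ a → Σ-⊠ʳ Wk (σ̃-term a))))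
                         (≈-trans (Σ-⊠ʳ D (λ a → ΣS (λ b → σ̃-term a b ⊠ Wk))) (Σ-cong λ a → Σ-⊠ʳ D (λ b → σ̃-term a b ⊠ Wk)))))
       (≈-trans (Σ-⊟ (λ a → ΣS (λ b → (σ̃-term a b ⊠ Wk) ⊠ D)))
       (≈-trans (Σ-cong λ a → ≈-trans (Σ-⊟ (λ b → (σ̃-term a b ⊠ Wk) ⊠ D)) (Σ-cong λ b →
           ≈-trans (⊟-cong (≈-trans (*-congˡ D (scale-*ˡ (+ T a k b) (dξξ a b) Wk)) (≈-trans (scale-*ˡ (+ T a k b) (dξξ a b ⊠ Wk) D)
              (scale-cong (+ T a k b) (Y-Wk a b))))) (neg-scale (+ T a k b) (Y a k b))))
        (≈-sym (midOP (λ a ℓ b → - (+ T a ℓ b))))))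

  cK : Fin n → Fin n → ℤ
  cK i j = (cPath i j + cOutK i j) + cInK i j
  cK' : Fin m → Fin n → Fin m → ℤ
  cK' a ℓ b = cOddPath a ℓ b + cOddK a ℓ b

  Kreduced-expand : Kreduced ≈ EP cK ⊞ OP cK'
  Kreduced-expand = ≈-trans (+-cong (+-cong (+-cong (+-cong expand-σp expand-pq) expand-Wp) expand-Wq) expand-σW)
    (≈-trans (rearr (OP cOddPath) (EP cPath) (EP cOutK) (EP cInK) (OP cOddK))
      (+-cong (≈-trans (+-cong (EP-+ cPath cOutK) ≈-refl) (EP-+ (λ i j → cPath i j + cOutK i j) cInK)) (OP-+ cOddPath cOddK)))
    where
      rearr : ∀ (a b c d e : SP n m) → (((a ⊞ b) ⊞ c) ⊞ d) ⊞ e ≈ ((b ⊞ c) ⊞ d) ⊞ (a ⊞ e)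
      rearr a b c d e = ≈-trans (+-cong (≈-trans (+-cong (+-assoc a b c) ≈-refl) (+-assoc a (b ⊞ c) d)) ≈-refl)
        (≈-trans (+-cong (+-comm a ((b ⊞ c) ⊞ d)) ≈-refl) (+-assoc ((b ⊞ c) ⊞ d) a e))

  Zanti : ∀ i j → Z j i ≈ ⊟ (Z i j)
  Zanti i j = Solver.solve ρ ((B1 :* B0) :* (B3 :* B2)) (:- ((B0 :* B1) :* (B2 :* B3))) refl
    where ρ : Vec (Atom n m) 4
          ρ = od (dX i) (oX i) ∷v od (dX j) (oX j) ∷v ev (Dx i) (eDx i) ∷v ev (Dx j) (eDx j) ∷v []v
          B0 = atom {4} (# 0) ; B1 = atom {4} (# 1) ; B2 = atom {4} (# 2) ; B3 = atom {4} (# 3)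

  Yanti : ∀ ℓ a b → Y b ℓ a ≈ ⊟ (Y a ℓ b)
  Yanti ℓ a b = solveVia ρ' ρ σv sv ((E1 :* xl) :* (Dl :* DD)) (:- ((E0 :* xl) :* (Dl :* DD))) refl
    where
      ρ' : Vec (Atom n m) 7
      ρ' = ev (genSP (dξ a)) (refl , tt) ∷v od (genSP (ξ a)) (refl , tt) ∷v ev (genSP (dξ b)) (refl , tt) ∷v od (genSP (ξ b)) (refl , tt) ∷v
           od (dX ℓ) (oX ℓ) ∷v ev (Dx ℓ) (eDx ℓ) ∷v ev D eD ∷v []v
      ρ : Vec (Atom n m) 5
      ρ = od (dξξ a b) (odξξ a b) ∷v od (dξξ b a) (odξξ b a) ∷v od (dX ℓ) (oX ℓ) ∷v ev (Dx ℓ) (eDx ℓ) ∷v ev D eD ∷v []v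
      σv : Vec (Expr 7) 5
      σv = (atom (# 0) :* atom (# 3) :+ (:- atom (# 1)) :* atom (# 2)) ∷v (atom (# 2) :* atom (# 1) :+ (:- atom (# 3)) :* atom (# 0)) ∷v
           atom (# 4) ∷v atom (# 5) ∷v atom (# 6) ∷v []v
      fl : ∀ (a' b' : Fin m) → dξξ a' b' ≈ genSP (dξ a') ⊠ genSP (ξ b') ⊞ (⊟ (genSP (ξ a'))) ⊠ genSP (dξ b')
      fl a' b' = ≈-trans (d-ξξ a' b') (+-cong {p = genSP (dξ a') ⊠ genSP (ξ b')} {p' = genSP (dξ a') ⊠ genSP (ξ b')} ≈-refl
                  (*-congˡ (genSP (dξ b')) (flip-hom (genSP (ξ a')) (refl , tt))))
      sv : AtomSubst ρ' ρ σv
      sv = fl a b ∷s fl b a ∷s ≈-refl ∷s ≈-refl ∷s ≈-refl ∷s []s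
      E0 = atom {5} (# 0) ; E1 = atom {5} (# 1) ; xl = atom {5} (# 2) ; Dl = atom {5} (# 3) ; DD = atom {5} (# 4)

  B' : Fin n → Fin n → ℕ
  B' = QData.B (mutate Qd k)
  T' : Fin m → Fin n → Fin m → ℕ
  T' = QData.T (mutate Qd k)

  coeffS : Fin n → Fin n → ℤ
  coeffS i j = mS i j + cK i j
  coeffSOdd : Fin m → Fin n → Fin m → ℤ
  coeffSOdd a ℓ b = mO a ℓ b + cK' a ℓ b

  -- The mutation rule in the form used here: the coefficients of the substituted
  -- form and the mutated multiplicities have the same antisymmetrisation.
  mutation-antisym-offdiag : ∀ i j → ¬ i ≡ j → coeffS i j - coeffS j i ≡ + B' i j - + B' j i
  mutation-antisym-offdiag i j i≢j with i == k in ei | j == k in ej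
  ... | false | false = trans (simplify (B i j) (B j i) (B i k) (B k j) (B j k) (B k i))
          (sym (monus-antisym-+* (B i j) (B i k) (B k j) (B j i) (B j k) (B k i)))
    where ring-identity : ∀ (a b p q r s : ℤ) → (a + (((p * q) + + 0) + + 0)) - (b + (((r * s) + + 0) + + 0)) ≡ (a + p * q) - (b + r * s)
          ring-identity = solve-∀
          simplify : ∀ a b p q r s → (+ a + (((+ p * + q) + + 0) + + 0)) - (+ b + (((+ r * + s) + + 0) + + 0)) ≡ (+ a + + p * + q) - (+ b + + r * + s)
          simplify a b p q r s = ring-identity (+ a) (+ b) (+ p) (+ q) (+ r) (+ s)
  ... | true | false with ==-true ei
  ... | refl rewrite noLoop k = simplify (B k j) (B j k) (B j k)
    where ring-identity : ∀ (a b c : ℤ) → (+ 0 + (((+ 0 * a) + (- a)) + b)) - (+ 0 + (((c * + 0) + + 0) + + 0)) ≡ b - a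
          ring-identity = solve-∀
          simplify : ∀ a b c → (+ 0 + (((+ 0 * + a) + (- + a)) + + b)) - (+ 0 + (((+ c * + 0) + + 0) + + 0)) ≡ + b - + a
          simplify a b c = ring-identity (+ a) (+ b) (+ c)
  mutation-antisym-offdiag i j i≢j | false | true with ==-true ej
  ... | refl rewrite noLoop k = simplify (B k i) (B i k) (B i k)
    where ring-identity : ∀ (a b c : ℤ) → (+ 0 + (((c * + 0) + + 0) + + 0)) - (+ 0 + (((+ 0 * a) + (- a)) + b)) ≡ a - b
          ring-identity = solve-∀
          simplify : ∀ a b c → (+ 0 + (((+ c * + 0) + + 0) + + 0)) - (+ 0 + (((+ 0 * + a) + (- + a)) + + b)) ≡ + a - + b
          simplify a b c = ring-identity (+ a) (+ b) (+ c)
  mutation-antisym-offdiag i j i≢j | true | true = ⊥-elim (i≢j (trans (==-true ei) (sym (==-true ej))))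

  mutation-antisym : ∀ i j → coeffS i j - coeffS j i ≡ + B' i j - + B' j i
  mutation-antisym i j with i Fin.≟ j
  ... | yes refl = trans (ℤP.+-inverseʳ (coeffS i i)) (sym (ℤP.+-inverseʳ (+ B' i i)))
  ... | no i≢j = mutation-antisym-offdiag i j i≢j

  mutation-antisym-odd : ∀ ℓ a b → coeffSOdd a ℓ b - coeffSOdd b ℓ a ≡ + T' a ℓ b - + T' b ℓ a
  mutation-antisym-odd ℓ a b with ℓ == k in el
  ... | false = trans (simplify (T a ℓ b) (T b ℓ a) (T a k b) (T b k a) (B k ℓ))
          (sym (monus-antisym-+* (T a ℓ b) (T a k b) (B k ℓ) (T b ℓ a) (T b k a) (B k ℓ)))
    where ring-identity : ∀ (p q r s t : ℤ) → (p + ((r * t) + + 0)) - (q + ((s * t) + + 0)) ≡ (p + r * t) - (q + s * t)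
          ring-identity = solve-∀
          simplify : ∀ p q r s t → (+ p + ((+ r * + t) + + 0)) - (+ q + ((+ s * + t) + + 0)) ≡ (+ p + + r * + t) - (+ q + + s * + t)
          simplify p q r s t = ring-identity (+ p) (+ q) (+ r) (+ s) (+ t)
  ... | true with ==-true el
  ... | refl rewrite noLoop k = simplify (T a k b) (T b k a)
    where ring-identity : ∀ (p q : ℤ) → (+ 0 + ((p * + 0) + (- p))) - (+ 0 + ((q * + 0) + (- q))) ≡ q - p
          ring-identity = solve-∀
          simplify : ∀ p q → (+ 0 + ((+ p * + 0) + (- + p))) - (+ 0 + ((+ q * + 0) + (- + q))) ≡ + q - + p
          simplify p q = ring-identity (+ p) (+ q)

  Wsubst : SP n m
  Wsubst = Kreduced ⊞ (EP mS ⊞ OP mO)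

  Wmut : SP n m
  Wmut = EP (λ i j → + B' i j) ⊞ OP (λ a ℓ b → + T' a ℓ b)

  -- The substituted form reduces to Wsubst/Δ: its numerator over R·Δ is R·Wsubst.
  numer-subst : numer substTag ≈ R ⊠ Wsubst
  numer-subst = ≈-trans numer-substTag (≈-trans (+-cong Kpart-factor ≈-refl) (≈-trans (+-cong Kfactored-R ≈-refl) (≈-sym (distribˡ R Kreduced (EP mS ⊞ OP mO)))))

  subst-reduces : omegaSubst Qd k ⊒ (Wsubst / Δ)
  subst-reduces = ⊒-trans subst-reduces₀ (conv-true substTag Wsubst substTag-hasR numer-subst)

  antisym-sum-odd : ∀ (c d : Fin m → Fin n → Fin m → ℤ) → (∀ ℓ a b → c a ℓ b - c b ℓ a ≡ d a ℓ b - d b ℓ a) → OP c ≈ OP d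
  antisym-sum-odd c d h = ≈-trans (Σ-swap (λ a ℓ → ΣS (λ b → scaleSP (c a ℓ b) (Y a ℓ b))))
    (≈-trans (Σ-cong λ ℓ → antisym-sum (λ a b → Y a ℓ b) (Yanti ℓ) (λ a b → c a ℓ b) (λ a b → d a ℓ b) (h ℓ))
      (≈-sym (Σ-swap (λ a ℓ → ΣS (λ b → scaleSP (d a ℓ b) (Y a ℓ b))))))

  -- The numerators agree: their coefficients have equal antisymmetrisations.
  numerators-agree : Wsubst ≈ Wmut
  numerators-agree = ≈-trans (+-cong Kreduced-expand ≈-refl)
    (≈-trans (⊞-shuffle (EP cK) (OP cK') (EP mS) (OP mO))
    (≈-trans (+-cong (≈-trans (+-comm (EP cK) (EP mS)) (EP-+ mS cK)) (≈-trans (+-comm (OP cK') (OP mO)) (OP-+ mO cK')))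
    (+-cong (antisym-sum Z Zanti coeffS (λ i j → + B' i j) mutation-antisym) (antisym-sum-odd coeffSOdd (λ a ℓ b → + T' a ℓ b) mutation-antisym-odd))))

  -- The mutated form is ω of a quiver in the original coordinates; all its
  -- summands reduce over Δ alone.
  module TL = CommonDenominator 𝟙 Δ e1 eΔ kΔ

  mutTag : Fin n → Fin n → TL.Tagged
  mutTag i j = false , Zterm (B' i j) i j
  mutTagOdd : Fin m → Fin n → Fin m → TL.Tagged
  mutTagOdd a ℓ b = false , Yterm (T' a ℓ b) a ℓ b

  mutTags : TL.Tagged
  mutTags = TL._⊕T_ (TL.foldT (λ i → TL.foldT (mutTag i))) (TL.foldT (λ a → TL.foldT (λ ℓ → TL.foldT (mutTagOdd a ℓ))))

  mut-reduces₀ : omega (mutate Qd k) ⊒ TL.⟦ mutTags ⟧T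
  mut-reduces₀ = ⊒-trans (⊒-+ (TL.sum-red _ (λ i → TL.foldT (mutTag i)) (λ i → TL.sum-red _ (mutTag i) (λ j → reduce-plain (B' i j) i j)))
                      (TL.sum-red _ (λ a → TL.foldT (λ ℓ → TL.foldT (mutTagOdd a ℓ))) (λ a → TL.sum-red _ (λ ℓ → TL.foldT (mutTagOdd a ℓ))
                          (λ ℓ → TL.sum-red _ (mutTagOdd a ℓ) (λ b → reduce-odd (T' a ℓ b) a ℓ b)))))
                 (TL.⊕T-red (TL.foldT (λ i → TL.foldT (mutTag i))) (TL.foldT (λ a → TL.foldT (λ ℓ → TL.foldT (mutTagOdd a ℓ)))))

  numer-mut : TL.numer mutTags ≈ Wmut
  numer-mut = ≈-trans (TL.numer-⊕ (TL.foldT (λ i → TL.foldT (mutTag i))) (TL.foldT (λ a → TL.foldT (λ ℓ → TL.foldT (mutTagOdd a ℓ)))))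
       (+-cong (≈-trans (TL.numer-fold (λ i → TL.foldT (mutTag i))) (Σ-cong λ i → ≈-trans (TL.numer-fold (mutTag i)) (Σ-cong λ j → ≈-trans (*-idˡ _) (Zterm-scale (B' i j) i j))))
               (≈-trans (TL.numer-fold (λ a → TL.foldT (λ ℓ → TL.foldT (mutTagOdd a ℓ)))) (Σ-cong λ a → ≈-trans (TL.numer-fold (λ ℓ → TL.foldT (mutTagOdd a ℓ)))
                   (Σ-cong λ ℓ → ≈-trans (TL.numer-fold (mutTagOdd a ℓ)) (Σ-cong λ b → ≈-trans (*-idˡ _) (Yterm-scale (T' a ℓ b) a ℓ b))))))

  mut-reduces : omega (mutate Qd k) ⊒ (Wmut / Δ)
  mut-reduces = ⊒-trans mut-reduces₀ (TL.conv-one mutTags Wmut ≈-refl numer-mut)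


theorem3p2 : ∀ {n m : ℕ} (Q : ExtQuiver n m) (k : Fin n) →
    omega (mutate (ExtQuiver.quiver Q) k) ≈F omegaSubst (ExtQuiver.quiver Q) k
theorem3p2 Q k =
  ⊒-final mut-reduces (⊒-trans subst-reduces (⊒-≋ numerators-agree ≈-refl))
  where
  open Exchange (QData.B (ExtQuiver.quiver Q)) (QData.T (ExtQuiver.quiver Q)) k (ExtQuiver.noLoop Q)
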